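{- Let $n\ge 2$, let $\Psi:\mathcal{NC}_n\to\mathcal{C}_n$ be the bijection defined below, and extend $\Psi$ linearly to a module isomorphism between the free $\mathbb{C}[q,q^{ -1}]$-modules with bases $\mathcal{NC}_n$ and $\mathcal{C}_n$. Then: - for every $1\le i\le 2n-1$, $F_i=\Psi^{ -1}e_i\Psi$; - $\rho=\Psi^{ -1}\sigma\Psi$.
   Context: $\mathcal{NC}_n$ is the set of non-crossing partitions of $[n]$, i.e. set partitions with no $i<j<k<l$ such that $i,k$ lie in one block and $j,l$ lie in a different block. Set $\tau=-(q+q^{ -1})$. Chord diagrams: take $2n$ points on a line at positions $1,\dots,2n$, labelled $1,1',2,2',\dots,n,n'$ (label $k$ at position $2k-1$, label $k'$ at position $2k$). $\mathcal{C}_n$ is the set of non-crossing perfect matchings of these points into $n$ arches, where non-crossing means no two arches $\{a<b\},\{c<d\}$ with $a<c<b<d$. Action of $e_i$ on $C\in\mathcal{C}_n$, for $1\le i\le 2n-1$: if positions $i$ and $i+1$ are matched to each other, then $e_iC=\tau C$. Otherwise, if $i$ is matched to $a$ and $i+1$ to $b$, then $e_iC$ is $C$ with arches $\{i,a\},\{i+1,b\}$ replaced by $\{i,i+1\},\{a,b\}$. Extend linearly. Rotation $\sigma$ on $\mathcal{C}_n$: with $\phi(p)=p+1$ for $p<2n$ and $\phi(2n)=1$, set $\sigma(C)=\{\{\phi(a),\phi(b)\}:\{a,b\}\in C\}$. Bijection $\Psi$: for $\pi\in\mathcal{NC}_n$ and each block $B=\{b_1<\dots<b_p\}$, form the pairs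 $(b_k,b_{k+1})$ for $1\le k\le p-1$ and the pair $(b_p,b_1)$; if $p=1$, this gives the single pair $(b_1,b_1)$. For each such pair $(i,j)$ over all blocks, $\Psi(\pi)$ contains the arch joining the point labelled $i$ to the point labelled $(j-1)'$, where $0'$ means $n'$. Kreweras endomorphism $\rho$ on $\mathcal{NC}_n$: place points on a circle in clockwise order $1',1,2',\dots,n',n$ ($i'$ between $i-1$ and $i$, and $1'$ between $n$ and $1$). Then $i,j$ are in the same block of $\rho(\pi)$ if and only if $i',j'$ lie in the same region of the disk cut out by the polygons of the blocks of $\pi$. Operators $F_i$: $F_1=f_1$, where $f_1\pi=\tau\pi$ if $1,2$ lie in the same block of $\pi$, and otherwise $f_1\pi$ is $\pi$ with the blocks of $1$ and $2$ merged. Then $F_{i+1}=\rho F_i\rho^{ -1}$. All maps are extended linearly. -}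

module Defs where

-- Conventions:
--  * points / labels are 1-indexed natural numbers, exactly as in the paper;
--  * a raw vector  v : Vec ℕ m  stores the value attached to point x (1 ≤ x ≤ m)
--    at index x-1; we read it with  at v x  (which is 0 outside [1,m]).

open import Data.Nat using (ℕ; zero; suc; _+_; _*_; _∸_; _≤_; _<_; _≟_; _≤?_; _<?_; _<ᵇ_; _≡ᵇ_)
open import Data.Bool using (Bool; true; false; if_then_else_; _∧_; _∨_; not)
open import Data.Fin using (Fin; toℕ)
open import Data.Fin.Properties using (all?)
open import Data.Vec using (Vec; []; _∷_; tabulate)
import Data.Vec.Properties as VecP
open import Data.List using (List; []; _∷_; map; concatMap; reverse; foldr; upTo)
open import Data.Bool.ListAction using (any)
open import Data.Maybe using (Maybe; just; nothing; fromMaybe)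
open import Data.Product using (Σ; _×_; _,_; proj₁)
open import Data.Empty using (⊥)
open import Relation.Nullary using (Dec; yes; no; ¬_; ¬?)
open import Relation.Nullary.Decidable using (True; fromWitness; ⌊_⌋; _×-dec_; _→-dec_)
open import Relation.Binary.PropositionalEquality using (_≡_; _≢_)
open import Algebra.Bundles using (CommutativeRing)
open import Level using (Level)

at : ∀ {m} → Vec ℕ m → ℕ → ℕ
at []      _             = 0
at (y ∷ v) zero          = 0
at (y ∷ v) (suc zero)    = y
at (y ∷ v) (suc (suc x)) = at v (suc x)

All[1‥_] : ∀ {p} (m : ℕ) → (ℕ → Set p) → Set p
All[1‥ m ] P = (i : Fin m) → P (suc (toℕ i))

all[1‥_]? : ∀ {p} (m : ℕ) {P : ℕ → Set p} → ((x : ℕ) → Dec (P x)) → Dec (All[1‥ m ] P)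
all[1‥ m ]? P? = all? (λ i → P? (suc (toℕ i)))

[1‥_] : ℕ → List ℕ
[1‥ m ] = map suc (upTo m)

_≟ᵛ_ : ∀ {m} (u v : Vec ℕ m) → Dec (u ≡ v)
_≟ᵛ_ = VecP.≡-dec _≟_

vecsUpTo : (m k : ℕ) → List (Vec ℕ m)
vecsUpTo zero    k = [] ∷ []
vecsUpTo (suc m) k = concatMap (λ x → map (x ∷_) (vecsUpTo m k)) [1‥ k ]

enumerate : ∀ {p} {m : ℕ} {P : Vec ℕ m → Set p} (P? : (v : Vec ℕ m) → Dec (P v)) →
            List (Vec ℕ m) → List (Σ (Vec ℕ m) (λ v → True (P? v)))
enumerate P? []       = []
enumerate {P = P} P? (v ∷ vs) with P? v
... | yes p = (v , fromWitness {a? = P? v} p) ∷ enumerate P? vs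
... | no  _ = enumerate P? vs

-- A set partition of [n] is encoded by  blk : Vec ℕ n,  where  at blk x  is the
-- minimum of the block containing x (the canonical representative).

IsSetPartition : ∀ {n} → Vec ℕ n → Set
IsSetPartition {n} blk =
  All[1‥ n ] λ x → (1 ≤ at blk x) × (at blk x ≤ x) × (at blk (at blk x) ≡ at blk x)

SameBlock : ∀ {n} → Vec ℕ n → ℕ → ℕ → Set
SameBlock blk x y = at blk x ≡ at blk y

IsNonCrossing : ∀ {n} → Vec ℕ n → Set
IsNonCrossing {n} blk =
  All[1‥ n ] λ i → All[1‥ n ] λ j → All[1‥ n ] λ k → All[1‥ n ] λ l →
    i < j → j < k → k < l → SameBlock blk i k → SameBlock blk j l → SameBlock blk i j

IsNC : ∀ {n} → Vec ℕ n → Set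
IsNC blk = IsSetPartition blk × IsNonCrossing blk

isNC? : ∀ {n} (blk : Vec ℕ n) → Dec (IsNC blk)
isNC? {n} blk =
  all[1‥ n ]? (λ x → (1 ≤? at blk x) ×-dec ((at blk x ≤? x) ×-dec (at blk (at blk x) ≟ at blk x)))
  ×-dec
  all[1‥ n ]? (λ i → all[1‥ n ]? λ j → all[1‥ n ]? λ k → all[1‥ n ]? λ l →
    (i <? j) →-dec ((j <? k) →-dec ((k <? l) →-dec
      ((at blk i ≟ at blk k) →-dec ((at blk j ≟ at blk l) →-dec (at blk i ≟ at blk j))))))

NC : ℕ → Set
NC n = Σ (Vec ℕ n) (λ blk → True (isNC? blk))

enumNC : (n : ℕ) → List (NC n)
enumNC n = enumerate isNC? (vecsUpTo n n)

-- Non-crossing perfect matchings of the 2n points 1,…,2n  (label k at 2k-1,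
-- label k' at 2k).  Encoded by the partner map  mt : Vec ℕ (2 * n).

IsMatching : ∀ {m} → Vec ℕ m → Set
IsMatching {m} mt =
  All[1‥ m ] λ p → (1 ≤ at mt p) × (at mt p ≤ m) × (at mt p ≢ p) × (at mt (at mt p) ≡ p)

IsNonCrossingMatching : ∀ {m} → Vec ℕ m → Set
IsNonCrossingMatching {m} mt =
  All[1‥ m ] λ a → All[1‥ m ] λ b → All[1‥ m ] λ c → All[1‥ m ] λ d →
    a < c → c < b → b < d → at mt a ≡ b → ¬ (at mt c ≡ d)

IsCD : ∀ {m} → Vec ℕ m → Set
IsCD mt = IsMatching mt × IsNonCrossingMatching mt

isCD? : ∀ {m} (mt : Vec ℕ m) → Dec (IsCD mt)
isCD? {m} mt =
  all[1‥ m ]? (λ p → (1 ≤? at mt p) ×-dec ((at mt p ≤? m) ×-dec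
                      (¬? (at mt p ≟ p) ×-dec (at mt (at mt p) ≟ p))))
  ×-dec
  all[1‥ m ]? (λ a → all[1‥ m ]? λ b → all[1‥ m ]? λ c → all[1‥ m ]? λ d →
    (a <? c) →-dec ((c <? b) →-dec ((b <? d) →-dec ((at mt a ≟ b) →-dec ¬? (at mt c ≟ d)))))

CD : ℕ → Set
CD n = Σ (Vec ℕ (2 * n)) (λ mt → True (isCD? mt))

enumCD : (n : ℕ) → List (CD n)
enumCD n = enumerate isCD? (vecsUpTo (2 * n) (2 * n))

-- For a block {b₁<…<bₚ}, the pairs (bₖ,bₖ₊₁) and (bₚ,b₁)
-- are exactly the pairs (i , next i) where next i is the cyclic successor of i
-- inside its block.  The pair (i,j) gives the arch from point i (position 2i-1)
-- to point (j-1)' (position 2(j-1), and 0' = n' is position 2n).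
module _ {n : ℕ} (blk : Vec ℕ n) where
  sameᵇ : ℕ → ℕ → Bool
  sameᵇ x y = at blk x ≡ᵇ at blk y

  next : ℕ → ℕ
  next i = fromMaybe (at blk i) (Data.List.findᵇ (λ j → (i <ᵇ j) ∧ sameᵇ i j) [1‥ n ])

  prev : ℕ → ℕ
  prev j = fromMaybe (fromMaybe 0 (Data.List.findᵇ (λ i → sameᵇ i j) (reverse [1‥ n ])))
                     (Data.List.findᵇ (λ i → (i <ᵇ j) ∧ sameᵇ i j) (reverse [1‥ n ]))

  primePos : ℕ → ℕ
  primePos (suc zero) = 2 * n
  primePos j          = 2 * (j ∸ 1)

  ΨpartnerOf : ℕ → ℕ
  ΨpartnerOf p with p Data.Nat.% 2
  ... | suc zero = primePos (next ((p + 1) Data.Nat./ 2))        -- p = 2i-1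
  ... | _        = let j  = p Data.Nat./ 2                             -- p = 2j, label j'
                       j₁ = if j <ᵇ n then j + 1 else 1            -- (j₁-1)' = j'
                   in 2 * prev j₁ ∸ 1

Ψraw : ∀ {n} → Vec ℕ n → Vec ℕ (2 * n)
Ψraw {n} blk = tabulate (λ k → ΨpartnerOf blk (suc (toℕ k)))

-- the action of eᵢ on a raw matching: (is-loop , result)
-- returns true and mt if i,i+1 are matched together (eᵢ C = τ C),
-- otherwise false and the rewired matching.
eRaw : ∀ {m} → ℕ → Vec ℕ m → Bool × Vec ℕ m
eRaw {m} i mt with at mt i ≡ᵇ (i + 1)
... | true  = true , mt
... | false = false , tabulate (λ k → new (suc (toℕ k)))
  where
  a = at mt i
  b = at mt (i + 1)
  new : ℕ → ℕ
  new p = if p ≡ᵇ i then i + 1 else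
          if p ≡ᵇ (i + 1) then i else
          if p ≡ᵇ a then b else
          if p ≡ᵇ b then a else at mt p

-- the rotation σ: φ(p)=p+1 (p<2n), φ(2n)=1; partner'(φ p) = φ(partner p)
σRaw : ∀ {m} → Vec ℕ m → Vec ℕ m
σRaw {m} mt = tabulate (λ k → φ (at mt (φ⁻¹ (suc (toℕ k)))))
  where
  φ : ℕ → ℕ
  φ p = if p <ᵇ m then p + 1 else 1
  φ⁻¹ : ℕ → ℕ
  φ⁻¹ p = if 1 <ᵇ p then p ∸ 1 else m

-- f₁ on a raw partition: (1,2 in same block , result)
f₁Raw : ∀ {n} → Vec ℕ n → Bool × Vec ℕ n
f₁Raw {n} blk with at blk 1 ≡ᵇ at blk 2
... | true  = true , blk
... | false = false , tabulate (λ k → let x = suc (toℕ k) in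
                                   if at blk x ≡ᵇ at blk 2 then at blk 1 else at blk x)

-- Points on the circle clockwise 1',1,2',2,…,n',n.
-- For i<j the chord from i' to j' separates the points {i,…,j-1} from the
-- other points of [n]; since the regions cut out by the (convex) block polygons
-- are convex, i' and j' lie in the same region iff no block of π has elements
-- on both sides of this chord.
module _ {n : ℕ} (blk : Vec ℕ n) where
  separatedᵇ : ℕ → ℕ → Bool
  separatedᵇ i j =
    any (λ a → (i Data.Nat.≤ᵇ a) ∧ (a <ᵇ j) ∧
        any (λ b → ((b <ᵇ i) ∨ (j Data.Nat.≤ᵇ b)) ∧ (at blk a ≡ᵇ at blk b)) [1‥ n ]) [1‥ n ]

  sameRegionᵇ : ℕ → ℕ → Bool
  sameRegionᵇ i j = if i Data.Nat.≤ᵇ j then not (separatedᵇ i j) else not (separatedᵇ j i)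

ρRaw : ∀ {n} → Vec ℕ n → Vec ℕ n
ρRaw {n} blk = tabulate (λ k → let x = suc (toℕ k) in
  fromMaybe 0 (Data.List.findᵇ (λ y → sameRegionᵇ blk y x) [1‥ n ]))

module _ {c ℓ : Level} (R : CommutativeRing c ℓ) where
  open CommutativeRing R using (Carrier; 0#; 1#) renaming (_+_ to _⊕_; _*_ to _⊗_)

  Vect : Set → Set c
  Vect B = B → Carrier

  linExt : ∀ {B B' : Set} → List B → (B → Vect B') → Vect B → Vect B'
  linExt enumB g v b' = foldr _⊕_ 0# (map (λ b → v b ⊗ g b b') enumB)

  monomial : ∀ {m} {P : Vec ℕ m → Set} → Carrier → Vec ℕ m → Vect (Σ (Vec ℕ m) P)
  monomial c t b' = if ⌊ t ≟ᵛ proj₁ b' ⌋ then c else 0#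

  module _ (τ : Carrier) (n : ℕ) where
    Ψ : Vect (NC n) → Vect (CD n)
    Ψ = linExt (enumNC n) (λ π → monomial 1# (Ψraw (proj₁ π)))

    Ψ⁻¹ : Vect (CD n) → Vect (NC n)
    Ψ⁻¹ = linExt (enumCD n) (λ C π → if ⌊ Ψraw (proj₁ π) ≟ᵛ proj₁ C ⌋ then 1# else 0#)

    e : ℕ → Vect (CD n) → Vect (CD n)
    e i = linExt (enumCD n) (λ C → let r = eRaw i (proj₁ C) in
            monomial (if Data.Product.proj₁ r then τ else 1#) (Data.Product.proj₂ r))

    σ : Vect (CD n) → Vect (CD n)
    σ = linExt (enumCD n) (λ C → monomial 1# (σRaw (proj₁ C)))

    ρ : Vect (NC n) → Vect (NC n)
    ρ = linExt (enumNC n) (λ π → monomial 1# (ρRaw (proj₁ π)))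

    ρ⁻¹ : Vect (NC n) → Vect (NC n)
    ρ⁻¹ = linExt (enumNC n) (λ π π' → if ⌊ ρRaw (proj₁ π') ≟ᵛ proj₁ π ⌋ then 1# else 0#)

    f₁ : Vect (NC n) → Vect (NC n)
    f₁ = linExt (enumNC n) (λ π → let r = f₁Raw (proj₁ π) in
            monomial (if Data.Product.proj₁ r then τ else 1#) (Data.Product.proj₂ r))

    -- F₁ = f₁, F_{i+1} = ρ Fᵢ ρ⁻¹   (F 0 is never used)
    F : ℕ → Vect (NC n) → Vect (NC n)
    F zero          = λ v → v
    F (suc zero)    = f₁
    F (suc (suc i)) = λ v → ρ (F (suc i) (ρ⁻¹ v))

-- Ψ joins each label i to (next i − 1)′, where next is the cyclic successor of i in its block.
-- Non-crossingness of π says exactly that the interior of every such arch is a union of arches,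
-- so Ψ(π) is a non-crossing matching; the arches recover next and hence π, so Ψ is injective.
-- In the Kreweras complement the block successor of j is prev j + 1 (cyclically), which is the
-- statement σΨ = Ψρ. Since σ^(2n) = id, also ρ^(2n) = id, and ρ⁻¹ = ρ^(2n−1). Merging the blocks of
-- 1 and 2 rewires exactly the arches at positions 1 and 2, so f₁ corresponds to e₁, and because
-- σ conjugates eᵢ into eᵢ₊₁, induction gives Fᵢ = Ψ⁻¹eᵢΨ. All maps are linear extensions, so
-- it suffices to compare their kernels on basis vectors.

module Submission where

open import Defs
open import Data.Nat using (ℕ; _≤_; _∸_)
import Data.Nat as Nat
open import Data.Product using (_×_; _,_)
open import Algebra.Bundles using (CommutativeRing)
open import Level using (Level)

module Basics where

  open import Data.Nat using (ℕ; zero; suc; _+_; _≤_; _<_; _<ᵇ_; _≡ᵇ_; _≤ᵇ_; z≤n; s≤s; s≤s⁻¹; z<s)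
  open import Data.Nat.Properties
  open import Data.Bool using (Bool; true; false; not; _∧_)
  open import Data.Bool.Properties using (T-≡; ¬-not)
  open import Data.Bool.ListAction using (any)
  open import Data.Fin using (Fin; toℕ; fromℕ<)
  open import Data.Fin.Properties using (toℕ-fromℕ<; toℕ<n)
  open import Data.Vec using (Vec; []; _∷_; tabulate)
  open import Data.List using (List; []; _∷_; map; reverse; applyUpTo; applyDownFrom; findᵇ)
  open import Data.List.Properties using (map-applyUpTo; map-applyDownFrom; reverse-map; reverse-applyUpTo)
  open import Data.Maybe using (just; nothing)
  open import Data.Product using (Σ; _×_; _,_)
  open import Data.Sum using (inj₁; inj₂)
  open import Function using (_∘_; Equivalence)
  open import Relation.Nullary using (¬_; contradiction)
  open import Relation.Binary using (tri<; tri≈; tri>)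
  open import Relation.Binary.PropositionalEquality

  private variable
    m n : ℕ

  ≡ᵇ-true⁻¹ : (m ≡ᵇ n) ≡ true → m ≡ n
  ≡ᵇ-true⁻¹ {m} {n} = ≡ᵇ⇒≡ m n ∘ Equivalence.from T-≡

  ≡ᵇ-true : m ≡ n → (m ≡ᵇ n) ≡ true
  ≡ᵇ-true {m} {n} = Equivalence.to T-≡ ∘ ≡⇒≡ᵇ m n

  ≡ᵇ-false : m ≢ n → (m ≡ᵇ n) ≡ false
  ≡ᵇ-false m≢n = ¬-not (m≢n ∘ ≡ᵇ-true⁻¹)

  <ᵇ-true⁻¹ : (m <ᵇ n) ≡ true → m < n
  <ᵇ-true⁻¹ {m} {n} = <ᵇ⇒< m n ∘ Equivalence.from T-≡

  <ᵇ-true : m < n → (m <ᵇ n) ≡ true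
  <ᵇ-true = Equivalence.to T-≡ ∘ <⇒<ᵇ

  <ᵇ-false : ¬ m < n → (m <ᵇ n) ≡ false
  <ᵇ-false m≮n = ¬-not (m≮n ∘ <ᵇ-true⁻¹)

  ≤ᵇ-true⁻¹ : (m ≤ᵇ n) ≡ true → m ≤ n
  ≤ᵇ-true⁻¹ {m} {n} = ≤ᵇ⇒≤ m n ∘ Equivalence.from T-≡

  ≤ᵇ-true : m ≤ n → (m ≤ᵇ n) ≡ true
  ≤ᵇ-true = Equivalence.to T-≡ ∘ ≤⇒≤ᵇ

  ≤ᵇ-false : ¬ m ≤ n → (m ≤ᵇ n) ≡ false
  ≤ᵇ-false m≰n = ¬-not (m≰n ∘ ≤ᵇ-true⁻¹)

  ≤ᵇ-false⁻¹ : (m ≤ᵇ n) ≡ false → ¬ m ≤ n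
  ≤ᵇ-false⁻¹ eq m≤n with () ← trans (sym eq) (≤ᵇ-true m≤n)

  ∧-true : ∀ {a b} → a ≡ true → b ≡ true → (a ∧ b) ≡ true
  ∧-true refl refl = refl

  ∧-true⁻¹ : ∀ {a b} → (a ∧ b) ≡ true → a ≡ true × b ≡ true
  ∧-true⁻¹ {true} {true} _ = refl , refl

  false≢true : ∀ {b} → b ≡ false → b ≢ true
  false≢true refl ()

  not≡true⇒≡false : ∀ {b} → not b ≡ true → b ≡ false
  not≡true⇒≡false {false} _ = refl

  ascending : ℕ → ℕ → List ℕ
  ascending a zero    = []
  ascending a (suc k) = a ∷ ascending (suc a) k

  applyUpTo-ascending : ∀ (f : ℕ → ℕ) a k → (∀ i → f i ≡ a + i) → applyUpTo f k ≡ ascending a k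
  applyUpTo-ascending f a zero    f≗a+ = refl
  applyUpTo-ascending f a (suc k) f≗a+ =
    cong₂ _∷_ (trans (f≗a+ 0) (+-identityʳ a))
              (applyUpTo-ascending (f ∘ suc) (suc a) k (λ i → trans (f≗a+ (suc i)) (+-suc a i)))

  [1‥n]≡ascending : ∀ n → [1‥ n ] ≡ ascending 1 n
  [1‥n]≡ascending n = trans (map-applyUpTo (λ i → i) suc n) (applyUpTo-ascending suc 1 n (λ _ → refl))

  reverse-[1‥n] : ∀ n → reverse [1‥ n ] ≡ applyDownFrom suc n
  reverse-[1‥n] n = begin
    reverse (map suc (applyUpTo (λ i → i) n)) ≡⟨ reverse-map suc (applyUpTo (λ i → i) n) ⟨
    map suc (reverse (applyUpTo (λ i → i) n)) ≡⟨ cong (map suc) (reverse-applyUpTo (λ i → i) n) ⟩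
    map suc (applyDownFrom (λ i → i) n)       ≡⟨ map-applyDownFrom (λ i → i) suc n ⟩
    applyDownFrom suc n                       ∎
    where open ≡-Reasoning

  module _ (P : ℕ → Bool) where

    findᵇ-ascending-just : ∀ a k y → findᵇ P (ascending a k) ≡ just y →
      a ≤ y × y < a + k × P y ≡ true × (∀ z → a ≤ z → z < y → P z ≡ false)
    findᵇ-ascending-just a (suc k) y eq with P a in Pa
    findᵇ-ascending-just a (suc k) y refl | true =
      ≤-refl , m<m+n a z<s , Pa , λ z a≤z z<a → contradiction a≤z (<⇒≱ z<a)
    ... | false with findᵇ-ascending-just (suc a) k y eq
    ... | a<y , y<a+k , Py , below = <⇒≤ a<y , subst (y <_) (sym (+-suc a k)) y<a+k , Py , below′
      where
      below′ : ∀ z → a ≤ z → z < y → P z ≡ false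
      below′ z a≤z z<y with m≤n⇒m<n∨m≡n a≤z
      ... | inj₁ a<z = below z a<z z<y
      ... | inj₂ refl = Pa

    findᵇ-ascending-nothing : ∀ a k → findᵇ P (ascending a k) ≡ nothing →
      ∀ z → a ≤ z → z < a + k → P z ≡ false
    findᵇ-ascending-nothing a zero eq z a≤z z<a+0 =
      contradiction a≤z (<⇒≱ (subst (z <_) (+-identityʳ a) z<a+0))
    findᵇ-ascending-nothing a (suc k) eq z a≤z z<a+k with P a in Pa
    ... | false with m≤n⇒m<n∨m≡n a≤z
    ...   | inj₂ refl = Pa
    ...   | inj₁ a<z = findᵇ-ascending-nothing (suc a) k eq z a<z (subst (z <_) (+-suc a k) z<a+k)

    findᵇ-ascending-least : ∀ a k y → a ≤ y → y < a + k → P y ≡ true →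
      (∀ z → a ≤ z → z < y → P z ≡ false) → findᵇ P (ascending a k) ≡ just y
    findᵇ-ascending-least a k y a≤y y<a+k Py below with findᵇ P (ascending a k) in eq
    ... | nothing = contradiction Py (false≢true (findᵇ-ascending-nothing a k eq y a≤y y<a+k))
    ... | just y′ with findᵇ-ascending-just a k y′ eq
    ...   | a≤y′ , _ , Py′ , below′ with <-cmp y y′
    ...     | tri≈ _ y≡y′ _ = cong just (sym y≡y′)
    ...     | tri< y<y′ _ _ = contradiction Py (false≢true (below′ y a≤y y<y′))
    ...     | tri> _ _ y′<y = contradiction Py′ (false≢true (below y′ a≤y′ y′<y))

    findᵇ-descending-just : ∀ n y → findᵇ P (applyDownFrom suc n) ≡ just y →
      1 ≤ y × y ≤ n × P y ≡ true × (∀ z → y < z → z ≤ n → P z ≡ false)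
    findᵇ-descending-just (suc n) y eq with P (suc n) in Pn
    findᵇ-descending-just (suc n) y refl | true =
      s≤s z≤n , ≤-refl , Pn , λ z y<z z≤n → contradiction z≤n (<⇒≱ y<z)
    ... | false with findᵇ-descending-just n y eq
    ... | 1≤y , y≤n , Py , above = 1≤y , m≤n⇒m≤1+n y≤n , Py , above′
      where
      above′ : ∀ z → y < z → z ≤ suc n → P z ≡ false
      above′ z y<z z≤1+n with m≤n⇒m<n∨m≡n z≤1+n
      ... | inj₁ z<1+n = above z y<z (s≤s⁻¹ z<1+n)
      ... | inj₂ refl = Pn

    findᵇ-descending-nothing : ∀ n → findᵇ P (applyDownFrom suc n) ≡ nothing →
      ∀ z → 1 ≤ z → z ≤ n → P z ≡ false
    findᵇ-descending-nothing zero eq z 1≤z z≤0 = contradiction z≤0 (<⇒≱ 1≤z)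
    findᵇ-descending-nothing (suc n) eq z 1≤z z≤1+n with P (suc n) in Pn
    ... | false with m≤n⇒m<n∨m≡n z≤1+n
    ...   | inj₂ refl = Pn
    ...   | inj₁ z<1+n = findᵇ-descending-nothing n eq z 1≤z (s≤s⁻¹ z<1+n)

    any-ascending-true : ∀ a k z → a ≤ z → z < a + k → P z ≡ true → any P (ascending a k) ≡ true
    any-ascending-true a zero z a≤z z<a+0 Pz =
      contradiction a≤z (<⇒≱ (subst (z <_) (+-identityʳ a) z<a+0))
    any-ascending-true a (suc k) z a≤z z<a+k Pz with m≤n⇒m<n∨m≡n a≤z
    ... | inj₂ refl rewrite Pz = refl
    ... | inj₁ a<z rewrite any-ascending-true (suc a) k z a<z (subst (z <_) (+-suc a k) z<a+k) Pz
      with P a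
    ...   | true  = refl
    ...   | false = refl

    any-ascending-true⁻¹ : ∀ a k → any P (ascending a k) ≡ true →
      Σ ℕ λ z → a ≤ z × z < a + k × P z ≡ true
    any-ascending-true⁻¹ a (suc k) eq with P a in Pa
    ... | true  = a , ≤-refl , m<m+n a z<s , Pa
    ... | false with any-ascending-true⁻¹ (suc a) k eq
    ...   | z , a<z , z<a+k , Pz = z , <⇒≤ a<z , subst (z <_) (sym (+-suc a k)) z<a+k , Pz

    any-ascending-false : ∀ a k → (∀ z → a ≤ z → z < a + k → P z ≡ false) →
      any P (ascending a k) ≡ false
    any-ascending-false a k none with any P (ascending a k) in eq
    ... | false = refl
    ... | true with any-ascending-true⁻¹ a k eq
    ...   | z , a≤z , z<a+k , Pz = contradiction Pz (false≢true (none z a≤z z<a+k))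

    any-ascending-false⁻¹ : ∀ a k → any P (ascending a k) ≡ false →
      ∀ z → a ≤ z → z < a + k → P z ≡ false
    any-ascending-false⁻¹ a k eq z a≤z z<a+k with P z in Pz
    ... | false = refl
    ... | true  = contradiction (any-ascending-true a k z a≤z z<a+k Pz) (false≢true eq)

  at-tabulate : ∀ (g : ℕ → ℕ) x → 1 ≤ x → x ≤ m →
    at (tabulate {n = m} (λ k → g (suc (toℕ k)))) x ≡ g x
  at-tabulate {suc m} g (suc zero)    _ _         = refl
  at-tabulate {suc m} g (suc (suc x)) _ (s≤s x≤m) = at-tabulate (g ∘ suc) (suc x) (s≤s z≤n) x≤m

  at-extensionality : (u v : Vec ℕ m) → (∀ x → 1 ≤ x → x ≤ m → at u x ≡ at v x) → u ≡ v
  at-extensionality []      []      _     = refl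
  at-extensionality (a ∷ u) (b ∷ v) u≗v =
    cong₂ _∷_ (u≗v 1 (s≤s z≤n) (s≤s z≤n))
              (at-extensionality u v λ { (suc x) _ x≤m → u≗v (suc (suc x)) (s≤s z≤n) (s≤s x≤m) })

  suc-toℕ-onto : ∀ x → 1 ≤ x → x ≤ m → Σ (Fin m) λ i → suc (toℕ i) ≡ x
  suc-toℕ-onto (suc x) _ x<m = fromℕ< x<m , cong suc (toℕ-fromℕ< x<m)

  All[1‥]⇒∀ : ∀ {p} {P : ℕ → Set p} → All[1‥ m ] P → ∀ x → 1 ≤ x → x ≤ m → P x
  All[1‥]⇒∀ all x 1≤x x≤m with suc-toℕ-onto x 1≤x x≤m
  ... | i , refl = all i

  ∀⇒All[1‥] : ∀ {p} {P : ℕ → Set p} → (∀ x → 1 ≤ x → x ≤ m → P x) → All[1‥ m ] P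
  ∀⇒All[1‥] all i = all (suc (toℕ i)) (s≤s z≤n) (toℕ<n i)

module Partitions where

  open import Data.Nat using (ℕ; suc; _≤_; _<_; _≟_; _<ᵇ_; _≡ᵇ_; z≤n; s≤s; s≤s⁻¹)
  open import Data.Nat.Induction using (<-rec)
  open import Data.Nat.Properties
  open import Data.Bool using (_∧_)
  open import Data.Vec using (Vec)
  open import Data.Fin.Properties using (toℕ<n)
  open import Data.List using (findᵇ; applyDownFrom)
  open import Data.Maybe using (just; nothing; fromMaybe)
  open import Data.Product using (_×_; _,_; proj₁; proj₂)
  open import Data.Sum using (inj₁; inj₂)
  open import Relation.Nullary using (yes; no; contradiction)
  open import Relation.Nullary.Decidable using (True; toWitness; fromWitness)
  open import Relation.Binary using (tri<; tri≈; tri>)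
  open import Relation.Binary.PropositionalEquality
  open Basics

  IsSetPartitionℕ : ∀ {n} → Vec ℕ n → Set
  IsSetPartitionℕ {n} blk = ∀ x → 1 ≤ x → x ≤ n →
    1 ≤ at blk x × at blk x ≤ x × at blk (at blk x) ≡ at blk x

  IsNonCrossingℕ : ∀ {n} → Vec ℕ n → Set
  IsNonCrossingℕ {n} blk = ∀ i j k l → 1 ≤ i → l ≤ n → i < j → j < k → k < l →
    at blk i ≡ at blk k → at blk j ≡ at blk l → at blk i ≡ at blk j

  module _ {n} (blk : Vec ℕ n) where

    isNC⇒ℕ : True (isNC? blk) → IsSetPartitionℕ blk × IsNonCrossingℕ blk
    isNC⇒ℕ t with toWitness t
    ... | part , nc = All[1‥]⇒∀ part , nonCrossing
      where
      nonCrossing : IsNonCrossingℕ blk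
      nonCrossing i j k l 1≤i l≤n i<j j<k k<l
        with suc-toℕ-onto i 1≤i i≤n | suc-toℕ-onto j 1≤j j≤n | suc-toℕ-onto k 1≤k k≤n | suc-toℕ-onto l 1≤l l≤n
        where
        1≤j = ≤-trans 1≤i (<⇒≤ i<j)
        1≤k = ≤-trans 1≤j (<⇒≤ j<k)
        1≤l = ≤-trans 1≤k (<⇒≤ k<l)
        k≤n = ≤-trans (<⇒≤ k<l) l≤n
        j≤n = ≤-trans (<⇒≤ j<k) k≤n
        i≤n = ≤-trans (<⇒≤ i<j) j≤n
      ... | i′ , refl | j′ , refl | k′ , refl | l′ , refl = nc i′ j′ k′ l′ i<j j<k k<l

    ℕ⇒isNC : IsSetPartitionℕ blk → IsNonCrossingℕ blk → True (isNC? blk)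
    ℕ⇒isNC part nc = fromWitness (∀⇒All[1‥] part ,
      λ i j k l i<j j<k k<l → nc _ _ _ _ (s≤s z≤n) (toℕ<n l) i<j j<k k<l)

  module BlockStructure {n : ℕ} (blk : Vec ℕ n) (part : IsSetPartitionℕ blk) where

    rep : ℕ → ℕ
    rep = at blk

    rep≥1 : ∀ x → 1 ≤ x → x ≤ n → 1 ≤ rep x
    rep≥1 x 1≤x x≤n = proj₁ (part x 1≤x x≤n)

    rep≤ : ∀ x → 1 ≤ x → x ≤ n → rep x ≤ x
    rep≤ x 1≤x x≤n = proj₁ (proj₂ (part x 1≤x x≤n))

    rep-idem : ∀ x → 1 ≤ x → x ≤ n → rep (rep x) ≡ rep x
    rep-idem x 1≤x x≤n = proj₂ (proj₂ (part x 1≤x x≤n))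

    rep≤n : ∀ x → 1 ≤ x → x ≤ n → rep x ≤ n
    rep≤n x 1≤x x≤n = ≤-trans (rep≤ x 1≤x x≤n) x≤n

    rep1≡1 : 1 ≤ n → rep 1 ≡ 1
    rep1≡1 1≤n = ≤-antisym (rep≤ 1 ≤-refl 1≤n) (rep≥1 1 ≤-refl 1≤n)

    rep≡self : ∀ j → 1 ≤ j → j ≤ n → (∀ z → 1 ≤ z → z < j → rep z ≢ rep j) → rep j ≡ j
    rep≡self j 1≤j j≤n first with m≤n⇒m<n∨m≡n (rep≤ j 1≤j j≤n)
    ... | inj₂ rep≡j = rep≡j
    ... | inj₁ rep<j = contradiction (rep-idem j 1≤j j≤n) (first (rep j) (rep≥1 j 1≤j j≤n) rep<j)

    data NextView (i : ℕ) : Set where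
      next-later : ∀ j → i < j → j ≤ n → rep i ≡ rep j → (∀ z → i < z → z < j → rep i ≢ rep z) →
                   next blk i ≡ j → NextView i
      next-wraps : (∀ z → i < z → z ≤ n → rep i ≢ rep z) → next blk i ≡ rep i → NextView i

    nextView : ∀ i → NextView i
    nextView i with findᵇ (λ j → (i <ᵇ j) ∧ (rep i ≡ᵇ rep j)) (ascending 1 n) in eq
    ... | just j = next-later j (<ᵇ-true⁻¹ i<ᵇj) (s≤s⁻¹ j<1+n) (≡ᵇ-true⁻¹ same) none-between unfold
      where
      found = findᵇ-ascending-just _ 1 n j eq
      i<ᵇj = proj₁ (∧-true⁻¹ (proj₁ (proj₂ (proj₂ found))))
      same = proj₂ (∧-true⁻¹ (proj₁ (proj₂ (proj₂ found))))
      j<1+n = proj₁ (proj₂ found)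
      none-between : ∀ z → i < z → z < j → rep i ≢ rep z
      none-between z i<z z<j rep≡ = false≢true (proj₂ (proj₂ (proj₂ found)) z (≤-trans (s≤s z≤n) i<z) z<j)
                                      (∧-true (<ᵇ-true i<z) (≡ᵇ-true rep≡))
      unfold : next blk i ≡ j
      unfold = cong (fromMaybe (rep i)) (trans (cong (findᵇ _) ([1‥n]≡ascending n)) eq)
    ... | nothing = next-wraps none-after (cong (fromMaybe (rep i)) (trans (cong (findᵇ _) ([1‥n]≡ascending n)) eq))
      where
      none-after : ∀ z → i < z → z ≤ n → rep i ≢ rep z
      none-after z i<z z≤n′ rep≡ = false≢true (findᵇ-ascending-nothing _ 1 n eq z (≤-trans (s≤s z≤n) i<z) (s≤s z≤n′))
                                    (∧-true (<ᵇ-true i<z) (≡ᵇ-true rep≡))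

    data PrevView (j : ℕ) : Set where
      prev-earlier : ∀ h → h < j → 1 ≤ h → rep h ≡ rep j → (∀ z → h < z → z < j → rep z ≢ rep j) →
                     prev blk j ≡ h → PrevView j
      prev-wraps : (∀ z → 1 ≤ z → z < j → rep z ≢ rep j) →
                   ∀ M → j ≤ M → M ≤ n → rep M ≡ rep j → (∀ z → M < z → z ≤ n → rep z ≢ rep j) →
                   prev blk j ≡ M → PrevView j

    prevView : ∀ j → 1 ≤ j → j ≤ n → PrevView j
    prevView j 1≤j j≤n with findᵇ (λ h → (h <ᵇ j) ∧ (rep h ≡ᵇ rep j)) (applyDownFrom suc n) in eq₁
    ... | just h = prev-earlier h (<ᵇ-true⁻¹ h<ᵇj) 1≤h (≡ᵇ-true⁻¹ same) none-between
                     (trans unfold (cong (fromMaybe _) eq₁))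
      where
      found = findᵇ-descending-just _ n h eq₁
      1≤h = proj₁ found
      h<ᵇj = proj₁ (∧-true⁻¹ (proj₁ (proj₂ (proj₂ found))))
      same = proj₂ (∧-true⁻¹ (proj₁ (proj₂ (proj₂ found))))
      none-between : ∀ z → h < z → z < j → rep z ≢ rep j
      none-between z h<z z<j rep≡ = false≢true (proj₂ (proj₂ (proj₂ found)) z h<z (≤-trans (<⇒≤ z<j) j≤n))
                                      (∧-true (<ᵇ-true z<j) (≡ᵇ-true rep≡))
      unfold = cong (λ l → fromMaybe (fromMaybe 0 (findᵇ (λ h → rep h ≡ᵇ rep j) l))
                                     (findᵇ (λ h → (h <ᵇ j) ∧ (rep h ≡ᵇ rep j)) l)) (reverse-[1‥n] n)
    ... | nothing with findᵇ (λ h → rep h ≡ᵇ rep j) (applyDownFrom suc n) in eq₂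
    ...   | nothing = contradiction (≡ᵇ-true {rep j} refl) (false≢true (findᵇ-descending-nothing _ n eq₂ j 1≤j j≤n))
    ...   | just M = prev-wraps none-before M j≤M M≤n (≡ᵇ-true⁻¹ same) none-after
                       (trans unfold (trans (cong (fromMaybe _) eq₁) (cong (fromMaybe 0) eq₂)))
      where
      found = findᵇ-descending-just _ n M eq₂
      M≤n = proj₁ (proj₂ found)
      same = proj₁ (proj₂ (proj₂ found))
      none-before : ∀ z → 1 ≤ z → z < j → rep z ≢ rep j
      none-before z 1≤z z<j rep≡ = false≢true (findᵇ-descending-nothing _ n eq₁ z 1≤z (≤-trans (<⇒≤ z<j) j≤n))
                                     (∧-true (<ᵇ-true z<j) (≡ᵇ-true rep≡))
      none-after : ∀ z → M < z → z ≤ n → rep z ≢ rep j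
      none-after z M<z z≤n′ rep≡ = false≢true (proj₂ (proj₂ (proj₂ found)) z M<z z≤n′) (≡ᵇ-true rep≡)
      j≤M : j ≤ M
      j≤M with ≤-<-connex j M
      ... | inj₁ j≤M = j≤M
      ... | inj₂ M<j = contradiction (≡ᵇ-true {rep j} refl) (false≢true (proj₂ (proj₂ (proj₂ found)) j M<j j≤n))
      unfold = cong (λ l → fromMaybe (fromMaybe 0 (findᵇ (λ h → rep h ≡ᵇ rep j) l))
                                     (findᵇ (λ h → (h <ᵇ j) ∧ (rep h ≡ᵇ rep j)) l)) (reverse-[1‥n] n)

    next-inBlock : ∀ i → 1 ≤ i → i ≤ n → 1 ≤ next blk i × next blk i ≤ n × rep (next blk i) ≡ rep i
    next-inBlock i 1≤i i≤n with nextView i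
    ... | next-later j i<j j≤n same _ eq rewrite eq = ≤-trans 1≤i (<⇒≤ i<j) , j≤n , sym same
    ... | next-wraps _ eq rewrite eq = rep≥1 i 1≤i i≤n , rep≤n i 1≤i i≤n , rep-idem i 1≤i i≤n

    prev-inBlock : ∀ j → 1 ≤ j → j ≤ n → 1 ≤ prev blk j × prev blk j ≤ n × rep (prev blk j) ≡ rep j
    prev-inBlock j 1≤j j≤n with prevView j 1≤j j≤n
    ... | prev-earlier h h<j 1≤h same _ eq rewrite eq = 1≤h , ≤-trans (<⇒≤ h<j) j≤n , same
    ... | prev-wraps _ M j≤M M≤n same _ eq rewrite eq = ≤-trans 1≤j j≤M , M≤n , same

    next-later-is : ∀ i j → i < j → j ≤ n → rep i ≡ rep j → (∀ z → i < z → z < j → rep i ≢ rep z) →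
                    next blk i ≡ j
    next-later-is i j i<j j≤n same none-between with nextView i
    ... | next-wraps none-after _ = contradiction same (none-after j i<j j≤n)
    ... | next-later j′ i<j′ _ same′ none-between′ eq with <-cmp j j′
    ...   | tri≈ _ j≡j′ _ = trans eq (sym j≡j′)
    ...   | tri< j<j′ _ _ = contradiction same (none-between′ j i<j j<j′)
    ...   | tri> _ _ j′<j = contradiction same′ (none-between j′ i<j′ j′<j)

    next-wraps-is : ∀ i → (∀ z → i < z → z ≤ n → rep i ≢ rep z) → next blk i ≡ rep i
    next-wraps-is i none-after with nextView i
    ... | next-wraps _ eq = eq
    ... | next-later j i<j j≤n same _ _ = contradiction same (none-after j i<j j≤n)

    prev-next : ∀ i → 1 ≤ i → i ≤ n → prev blk (next blk i) ≡ i
    prev-next i 1≤i i≤n with nextView i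
    ... | next-later j i<j j≤n same none-between eq rewrite eq with prevView j (≤-trans 1≤i (<⇒≤ i<j)) j≤n
    ...   | prev-wraps none-before _ _ _ _ _ _ = contradiction same (none-before i 1≤i i<j)
    ...   | prev-earlier h h<j _ same′ none-between′ eq′ rewrite eq′ with <-cmp i h
    ...     | tri≈ _ i≡h _ = sym i≡h
    ...     | tri< i<h _ _ = contradiction (trans same (sym same′)) (none-between h i<h h<j)
    ...     | tri> _ _ h<i = contradiction same (none-between′ i h<i i<j)
    prev-next i 1≤i i≤n | next-wraps none-after eq rewrite eq with prevView (rep i) (rep≥1 i 1≤i i≤n) (rep≤n i 1≤i i≤n)
    ...   | prev-earlier h h<r 1≤h same _ _ =
            contradiction (trans same (rep-idem i 1≤i i≤n))
              (λ rep≡ → <-irrefl rep≡ (≤-<-trans (rep≤ h 1≤h (≤-trans (<⇒≤ h<r) (rep≤n i 1≤i i≤n))) h<r))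
    ...   | prev-wraps _ M _ M≤n same none-after′ eq′ rewrite eq′ with <-cmp i M
    ...     | tri≈ _ i≡M _ = sym i≡M
    ...     | tri< i<M _ _ = contradiction (sym (trans same (rep-idem i 1≤i i≤n))) (none-after M i<M M≤n)
    ...     | tri> _ _ M<i = contradiction (sym (rep-idem i 1≤i i≤n)) (none-after′ i M<i i≤n)

    next-prev : ∀ j → 1 ≤ j → j ≤ n → next blk (prev blk j) ≡ j
    next-prev j 1≤j j≤n with prevView j 1≤j j≤n
    ... | prev-earlier h h<j _ same none-between eq rewrite eq with nextView h
    ...   | next-wraps none-after _ = contradiction same (none-after j h<j j≤n)
    ...   | next-later j′ h<j′ _ same′ none-between′ eq′ rewrite eq′ with <-cmp j j′
    ...     | tri≈ _ j≡j′ _ = sym j≡j′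
    ...     | tri< j<j′ _ _ = contradiction same (none-between′ j h<j j<j′)
    ...     | tri> _ _ j′<j = contradiction (trans (sym same′) same) (none-between j′ h<j′ j′<j)
    next-prev j 1≤j j≤n | prev-wraps none-before M _ _ same none-after eq rewrite eq with nextView M
    ...   | next-later j′ M<j′ j′≤n same′ _ _ = contradiction (trans (sym same′) same) (none-after j′ M<j′ j′≤n)
    ...   | next-wraps _ eq′ rewrite eq′ = trans same (rep≡self j 1≤j j≤n none-before)

    next≢blockMin : ∀ x → x ≤ n → rep x ≡ x → ∀ i → 1 ≤ i → i < x → next blk i ≢ x
    next≢blockMin x x≤n rep≡x i 1≤i i<x next≡x = <-irrefl refl (≤-<-trans rep≤i i<x)
      where
      i≤n = ≤-trans (<⇒≤ i<x) x≤n
      rep≤i : x ≤ i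
      rep≤i = subst (_≤ i) (trans (sym (proj₂ (proj₂ (next-inBlock i 1≤i i≤n)))) (trans (cong rep next≡x) rep≡x))
                    (rep≤ i 1≤i i≤n)

    prev<nonMin : ∀ x → 1 ≤ x → x ≤ n → rep x ≢ x → prev blk x < x
    prev<nonMin x 1≤x x≤n rep≢x with prevView x 1≤x x≤n
    ... | prev-earlier h h<x _ _ _ eq rewrite eq = h<x
    ... | prev-wraps none-before _ _ _ _ _ _ = contradiction (rep≡self x 1≤x x≤n none-before) rep≢x

  next-determines-partition : ∀ {n} (b b′ : Vec ℕ n) → IsSetPartitionℕ b → IsSetPartitionℕ b′ →
    (∀ i → 1 ≤ i → i ≤ n → next b i ≡ next b′ i) → b ≡ b′
  next-determines-partition {n} b b′ part part′ next≡ = at-extensionality b b′ (<-rec _ rep-agree)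
    where
    module B = BlockStructure b part
    module B′ = BlockStructure b′ part′

    rep-agree : ∀ x → (∀ {y} → y < x → 1 ≤ y → y ≤ n → at b y ≡ at b′ y) → 1 ≤ x → x ≤ n → at b x ≡ at b′ x
    rep-agree x earlier 1≤x x≤n with at b x ≟ x | at b′ x ≟ x
    ... | yes min | yes min′ = trans min (sym min′)
    ... | yes min | no ¬min′ = contradiction (trans (next≡ h 1≤h h≤n) (B′.next-prev x 1≤x x≤n))
                                             (B.next≢blockMin x x≤n min h 1≤h h<x)
      where
      h = prev b′ x
      h<x = B′.prev<nonMin x 1≤x x≤n ¬min′
      1≤h = proj₁ (B′.prev-inBlock x 1≤x x≤n)
      h≤n = ≤-trans (<⇒≤ h<x) x≤n
    ... | no ¬min | _ = begin
      at b x              ≡⟨ cong (at b) (B.next-prev x 1≤x x≤n) ⟨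
      at b (next b h)     ≡⟨ proj₂ (proj₂ (B.next-inBlock h 1≤h h≤n)) ⟩
      at b h              ≡⟨ earlier h<x 1≤h h≤n ⟩
      at b′ h             ≡⟨ proj₂ (proj₂ (B′.next-inBlock h 1≤h h≤n)) ⟨
      at b′ (next b′ h)   ≡⟨ cong (at b′) (next≡ h 1≤h h≤n) ⟨
      at b′ (next b h)    ≡⟨ cong (at b′) (B.next-prev x 1≤x x≤n) ⟩
      at b′ x             ∎
      where
      open ≡-Reasoning
      h = prev b x
      h<x = B.prev<nonMin x 1≤x x≤n ¬min
      1≤h = proj₁ (B.prev-inBlock x 1≤x x≤n)
      h≤n = ≤-trans (<⇒≤ h<x) x≤n

module Arches where

  open import Data.Nat using (ℕ; zero; suc; _+_; _*_; _∸_; _≤_; _<_; _≟_; _<ᵇ_; z≤n; s≤s; s≤s⁻¹; s<s⁻¹; _%_; _/_)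
  open import Data.Nat.Properties
  open import Data.Nat.DivMod using ([m+kn]%n≡m%n; m*n/n≡m)
  open import Data.Bool using (if_then_else_)
  open import Data.Vec using (Vec)
  open import Data.Fin using (toℕ)
  open import Data.Fin.Properties using (toℕ<n)
  open import Data.Product using (Σ; _×_; _,_; proj₁; proj₂)
  open import Data.Sum using (_⊎_; inj₁; inj₂)
  open import Data.Empty using (⊥)
  open import Relation.Nullary using (¬_; yes; no; contradiction)
  open import Function using (_∘_)
  open import Relation.Binary using (tri<; tri≈; tri>)
  open import Relation.Binary.PropositionalEquality
  open Basics
  open Partitions

  private variable
    a b c : ℕ

  odd<odd : a < b → suc (2 * a) < suc (2 * b)
  odd<odd a<b = s≤s (*-monoʳ-< 2 a<b)

  odd<odd⁻¹ : suc (2 * a) < suc (2 * b) → a < b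
  odd<odd⁻¹ {a} {b} lt = *-cancelˡ-< 2 a b (s<s⁻¹ lt)

  odd<even : a < b → suc (2 * a) < 2 * b
  odd<even {a} a<b = ≤-trans (≤-reflexive (sym (*-suc 2 a))) (*-monoʳ-≤ 2 a<b)

  odd<even⁻¹ : suc (2 * a) < 2 * b → a < b
  odd<even⁻¹ {a} {b} lt with <-≤-connex a b
  ... | inj₁ a<b = a<b
  ... | inj₂ b≤a = contradiction lt (<-asym (s≤s (*-monoʳ-≤ 2 b≤a)))

  even<odd : b ≤ a → 2 * b < suc (2 * a)
  even<odd b≤a = s≤s (*-monoʳ-≤ 2 b≤a)

  even<odd⁻¹ : 2 * b < suc (2 * a) → b ≤ a
  even<odd⁻¹ {b} {a} lt with <-≤-connex a b
  ... | inj₂ b≤a = b≤a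
  ... | inj₁ a<b = contradiction lt (<-asym (odd<even a<b))

  even<even : a < b → 2 * a < 2 * b
  even<even a<b = *-monoʳ-< 2 a<b

  even<even⁻¹ : 2 * a < 2 * b → a < b
  even<even⁻¹ {a} {b} = *-cancelˡ-< 2 a b

  odd≢even : ∀ a b → suc (2 * a) ≢ 2 * b
  odd≢even a b eq with <-cmp a b
  ... | tri< a<b _ _ = <-irrefl eq (odd<even a<b)
  ... | tri≈ _ refl _ = <-irrefl (sym eq) (n<1+n (2 * a))
  ... | tri> _ _ b<a = <-irrefl (sym eq) (even<odd (<⇒≤ b<a))

  pos : ℕ → ℕ
  pos i = 2 * i ∸ 1

  pos-suc : ∀ a → pos (suc a) ≡ suc (2 * a)
  pos-suc a = cong (_∸ 1) (*-suc 2 a)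

  pos-bounds : ∀ {n} i → 1 ≤ i → i ≤ n → 1 ≤ pos i × pos i ≤ 2 * n
  pos-bounds (suc a) _ a<n rewrite pos-suc a = s≤s z≤n , <⇒≤ (odd<even a<n)

  pos-injective : ∀ i j → 1 ≤ i → 1 ≤ j → pos i ≡ pos j → i ≡ j
  pos-injective (suc a) (suc b) _ _ eq =
    cong suc (*-cancelˡ-≡ a b 2 (suc-injective (trans (sym (pos-suc a)) (trans eq (pos-suc b)))))

  pos≢even : ∀ i c → 1 ≤ i → pos i ≢ 2 * c
  pos≢even (suc a) c _ eq = odd≢even a c (trans (sym (pos-suc a)) eq)

  pos+1 : ∀ i → 1 ≤ i → pos i + 1 ≡ 2 * i
  pos+1 (suc a) _ = trans (cong (_+ 1) (pos-suc a)) (trans (+-comm (suc (2 * a)) 1) (sym (*-suc 2 a)))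

  pos-bounded : ∀ n i → 1 ≤ i → pos i ≤ 2 * n → i ≤ n
  pos-bounded n (suc a) _ bound with ≤-<-connex (suc a) n
  ... | inj₁ i≤n = i≤n
  ... | inj₂ (s≤s n≤a) = contradiction (subst (_≤ 2 * n) (pos-suc a) bound) (<⇒≱ (even<odd n≤a))

  pos⊎even : ∀ p → 1 ≤ p → (Σ ℕ λ i → 1 ≤ i × p ≡ pos i) ⊎ (Σ ℕ λ j → 1 ≤ j × p ≡ 2 * j)
  pos⊎even (suc zero) _ = inj₁ (1 , s≤s z≤n , refl)
  pos⊎even (suc (suc p)) _ with pos⊎even (suc p) (s≤s z≤n)
  ... | inj₁ (i , 1≤i , eq) = inj₂ (i , 1≤i , trans (cong suc eq) (trans (+-comm 1 (pos i)) (pos+1 i 1≤i)))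
  ... | inj₂ (j , 1≤j , eq) = inj₁ (suc j , s≤s z≤n , trans (cong suc eq) (sym (pos-suc j)))

  pos%2 : ∀ i → 1 ≤ i → pos i % 2 ≡ 1
  pos%2 (suc a) _ = trans (cong (_% 2) (trans (pos-suc a) (cong suc (*-comm 2 a)))) ([m+kn]%n≡m%n 1 a 2)

  [pos+1]/2 : ∀ i → 1 ≤ i → (pos i + 1) / 2 ≡ i
  [pos+1]/2 i 1≤i = trans (cong (_/ 2) (trans (pos+1 i 1≤i) (*-comm 2 i))) (m*n/n≡m i 2)

  even%2 : ∀ j → (2 * j) % 2 ≡ 0
  even%2 j = trans (cong (_% 2) (*-comm 2 j)) ([m+kn]%n≡m%n 0 j 2)

  even/2 : ∀ j → (2 * j) / 2 ≡ j
  even/2 j = trans (cong (_/ 2) (*-comm 2 j)) (m*n/n≡m j 2)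

  cyclicSuc : ℕ → ℕ → ℕ
  cyclicSuc n j = if j <ᵇ n then j + 1 else 1

  cyclicSuc-last : ∀ n → cyclicSuc n n ≡ 1
  cyclicSuc-last n rewrite <ᵇ-false (<-irrefl (refl {x = n})) = refl

  cyclicSuc-< : ∀ n j → j < n → cyclicSuc n j ≡ suc j
  cyclicSuc-< n j j<n rewrite <ᵇ-true j<n = +-comm j 1

  cyclicSuc-bounds : ∀ n j → 1 ≤ j → j ≤ n → 1 ≤ cyclicSuc n j × cyclicSuc n j ≤ n
  cyclicSuc-bounds n j 1≤j j≤n with m≤n⇒m<n∨m≡n j≤n
  ... | inj₁ j<n rewrite cyclicSuc-< n j j<n = s≤s z≤n , j<n
  ... | inj₂ refl rewrite cyclicSuc-last j = ≤-refl , 1≤j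

  module _ {n : ℕ} (blk : Vec ℕ n) where

    primePos-shape : ∀ x → 1 ≤ x → x ≤ n →
      (x ≡ 1 × primePos blk x ≡ 2 * n) ⊎ (Σ ℕ λ c → x ≡ suc c × 1 ≤ c × c < n × primePos blk x ≡ 2 * c)
    primePos-shape (suc zero)    _ _   = inj₁ (refl , refl)
    primePos-shape (suc (suc c)) _ x≤n = inj₂ (suc c , refl , s≤s z≤n , x≤n , refl)

    primePos-even : ∀ x → 1 ≤ x → x ≤ n → Σ ℕ λ c → 1 ≤ c × primePos blk x ≡ 2 * c
    primePos-even x 1≤x x≤n with primePos-shape x 1≤x x≤n
    ... | inj₁ (refl , eq) = n , x≤n , eq
    ... | inj₂ (c , _ , 1≤c , _ , eq) = c , 1≤c , eq

    primePos-cyclicSuc : ∀ j → 1 ≤ j → j ≤ n → primePos blk (cyclicSuc n j) ≡ 2 * j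
    primePos-cyclicSuc (suc c) _ j≤n with m≤n⇒m<n∨m≡n j≤n
    ... | inj₁ j<n rewrite cyclicSuc-< n (suc c) j<n = refl
    ... | inj₂ refl rewrite cyclicSuc-last (suc c) = refl

    partner-pos : ∀ i → 1 ≤ i → ΨpartnerOf blk (pos i) ≡ primePos blk (next blk i)
    partner-pos i 1≤i = trans (odd-case (pos i) (pos%2 i 1≤i)) (cong (primePos blk ∘ next blk) ([pos+1]/2 i 1≤i))
      where
      odd-case : ∀ p → p % 2 ≡ 1 → ΨpartnerOf blk p ≡ primePos blk (next blk ((p + 1) / 2))
      odd-case p eq with p % 2
      odd-case p refl | .1 = refl

    partner-even : ∀ j → ΨpartnerOf blk (2 * j) ≡ pos (prev blk (cyclicSuc n j))
    partner-even j = trans (even-case (2 * j) (even%2 j)) (cong (λ z → pos (prev blk (cyclicSuc n z))) (even/2 j))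
      where
      even-case : ∀ p → p % 2 ≡ 0 → ΨpartnerOf blk p ≡ pos (prev blk (cyclicSuc n (p / 2)))
      even-case p eq with p % 2
      even-case p refl | .0 = refl

    at-Ψraw : ∀ p → 1 ≤ p → p ≤ 2 * n → at (Ψraw blk) p ≡ ΨpartnerOf blk p
    at-Ψraw = at-tabulate (ΨpartnerOf blk)

  primePos-injective : ∀ {n} (blk blk′ : Vec ℕ n) x y → 1 ≤ x → x ≤ n → 1 ≤ y → y ≤ n →
    primePos blk x ≡ primePos blk′ y → x ≡ y
  primePos-injective blk blk′ (suc zero)    (suc zero)    _ _   _ _   _  = refl
  primePos-injective blk blk′ (suc zero)    (suc (suc y)) _ _   _ y<n eq = contradiction (*-monoʳ-< 2 y<n) (<-irrefl (sym eq))
  primePos-injective blk blk′ (suc (suc x)) (suc zero)    _ x<n _ _   eq = contradiction (*-monoʳ-< 2 x<n) (<-irrefl eq)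
  primePos-injective blk blk′ (suc (suc x)) (suc (suc y)) _ _   _ _   eq = cong suc (*-cancelˡ-≡ (suc x) (suc y) 2 eq)

  Between : ℕ → ℕ → ℕ → Set
  Between p q x = (p < x × x < q) ⊎ (q < x × x < p)

  Between-subst : ∀ {p p′ q q′ x x′} → p ≡ p′ → q ≡ q′ → x ≡ x′ → Between p q x → Between p′ q′ x′
  Between-subst refl refl refl btw = btw

  between-up-odd : a < b → Between (suc (2 * a)) (2 * b) (suc (2 * c)) → a < c × c < b
  between-up-odd a<b (inj₁ (lo , hi)) = odd<odd⁻¹ lo , odd<even⁻¹ hi
  between-up-odd a<b (inj₂ (lo , hi)) = contradiction (odd<even a<b) (<-asym (<-trans lo hi))

  between-up-odd⁻¹ : a < c → c < b → Between (suc (2 * a)) (2 * b) (suc (2 * c))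
  between-up-odd⁻¹ a<c c<b = inj₁ (odd<odd a<c , odd<even c<b)

  between-up-even : a < b → Between (suc (2 * a)) (2 * b) (2 * c) → a < c × c < b
  between-up-even a<b (inj₁ (lo , hi)) = odd<even⁻¹ lo , even<even⁻¹ hi
  between-up-even a<b (inj₂ (lo , hi)) = contradiction (odd<even a<b) (<-asym (<-trans lo hi))

  between-up-even⁻¹ : a < c → c < b → Between (suc (2 * a)) (2 * b) (2 * c)
  between-up-even⁻¹ a<c c<b = inj₁ (odd<even a<c , even<even c<b)

  between-down-odd : b ≤ a → Between (suc (2 * a)) (2 * b) (suc (2 * c)) → b ≤ c × c < a
  between-down-odd b≤a (inj₂ (lo , hi)) = even<odd⁻¹ lo , odd<odd⁻¹ hi
  between-down-odd b≤a (inj₁ (lo , hi)) = contradiction (even<odd b≤a) (<-asym (<-trans lo hi))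

  between-down-odd⁻¹ : b ≤ c → c < a → Between (suc (2 * a)) (2 * b) (suc (2 * c))
  between-down-odd⁻¹ b≤c c<a = inj₂ (even<odd b≤c , odd<odd c<a)

  between-down-even : b ≤ a → Between (suc (2 * a)) (2 * b) (2 * c) → b < c × c ≤ a
  between-down-even b≤a (inj₂ (lo , hi)) = even<even⁻¹ lo , even<odd⁻¹ hi
  between-down-even b≤a (inj₁ (lo , hi)) = contradiction (even<odd b≤a) (<-asym (<-trans lo hi))

  between-down-even⁻¹ : b < c → c ≤ a → Between (suc (2 * a)) (2 * b) (2 * c)
  between-down-even⁻¹ b<c c≤a = inj₂ (even<even b<c , even<odd c≤a)

  module ArchStructure {n : ℕ} (blk : Vec ℕ n) (part : IsSetPartitionℕ blk) (nc : IsNonCrossingℕ blk) where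
    open BlockStructure blk part public

    archEnd : ℕ → ℕ
    archEnd i = primePos blk (next blk i)

    -- An arch ending at 1 is separate: its end 0′ = n′ sits at position 2n, to the right of label i.
    data ArchShape (i : ℕ) : Set where
      forward    : ∀ j → next blk i ≡ j → i < j → j ≤ n → rep i ≡ rep j →
                   (∀ z → i < z → z < j → rep i ≢ rep z) → ArchShape i
      wraps-to-1 : next blk i ≡ 1 → rep i ≡ 1 → (∀ z → i < z → z ≤ n → rep i ≢ rep z) → ArchShape i
      wraps-to   : ∀ m → next blk i ≡ m → rep i ≡ m → 2 ≤ m → m ≤ i →
                   (∀ z → i < z → z ≤ n → rep i ≢ rep z) → ArchShape i

    archShape : ∀ i → 1 ≤ i → i ≤ n → ArchShape i
    archShape i 1≤i i≤n with nextView i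
    ... | next-later j i<j j≤n same none-between eq = forward j eq i<j j≤n same none-between
    ... | next-wraps none-after eq with m≤n⇒m<n∨m≡n (rep≥1 i 1≤i i≤n)
    ...   | inj₂ 1≡rep = wraps-to-1 (trans eq (sym 1≡rep)) (sym 1≡rep) none-after
    ...   | inj₁ 1<rep = wraps-to (rep i) eq refl 1<rep (rep≤ i 1≤i i≤n) none-after

    forward-inside : ∀ i k j → 1 ≤ i → k ≤ n → i < j → j ≤ n → rep i ≡ rep j →
      (∀ z → i < z → z < j → rep i ≢ rep z) →
      i < k → k < j → 2 ≤ next blk k × i < next blk k × next blk k < j
    forward-inside i k j 1≤i k≤n i<j j≤n same none-between i<k k<j with nextView k
    ... | next-later s k<s s≤n same′ _ eq rewrite eq with <-cmp s j
    ...   | tri< s<j _ _ = ≤-trans (s≤s 1≤i) (≤-trans i<k (<⇒≤ k<s)) , <-trans i<k k<s , s<j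
    ...   | tri≈ _ refl _ = contradiction (trans same (sym same′)) (none-between k i<k k<j)
    ...   | tri> _ _ j<s = contradiction (nc i k j s 1≤i s≤n i<k k<j j<s same same′) (none-between k i<k k<j)
    forward-inside i k j 1≤i k≤n i<j j≤n same none-between i<k k<j | next-wraps _ eq rewrite eq
      with <-cmp (rep k) i
    ... | tri< rk<i _ _ = contradiction (sym (trans (sym (rep-idem k 1≤k k≤n))
                            (nc (rep k) i k j (rep≥1 k 1≤k k≤n) j≤n rk<i i<k k<j (rep-idem k 1≤k k≤n) same)))
                            (none-between k i<k k<j)
      where 1≤k = ≤-trans 1≤i (<⇒≤ i<k)
    ... | tri≈ _ rk≡i _ = contradiction (trans (cong rep (sym rk≡i)) (rep-idem k (≤-trans 1≤i (<⇒≤ i<k)) k≤n))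
                            (none-between k i<k k<j)
    ... | tri> _ _ i<rk = ≤-trans (s≤s 1≤i) i<rk , i<rk , ≤-<-trans (rep≤ k (≤-trans 1≤i (<⇒≤ i<k)) k≤n) k<j

    forward-inside⁻¹ : ∀ i k j → 1 ≤ i → 1 ≤ k → k ≤ n → i ≢ k → i < j → j ≤ n → rep i ≡ rep j →
      (∀ z → i < z → z < j → rep i ≢ rep z) →
      i < next blk k → next blk k < j → i < k × k < j
    forward-inside⁻¹ i k j 1≤i 1≤k k≤n i≢k i<j j≤n same none-between i<s s<j with next-inBlock k 1≤k k≤n
    ... | _ , _ , rs≡rk with <-cmp k i
    ...   | tri≈ _ k≡i _ = contradiction (sym k≡i) i≢k
    ...   | tri< k<i _ _ = contradiction (trans (sym (nc k i (next blk k) j 1≤k j≤n k<i i<s s<j (sym rs≡rk) same))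
                                                (sym rs≡rk))
                                         (none-between (next blk k) i<s s<j)
    ...   | tri> _ _ i<k with <-cmp k j
    ...     | tri< k<j _ _ = i<k , k<j
    ...     | tri≈ _ refl _ = contradiction (trans same (sym rs≡rk)) (none-between (next blk k) i<s s<j)
    ...     | tri> _ _ j<k = contradiction (nc i (next blk k) j k 1≤i k≤n i<s s<j j<k same rs≡rk)
                                           (none-between (next blk k) i<s s<j)

    wrap₁-inside : ∀ i k → 1 ≤ i → k ≤ n → rep i ≡ 1 → (∀ z → i < z → z ≤ n → rep i ≢ rep z) →
      i < k → 2 ≤ next blk k × i < next blk k
    wrap₁-inside i k 1≤i k≤n ri≡1 none-after i<k with nextView k
    ... | next-later s k<s _ _ _ eq rewrite eq = ≤-trans (s≤s 1≤i) (≤-trans i<k (<⇒≤ k<s)) , <-trans i<k k<s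
    ... | next-wraps _ eq rewrite eq with <-cmp (rep k) i
    ...   | tri≈ _ rk≡i _ = contradiction (trans (cong rep (sym rk≡i)) (rep-idem k 1≤k k≤n)) (none-after k i<k k≤n)
      where 1≤k = ≤-trans 1≤i (<⇒≤ i<k)
    ...   | tri> _ _ i<rk = ≤-trans (s≤s 1≤i) i<rk , i<rk
    ...   | tri< rk<i _ _ with m≤n⇒m<n∨m≡n (rep≥1 k 1≤k k≤n)
      where 1≤k = ≤-trans 1≤i (<⇒≤ i<k)
    ...     | inj₂ 1≡rk = contradiction (trans ri≡1 1≡rk) (none-after k i<k k≤n)
    ...     | inj₁ 1<rk = contradiction (trans ri≡1 (trans (sym (rep1≡1 1≤n)) (trans
                            (nc 1 (rep k) i k ≤-refl k≤n 1<rk rk<i i<k (trans (rep1≡1 1≤n) (sym ri≡1))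
                                (rep-idem k 1≤k k≤n))
                            (rep-idem k 1≤k k≤n))))
                            (none-after k i<k k≤n)
      where 1≤k = ≤-trans 1≤i (<⇒≤ i<k)
            1≤n = ≤-trans 1≤k k≤n

    wrap₁-inside⁻¹ : ∀ i k → 1 ≤ i → 1 ≤ k → k ≤ n → i ≢ k → rep i ≡ 1 →
      (∀ z → i < z → z ≤ n → rep i ≢ rep z) → i < next blk k → i < k
    wrap₁-inside⁻¹ i k 1≤i 1≤k k≤n i≢k ri≡1 none-after i<s with next-inBlock k 1≤k k≤n
    ... | _ , s≤n , rs≡rk with <-cmp k i
    ...   | tri≈ _ k≡i _ = contradiction (sym k≡i) i≢k
    ...   | tri> _ _ i<k = i<k
    ...   | tri< k<i _ _ with m≤n⇒m<n∨m≡n 1≤k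
    ...     | inj₂ 1≡k = contradiction (trans ri≡1 (trans (sym (rep1≡1 1≤n)) (trans (cong rep 1≡k) (sym rs≡rk))))
                                       (none-after (next blk k) i<s s≤n)
      where 1≤n = ≤-trans 1≤k k≤n
    ...     | inj₁ 1<k = contradiction (trans ri≡1 (trans (sym (rep1≡1 1≤n)) (trans
                            (nc 1 k i (next blk k) ≤-refl s≤n 1<k k<i i<s (trans (rep1≡1 1≤n) (sym ri≡1)) (sym rs≡rk))
                            (sym rs≡rk))))
                            (none-after (next blk k) i<s s≤n)
      where 1≤n = ≤-trans 1≤k k≤n

    wrap-inside : ∀ i k m → 1 ≤ i → i ≤ n → rep i ≡ m → 2 ≤ m → (∀ z → i < z → z ≤ n → rep i ≢ rep z) →
      m ≤ k → k < i → 2 ≤ next blk k × m < next blk k × next blk k ≤ i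
    wrap-inside i k m 1≤i i≤n ri≡m 2≤m none-after m≤k k<i with rep k ≟ rep i
    ... | yes rk≡ri with nextView k
    ...   | next-wraps none-after′ _ = contradiction rk≡ri (none-after′ i k<i i≤n)
    ...   | next-later s k<s s≤n same _ eq rewrite eq with <-cmp s i
    ...     | tri> _ _ i<s = contradiction (trans (sym rk≡ri) same) (none-after s i<s s≤n)
    ...     | tri< s<i _ _ = ≤-trans 2≤m (≤-trans m≤k (<⇒≤ k<s)) , <-≤-trans (s≤s m≤k) k<s , <⇒≤ s<i
    ...     | tri≈ _ s≡i _ = ≤-trans 2≤m (≤-trans m≤k (<⇒≤ k<s)) , <-≤-trans (s≤s m≤k) k<s , ≤-reflexive s≡i
    wrap-inside i k m 1≤i i≤n ri≡m 2≤m none-after m≤k k<i | no rk≢ri = inside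
      where
      1≤m = ≤-trans (s≤s z≤n) 2≤m
      1≤k = ≤-trans 1≤m m≤k
      k≤n = ≤-trans (<⇒≤ k<i) i≤n
      rm≡ri : rep m ≡ rep i
      rm≡ri = trans (cong rep (sym ri≡m)) (rep-idem i 1≤i i≤n)
      m<k : m < k
      m<k with m≤n⇒m<n∨m≡n m≤k
      ... | inj₁ m<k = m<k
      ... | inj₂ refl = contradiction rm≡ri rk≢ri
      inside : 2 ≤ next blk k × m < next blk k × next blk k ≤ i
      inside with nextView k
      ... | next-later s k<s s≤n same _ eq rewrite eq with <-cmp s i
      ...   | tri< s<i _ _ = ≤-trans 2≤m (≤-trans m≤k (<⇒≤ k<s)) , <-≤-trans (s≤s m≤k) k<s , <⇒≤ s<i
      ...   | tri≈ _ refl _ = contradiction same rk≢ri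
      ...   | tri> _ _ i<s = contradiction (sym (trans (sym rm≡ri) (nc m k i s 1≤m s≤n m<k k<i i<s rm≡ri same))) rk≢ri
      inside | next-wraps _ eq rewrite eq with <-cmp (rep k) m
      ... | tri≈ _ rk≡m _ = contradiction (trans rk≡m (sym ri≡m)) rk≢ri
      ... | tri> _ _ m<rk = ≤-trans 2≤m (<⇒≤ m<rk) , m<rk , ≤-trans (rep≤ k 1≤k k≤n) (<⇒≤ k<i)
      ... | tri< rk<m _ _ = contradiction (trans (sym (rep-idem k 1≤k k≤n))
                              (trans (nc (rep k) m k i (rep≥1 k 1≤k k≤n) i≤n rk<m m<k k<i (rep-idem k 1≤k k≤n) rm≡ri)
                                     rm≡ri))
                              rk≢ri

    wrap-inside⁻¹ : ∀ i k m → 1 ≤ i → i ≤ n → 1 ≤ k → k ≤ n → i ≢ k → rep i ≡ m → 2 ≤ m →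
      (∀ z → i < z → z ≤ n → rep i ≢ rep z) → m < next blk k → next blk k ≤ i → m ≤ k × k < i
    wrap-inside⁻¹ i k m 1≤i i≤n 1≤k k≤n i≢k ri≡m 2≤m none-after m<s s≤i with rep k ≟ rep i
    ... | yes rk≡ri = ≤-trans (≤-reflexive (trans (sym ri≡m) (sym rk≡ri))) (rep≤ k 1≤k k≤n) , k<i
      where
      k<i : k < i
      k<i with <-cmp k i
      ... | tri< k<i _ _ = k<i
      ... | tri≈ _ k≡i _ = contradiction (sym k≡i) i≢k
      ... | tri> _ _ i<k = contradiction (sym rk≡ri) (none-after k i<k k≤n)
    ... | no rk≢ri with next-inBlock k 1≤k k≤n
    ...   | _ , _ , rs≡rk = inside
      where
      1≤m = ≤-trans (s≤s z≤n) 2≤m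
      rm≡ri : rep m ≡ rep i
      rm≡ri = trans (cong rep (sym ri≡m)) (rep-idem i 1≤i i≤n)
      s<i : next blk k < i
      s<i with m≤n⇒m<n∨m≡n s≤i
      ... | inj₁ s<i = s<i
      ... | inj₂ s≡i = contradiction (trans (sym rs≡rk) (cong rep s≡i)) rk≢ri
      inside : m ≤ k × k < i
      inside with <-cmp k m
      ... | tri< k<m _ _ = contradiction (trans (nc k m (next blk k) i 1≤k i≤n k<m m<s s<i (sym rs≡rk) rm≡ri) rm≡ri) rk≢ri
      ... | tri≈ _ k≡m _ = contradiction (trans (cong rep k≡m) rm≡ri) rk≢ri
      ... | tri> _ _ m<k with <-cmp k i
      ...   | tri< k<i _ _ = <⇒≤ m<k , k<i
      ...   | tri≈ _ k≡i _ = contradiction (sym k≡i) i≢k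
      ...   | tri> _ _ i<k = contradiction (trans (sym rs≡rk) (trans (sym (nc m (next blk k) i k 1≤m k≤n m<s s<i i<k rm≡ri rs≡rk)) rm≡ri))
                                           rk≢ri

    archEnd-shape : ∀ k → 1 ≤ k → k ≤ n → (next blk k ≡ 1 × archEnd k ≡ 2 * n) ⊎
      (Σ ℕ λ c → next blk k ≡ suc c × 1 ≤ c × c < n × archEnd k ≡ 2 * c)
    archEnd-shape k 1≤k k≤n = primePos-shape blk (next blk k) (proj₁ inBlock) (proj₁ (proj₂ inBlock))
      where inBlock = next-inBlock k 1≤k k≤n

    archEnd-bounds : ∀ i → 1 ≤ i → i ≤ n → 1 ≤ archEnd i × archEnd i ≤ 2 * n
    archEnd-bounds i 1≤i i≤n with archEnd-shape i 1≤i i≤n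
    ... | inj₁ (_ , eq) rewrite eq = ≤-trans 1≤i (≤-trans i≤n (m≤n*m n 2)) , ≤-refl
    ... | inj₂ (c , _ , 1≤c , c<n , eq) rewrite eq = ≤-trans 1≤c (m≤n*m c 2) , *-monoʳ-≤ 2 (<⇒≤ c<n)

    archEnd-even : ∀ k → 1 ≤ k → k ≤ n → 2 ≤ next blk k →
      Σ ℕ λ c → next blk k ≡ suc c × 1 ≤ c × c < n × archEnd k ≡ 2 * c
    archEnd-even k 1≤k k≤n 2≤s with archEnd-shape k 1≤k k≤n
    ... | inj₁ (s≡1 , _) = contradiction 2≤s (<-irrefl (sym s≡1))
    ... | inj₂ shape = shape

    end-inside : ∀ i k → 1 ≤ i → i ≤ n → 1 ≤ k → k ≤ n →
      Between (pos i) (archEnd i) (pos k) → Between (pos i) (archEnd i) (archEnd k)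
    end-inside (suc a) (suc c) 1≤i i≤n 1≤k k≤n btw with archShape (suc a) 1≤i i≤n
    ... | forward (suc zero) _ (s≤s ()) _ _ _
    ... | forward (suc (suc b)) eq i<j j≤n same none-between =
      let a<c , c<b = between-up-odd (s≤s⁻¹ i<j) (Between-subst (pos-suc a) (cong (primePos blk) eq) (pos-suc c) btw)
          2≤s , i<s , s<j = forward-inside (suc a) (suc c) (suc (suc b)) 1≤i k≤n i<j j≤n same none-between
                              (s≤s a<c) (s≤s c<b)
          _ , s≡ , _ , _ , end≡ = archEnd-even (suc c) 1≤k k≤n 2≤s
      in Between-subst (sym (pos-suc a)) (cong (primePos blk) (sym eq)) (sym end≡)
           (between-up-even⁻¹ (s≤s⁻¹ (subst (suc a <_) s≡ i<s)) (s≤s⁻¹ (subst (_< suc (suc b)) s≡ s<j)))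
    ... | wraps-to-1 eq ri≡1 none-after =
      let a<c , _ = between-up-odd i≤n (Between-subst (pos-suc a) (cong (primePos blk) eq) (pos-suc c) btw)
          2≤s , i<s = wrap₁-inside (suc a) (suc c) 1≤i k≤n ri≡1 none-after (s≤s a<c)
          _ , s≡ , _ , c′<n , end≡ = archEnd-even (suc c) 1≤k k≤n 2≤s
      in Between-subst (sym (pos-suc a)) (cong (primePos blk) (sym eq)) (sym end≡)
           (between-up-even⁻¹ (s≤s⁻¹ (subst (suc a <_) s≡ i<s)) c′<n)
    ... | wraps-to (suc zero) _ _ (s≤s ()) _ _
    ... | wraps-to (suc (suc b)) eq ri≡m 2≤m m≤i none-after =
      let b≤c , c<a = between-down-odd (s≤s⁻¹ m≤i) (Between-subst (pos-suc a) (cong (primePos blk) eq) (pos-suc c) btw)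
          2≤s , m<s , s≤i = wrap-inside (suc a) (suc c) (suc (suc b)) 1≤i i≤n ri≡m 2≤m none-after (s≤s b≤c) (s≤s c<a)
          _ , s≡ , _ , _ , end≡ = archEnd-even (suc c) 1≤k k≤n 2≤s
      in Between-subst (sym (pos-suc a)) (cong (primePos blk) (sym eq)) (sym end≡)
           (between-down-even⁻¹ (s≤s⁻¹ (subst (suc (suc b) <_) s≡ m<s)) (s≤s⁻¹ (subst (_≤ suc a) s≡ s≤i)))

    -- Position 2n is never strictly inside an arch; otherwise archEnd k = 2c with next k = c + 1.
    end-inside⁻¹ : ∀ i k → 1 ≤ i → i ≤ n → 1 ≤ k → k ≤ n → i ≢ k →
      Between (pos i) (archEnd i) (archEnd k) → Between (pos i) (archEnd i) (pos k)
    end-inside⁻¹ i k 1≤i i≤n 1≤k k≤n i≢k btw with archEnd-shape k 1≤k k≤n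
    end-inside⁻¹ i k 1≤i i≤n 1≤k k≤n i≢k (inj₁ (_ , hi)) | inj₁ (_ , end≡) =
      contradiction (proj₂ (archEnd-bounds i 1≤i i≤n)) (<⇒≱ (subst (_< archEnd i) end≡ hi))
    end-inside⁻¹ i k 1≤i i≤n 1≤k k≤n i≢k (inj₂ (_ , hi)) | inj₁ (_ , end≡) =
      contradiction (proj₂ (pos-bounds i 1≤i i≤n)) (<⇒≱ (subst (_< pos i) end≡ hi))
    end-inside⁻¹ (suc a) (suc c) 1≤i i≤n 1≤k k≤n i≢k btw | inj₂ (c′ , s≡ , 1≤c′ , _ , end≡)
      with archShape (suc a) 1≤i i≤n
    ... | forward (suc zero) _ (s≤s ()) _ _ _
    ... | forward (suc (suc b)) eq i<j j≤n same none-between =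
      let a<c′ , c′<b = between-up-even (s≤s⁻¹ i<j) (Between-subst (pos-suc a) (cong (primePos blk) eq) end≡ btw)
          i<k , k<j = forward-inside⁻¹ (suc a) (suc c) (suc (suc b)) 1≤i 1≤k k≤n i≢k i<j j≤n same none-between
                        (subst (suc a <_) (sym s≡) (s≤s a<c′)) (subst (_< suc (suc b)) (sym s≡) (s≤s c′<b))
      in Between-subst (sym (pos-suc a)) (cong (primePos blk) (sym eq)) (sym (pos-suc c))
           (between-up-odd⁻¹ (s≤s⁻¹ i<k) (s≤s⁻¹ k<j))
    ... | wraps-to-1 eq ri≡1 none-after =
      let a<c′ , _ = between-up-even i≤n (Between-subst (pos-suc a) (cong (primePos blk) eq) end≡ btw)
          i<k = wrap₁-inside⁻¹ (suc a) (suc c) 1≤i 1≤k k≤n i≢k ri≡1 none-after (subst (suc a <_) (sym s≡) (s≤s a<c′))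
      in Between-subst (sym (pos-suc a)) (cong (primePos blk) (sym eq)) (sym (pos-suc c))
           (between-up-odd⁻¹ (s≤s⁻¹ i<k) k≤n)
    ... | wraps-to (suc zero) _ _ (s≤s ()) _ _
    ... | wraps-to (suc (suc b)) eq ri≡m 2≤m m≤i none-after =
      let b<c′ , c′≤a = between-down-even (s≤s⁻¹ m≤i) (Between-subst (pos-suc a) (cong (primePos blk) eq) end≡ btw)
          m≤k , k<i = wrap-inside⁻¹ (suc a) (suc c) (suc (suc b)) 1≤i i≤n 1≤k k≤n i≢k ri≡m 2≤m none-after
                        (subst (suc (suc b) <_) (sym s≡) (s≤s b<c′)) (subst (_≤ suc a) (sym s≡) (s≤s c′≤a))
      in Between-subst (sym (pos-suc a)) (cong (primePos blk) (sym eq)) (sym (pos-suc c))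
           (between-down-odd⁻¹ (s≤s⁻¹ m≤k) (s≤s⁻¹ k<i))

    partner-archEnd : ∀ i → 1 ≤ i → i ≤ n → ΨpartnerOf blk (archEnd i) ≡ pos i
    partner-archEnd i 1≤i i≤n with archEnd-shape i 1≤i i≤n
    ... | inj₁ (s≡1 , end≡) = begin
      ΨpartnerOf blk (archEnd i)            ≡⟨ cong (ΨpartnerOf blk) end≡ ⟩
      ΨpartnerOf blk (2 * n)                ≡⟨ partner-even blk n ⟩
      pos (prev blk (cyclicSuc n n))        ≡⟨ cong (pos ∘ prev blk) (trans (cyclicSuc-last n) (sym s≡1)) ⟩
      pos (prev blk (next blk i))           ≡⟨ cong pos (prev-next i 1≤i i≤n) ⟩
      pos i                                 ∎
      where open ≡-Reasoning
    ... | inj₂ (c , s≡ , _ , c<n , end≡) = begin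
      ΨpartnerOf blk (archEnd i)            ≡⟨ cong (ΨpartnerOf blk) end≡ ⟩
      ΨpartnerOf blk (2 * c)                ≡⟨ partner-even blk c ⟩
      pos (prev blk (cyclicSuc n c))        ≡⟨ cong (pos ∘ prev blk) (trans (cyclicSuc-< n c c<n) (sym s≡)) ⟩
      pos (prev blk (next blk i))           ≡⟨ cong pos (prev-next i 1≤i i≤n) ⟩
      pos i                                 ∎
      where open ≡-Reasoning

    archEnd-injective : ∀ x y → 1 ≤ x → x ≤ n → 1 ≤ y → y ≤ n → archEnd x ≡ archEnd y → x ≡ y
    archEnd-injective x y 1≤x x≤n 1≤y y≤n eq = begin
      x                      ≡⟨ prev-next x 1≤x x≤n ⟨
      prev blk (next blk x)  ≡⟨ cong (prev blk) (primePos-injective blk blk (next blk x) (next blk y) 1≤s s≤n 1≤t t≤n eq) ⟩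
      prev blk (next blk y)  ≡⟨ prev-next y 1≤y y≤n ⟩
      y                      ∎
      where
      open ≡-Reasoning
      1≤s = proj₁ (next-inBlock x 1≤x x≤n)
      s≤n = proj₁ (proj₂ (next-inBlock x 1≤x x≤n))
      1≤t = proj₁ (next-inBlock y 1≤y y≤n)
      t≤n = proj₁ (proj₂ (next-inBlock y 1≤y y≤n))

    pos≢archEnd : ∀ y i → 1 ≤ y → 1 ≤ i → i ≤ n → pos y ≢ archEnd i
    pos≢archEnd y i 1≤y 1≤i i≤n eq with archEnd-shape i 1≤i i≤n
    ... | inj₁ (_ , end≡) = pos≢even y n 1≤y (trans eq end≡)
    ... | inj₂ (c , _ , _ , _ , end≡) = pos≢even y c 1≤y (trans eq end≡)

    position-cover : ∀ p → 1 ≤ p → p ≤ 2 * n → Σ ℕ λ i → 1 ≤ i × i ≤ n × (p ≡ pos i ⊎ p ≡ archEnd i)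
    position-cover p 1≤p p≤2n with pos⊎even p 1≤p
    ... | inj₁ (i , 1≤i , eq) = i , 1≤i , pos-bounded n i 1≤i (subst (_≤ 2 * n) eq p≤2n) , inj₁ eq
    ... | inj₂ (j , 1≤j , eq) = prev blk s , 1≤h , h≤n , inj₂ (trans eq (sym end≡))
      where
      j≤n = *-cancelˡ-≤ 2 (subst (_≤ 2 * n) eq p≤2n)
      s = cyclicSuc n j
      s-bounds = cyclicSuc-bounds n j 1≤j j≤n
      1≤h = proj₁ (prev-inBlock s (proj₁ s-bounds) (proj₂ s-bounds))
      h≤n = proj₁ (proj₂ (prev-inBlock s (proj₁ s-bounds) (proj₂ s-bounds)))
      end≡ : archEnd (prev blk s) ≡ 2 * j
      end≡ = trans (cong (primePos blk) (next-prev s (proj₁ s-bounds) (proj₂ s-bounds)))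
                   (primePos-cyclicSuc blk j 1≤j j≤n)

    IsArch : ℕ → ℕ → ℕ → Set
    IsArch i p q = (p ≡ pos i × q ≡ archEnd i) ⊎ (p ≡ archEnd i × q ≡ pos i)

    arch-at : ∀ p → 1 ≤ p → p ≤ 2 * n → Σ ℕ λ i → 1 ≤ i × i ≤ n × IsArch i p (at (Ψraw blk) p)
    arch-at p 1≤p p≤2n with position-cover p 1≤p p≤2n
    ... | i , 1≤i , i≤n , inj₁ eq =
      i , 1≤i , i≤n , inj₁ (eq , trans (at-Ψraw blk p 1≤p p≤2n) (trans (cong (ΨpartnerOf blk) eq) (partner-pos blk i 1≤i)))
    ... | i , 1≤i , i≤n , inj₂ eq =
      i , 1≤i , i≤n , inj₂ (eq , trans (at-Ψraw blk p 1≤p p≤2n) (trans (cong (ΨpartnerOf blk) eq) (partner-archEnd i 1≤i i≤n)))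

    Ψraw-isMatching : IsMatching (Ψraw blk)
    Ψraw-isMatching = ∀⇒All[1‥] matched
      where
      matched : ∀ p → 1 ≤ p → p ≤ 2 * n → 1 ≤ at (Ψraw blk) p × at (Ψraw blk) p ≤ 2 * n ×
                  at (Ψraw blk) p ≢ p × at (Ψraw blk) (at (Ψraw blk) p) ≡ p
      matched p 1≤p p≤2n with arch-at p 1≤p p≤2n
      ... | i , 1≤i , i≤n , inj₁ (p≡ , q≡) rewrite q≡ =
        proj₁ end-bounds , proj₂ end-bounds , (λ eq → pos≢archEnd i i 1≤i 1≤i i≤n (sym (trans eq p≡))) ,
        trans (at-Ψraw blk _ (proj₁ end-bounds) (proj₂ end-bounds)) (trans (partner-archEnd i 1≤i i≤n) (sym p≡))
        where end-bounds = archEnd-bounds i 1≤i i≤n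
      ... | i , 1≤i , i≤n , inj₂ (p≡ , q≡) rewrite q≡ =
        proj₁ p-bounds , proj₂ p-bounds , (λ eq → pos≢archEnd i i 1≤i 1≤i i≤n (trans eq p≡)) ,
        trans (at-Ψraw blk _ (proj₁ p-bounds) (proj₂ p-bounds)) (trans (partner-pos blk i 1≤i) (sym p≡))
        where p-bounds = pos-bounds i 1≤i i≤n

    private
      between-IsArch : ∀ {i p q x} → IsArch i p q → p < x → x < q → Between (pos i) (archEnd i) x
      between-IsArch (inj₁ (refl , refl)) p<x x<q = inj₁ (p<x , x<q)
      between-IsArch (inj₂ (refl , refl)) p<x x<q = inj₂ (p<x , x<q)

      beyond-IsArch : ∀ {i p q x} → IsArch i p q → p < q → q < x → ¬ Between (pos i) (archEnd i) x
      beyond-IsArch (inj₁ (refl , refl)) p<q q<x (inj₁ (_ , x<e)) = <-asym q<x x<e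
      beyond-IsArch (inj₁ (refl , refl)) p<q q<x (inj₂ (_ , x<p)) = <-asym (<-trans p<q q<x) x<p
      beyond-IsArch (inj₂ (refl , refl)) p<q q<x (inj₁ (_ , x<e)) = <-asym (<-trans p<q q<x) x<e
      beyond-IsArch (inj₂ (refl , refl)) p<q q<x (inj₂ (_ , x<p)) = <-asym q<x x<p

      IsArch-nested : ∀ {i p q p′ q′} → IsArch i p q → IsArch i p′ q′ → p < p′ → p′ < q → ⊥
      IsArch-nested (inj₁ (p≡ , _))  (inj₁ (p′≡ , _)) p<p′ _   = <-irrefl (trans p≡ (sym p′≡)) p<p′
      IsArch-nested (inj₁ (_ , q≡))  (inj₂ (p′≡ , _)) _   p′<q = <-irrefl (trans p′≡ (sym q≡)) p′<q
      IsArch-nested (inj₂ (_ , q≡))  (inj₁ (p′≡ , _)) _   p′<q = <-irrefl (trans p′≡ (sym q≡)) p′<q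
      IsArch-nested (inj₂ (p≡ , _))  (inj₂ (p′≡ , _)) p<p′ _   = <-irrefl (trans p≡ (sym p′≡)) p<p′

    -- The interior of the arch of i is a union of arches, so no arch can leave it.
    arches-noncrossing : ∀ a b c d → 1 ≤ a → a ≤ 2 * n → 1 ≤ c → c ≤ 2 * n → a < c → c < b → b < d →
      at (Ψraw blk) a ≡ b → at (Ψraw blk) c ≡ d → ⊥
    arches-noncrossing a b c d 1≤a a≤2n 1≤c c≤2n a<c c<b b<d refl refl
      with arch-at a 1≤a a≤2n | arch-at c 1≤c c≤2n
    ... | i , 1≤i , i≤n , arch-i | k , 1≤k , k≤n , arch-k = escapes arch-k
      where
      c-inside : Between (pos i) (archEnd i) c
      c-inside = between-IsArch arch-i a<c c<b
      i≢k : i ≢ k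
      i≢k refl = IsArch-nested arch-i arch-k a<c c<b
      escapes : IsArch k c d → ⊥
      escapes (inj₁ (c≡ , d≡)) = beyond-IsArch arch-i (<-trans a<c c<b) b<d
        (subst (Between (pos i) (archEnd i)) (sym d≡) (end-inside i k 1≤i i≤n 1≤k k≤n (subst (Between (pos i) (archEnd i)) c≡ c-inside)))
      escapes (inj₂ (c≡ , d≡)) = beyond-IsArch arch-i (<-trans a<c c<b) b<d
        (subst (Between (pos i) (archEnd i)) (sym d≡) (end-inside⁻¹ i k 1≤i i≤n 1≤k k≤n i≢k (subst (Between (pos i) (archEnd i)) c≡ c-inside)))

    Ψraw-isCD : IsCD (Ψraw blk)
    Ψraw-isCD = Ψraw-isMatching , λ a b c d a<c c<b b<d →
      arches-noncrossing (suc (toℕ a)) (suc (toℕ b)) (suc (toℕ c)) (suc (toℕ d))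
        (s≤s z≤n) (toℕ<n a) (s≤s z≤n) (toℕ<n c) a<c c<b b<d

  Ψraw-determines-next : ∀ {n} (b b′ : Vec ℕ n) → IsSetPartitionℕ b → IsSetPartitionℕ b′ → Ψraw b ≡ Ψraw b′ →
    ∀ i → 1 ≤ i → i ≤ n → next b i ≡ next b′ i
  Ψraw-determines-next {n} b b′ part part′ Ψ≡ i 1≤i i≤n = primePos-injective b b′ (next b i) (next b′ i)
    (proj₁ (B.next-inBlock i 1≤i i≤n)) (proj₁ (proj₂ (B.next-inBlock i 1≤i i≤n)))
    (proj₁ (B′.next-inBlock i 1≤i i≤n)) (proj₁ (proj₂ (B′.next-inBlock i 1≤i i≤n))) (begin
      primePos b (next b i)       ≡⟨ partner-pos b i 1≤i ⟨
      ΨpartnerOf b (pos i)        ≡⟨ at-Ψraw b (pos i) 1≤p p≤2n ⟨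
      at (Ψraw b) (pos i)         ≡⟨ cong (λ v → at v (pos i)) Ψ≡ ⟩
      at (Ψraw b′) (pos i)        ≡⟨ at-Ψraw b′ (pos i) 1≤p p≤2n ⟩
      ΨpartnerOf b′ (pos i)       ≡⟨ partner-pos b′ i 1≤i ⟩
      primePos b′ (next b′ i)     ∎)
    where
    open ≡-Reasoning
    module B = BlockStructure b part
    module B′ = BlockStructure b′ part′
    1≤p = proj₁ (pos-bounds i 1≤i i≤n)
    p≤2n = proj₂ (pos-bounds i 1≤i i≤n)

  Ψraw-injective : ∀ {n} (b b′ : Vec ℕ n) → IsSetPartitionℕ b → IsSetPartitionℕ b′ → Ψraw b ≡ Ψraw b′ → b ≡ b′
  Ψraw-injective b b′ part part′ Ψ≡ = next-determines-partition b b′ part part′ (Ψraw-determines-next b b′ part part′ Ψ≡)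

module KrewerasComplement where

  open import Data.Nat using (ℕ; suc; _≤_; _<_; _≟_; _<ᵇ_; _≡ᵇ_; _≤ᵇ_; z≤n; s≤s; s≤s⁻¹)
  open import Data.Nat.Properties
  open import Data.Bool using (Bool; true; false; _∧_; _∨_)
  open import Data.Bool.Properties using (∨-zeroʳ)
  open import Data.Bool.ListAction using (any)
  open import Data.Vec using (Vec)
  open import Data.List using (findᵇ)
  open import Data.Maybe using (just; nothing; fromMaybe)
  open import Data.Product using (_×_; _,_; proj₁; proj₂)
  open import Data.Sum using (_⊎_; inj₁; inj₂; map₁; map₂)
  open import Relation.Nullary using (¬_; yes; no; contradiction)
  open import Function using (_∘_)
  open import Relation.Binary.PropositionalEquality
  open Basics
  open Partitions
  open Arches using (cyclicSuc; cyclicSuc-last; cyclicSuc-<)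

  module KrewerasRegions {n : ℕ} (blk : Vec ℕ n) where

    rep : ℕ → ℕ
    rep = at blk

    -- [i, j) is a union of blocks; for i ≤ j this says the chord from i′ to j′ meets no block.
    Saturated : ℕ → ℕ → Set
    Saturated i j = ∀ a b → 1 ≤ a → a ≤ n → 1 ≤ b → b ≤ n → i ≤ a → a < j → (b < i ⊎ j ≤ b) → rep a ≢ rep b

    private
      leaksTo : ℕ → ℕ → ℕ → ℕ → Bool
      leaksTo i j a b = ((b <ᵇ i) ∨ (j ≤ᵇ b)) ∧ (rep a ≡ᵇ rep b)

      leaksFrom : ℕ → ℕ → ℕ → Bool
      leaksFrom i j a = (i ≤ᵇ a) ∧ (a <ᵇ j) ∧ any (leaksTo i j a) (ascending 1 n)

      separatedᵇ-ascending : ∀ i j → separatedᵇ blk i j ≡ any (leaksFrom i j) (ascending 1 n)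
      separatedᵇ-ascending i j rewrite [1‥n]≡ascending n = refl

    separatedᵇ-false : ∀ i j → Saturated i j → separatedᵇ blk i j ≡ false
    separatedᵇ-false i j sat = trans (separatedᵇ-ascending i j)
      (any-ascending-false _ 1 n λ a 1≤a a<1+n → no-leak-from a 1≤a (s≤s⁻¹ a<1+n))
      where
      no-leak-from : ∀ a → 1 ≤ a → a ≤ n → leaksFrom i j a ≡ false
      no-leak-from a 1≤a a≤n with i ≤ᵇ a in i≤ᵇa | a <ᵇ j in a<ᵇj
      ... | false | _     = refl
      ... | true  | false = refl
      ... | true  | true  = any-ascending-false _ 1 n λ b 1≤b b<1+n → no-leak-to b 1≤b (s≤s⁻¹ b<1+n)
        where
        disjoint : ∀ b → 1 ≤ b → b ≤ n → b < i ⊎ j ≤ b → (rep a ≡ᵇ rep b) ≡ false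
        disjoint b 1≤b b≤n outside = ≡ᵇ-false (sat a b 1≤a a≤n 1≤b b≤n (≤ᵇ-true⁻¹ i≤ᵇa) (<ᵇ-true⁻¹ a<ᵇj) outside)
        no-leak-to : ∀ b → 1 ≤ b → b ≤ n → leaksTo i j a b ≡ false
        no-leak-to b 1≤b b≤n with b <? i
        ... | yes b<i rewrite <ᵇ-true b<i = disjoint b 1≤b b≤n (inj₁ b<i)
        ... | no b≮i rewrite <ᵇ-false b≮i with j ≤? b
        ...   | yes j≤b rewrite ≤ᵇ-true j≤b = disjoint b 1≤b b≤n (inj₂ j≤b)
        ...   | no j≰b rewrite ≤ᵇ-false j≰b = refl

    separatedᵇ-false⁻¹ : ∀ i j → separatedᵇ blk i j ≡ false → Saturated i j
    separatedᵇ-false⁻¹ i j sep a b 1≤a a≤n 1≤b b≤n i≤a a<j outside same =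
      false≢true (any-ascending-false⁻¹ _ 1 n no-leak-to b 1≤b (s≤s b≤n)) (leak outside)
      where
      no-leak-from = any-ascending-false⁻¹ _ 1 n (trans (sym (separatedᵇ-ascending i j)) sep) a 1≤a (s≤s a≤n)
      no-leak-to : any (leaksTo i j a) (ascending 1 n) ≡ false
      no-leak-to = subst (_≡ false) (cong₂ (λ x y → x ∧ y ∧ any (leaksTo i j a) (ascending 1 n))
                                           (≤ᵇ-true i≤a) (<ᵇ-true a<j)) no-leak-from
      leak : b < i ⊎ j ≤ b → leaksTo i j a b ≡ true
      leak (inj₁ b<i) rewrite <ᵇ-true b<i = ≡ᵇ-true same
      leak (inj₂ j≤b) rewrite ≤ᵇ-true j≤b | ∨-zeroʳ (b <ᵇ i) = ≡ᵇ-true same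

    Saturated-empty : ∀ i → Saturated i i
    Saturated-empty i a b _ _ _ _ i≤a a<i _ = contradiction i≤a (<⇒≱ a<i)

    Saturated-join : ∀ i j k → i ≤ j → j ≤ k → Saturated i j → Saturated j k → Saturated i k
    Saturated-join i j k i≤j j≤k sat₁ sat₂ a b 1≤a a≤n 1≤b b≤n i≤a a<k outside with <-≤-connex a j
    ... | inj₁ a<j = sat₁ a b 1≤a a≤n 1≤b b≤n i≤a a<j (map₂ (≤-trans j≤k) outside)
    ... | inj₂ j≤a = sat₂ a b 1≤a a≤n 1≤b b≤n j≤a a<k (map₁ (λ b<i → <-≤-trans b<i i≤j) outside)

    Saturated-diffˡ : ∀ i j k → i ≤ j → Saturated i k → Saturated i j → Saturated j k
    Saturated-diffˡ i j k i≤j sat₁ sat₂ a b 1≤a a≤n 1≤b b≤n j≤a a<k (inj₂ k≤b) =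
      sat₁ a b 1≤a a≤n 1≤b b≤n (≤-trans i≤j j≤a) a<k (inj₂ k≤b)
    Saturated-diffˡ i j k i≤j sat₁ sat₂ a b 1≤a a≤n 1≤b b≤n j≤a a<k (inj₁ b<j) with <-≤-connex b i
    ... | inj₁ b<i = sat₁ a b 1≤a a≤n 1≤b b≤n (≤-trans i≤j j≤a) a<k (inj₁ b<i)
    ... | inj₂ i≤b = λ same → sat₂ b a 1≤b b≤n 1≤a a≤n i≤b b<j (inj₂ j≤a) (sym same)

    Saturated-diffʳ : ∀ i j k → j ≤ k → Saturated i k → Saturated j k → Saturated i j
    Saturated-diffʳ i j k j≤k sat₁ sat₂ a b 1≤a a≤n 1≤b b≤n i≤a a<j (inj₁ b<i) =
      sat₁ a b 1≤a a≤n 1≤b b≤n i≤a (<-≤-trans a<j j≤k) (inj₁ b<i)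
    Saturated-diffʳ i j k j≤k sat₁ sat₂ a b 1≤a a≤n 1≤b b≤n i≤a a<j (inj₂ j≤b) with <-≤-connex b k
    ... | inj₂ k≤b = sat₁ a b 1≤a a≤n 1≤b b≤n i≤a (<-≤-trans a<j j≤k) (inj₂ k≤b)
    ... | inj₁ b<k = λ same → sat₂ b a 1≤b b≤n 1≤a a≤n j≤b b<k (inj₁ a<j) (sym same)

    Saturated-meet : ∀ i j k l → i ≤ j → k ≤ l → Saturated i k → Saturated j l → Saturated j k
    Saturated-meet i j k l i≤j k≤l sat₁ sat₂ a b 1≤a a≤n 1≤b b≤n j≤a a<k (inj₁ b<j) with <-≤-connex b i
    ... | inj₁ b<i = sat₁ a b 1≤a a≤n 1≤b b≤n (≤-trans i≤j j≤a) a<k (inj₁ b<i)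
    ... | inj₂ i≤b = sat₂ a b 1≤a a≤n 1≤b b≤n j≤a (<-≤-trans a<k k≤l) (inj₁ b<j)
    Saturated-meet i j k l i≤j k≤l sat₁ sat₂ a b 1≤a a≤n 1≤b b≤n j≤a a<k (inj₂ k≤b) with <-≤-connex b l
    ... | inj₂ l≤b = sat₂ a b 1≤a a≤n 1≤b b≤n j≤a (<-≤-trans a<k k≤l) (inj₂ l≤b)
    ... | inj₁ b<l = sat₁ a b 1≤a a≤n 1≤b b≤n (≤-trans i≤j j≤a) a<k (inj₂ k≤b)

    SameRegion : ℕ → ℕ → Set
    SameRegion i j = (i ≤ j × Saturated i j) ⊎ (j < i × Saturated j i)

    SameRegion-ordered : ∀ i j → SameRegion i j → (i ≤ j × Saturated i j) ⊎ (j ≤ i × Saturated j i)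
    SameRegion-ordered i j (inj₁ fwd)           = inj₁ fwd
    SameRegion-ordered i j (inj₂ (j<i , sat))   = inj₂ (<⇒≤ j<i , sat)

    SameRegion-intro : ∀ i j → i ≤ j → Saturated i j → SameRegion i j × SameRegion j i
    SameRegion-intro i j i≤j sat with m≤n⇒m<n∨m≡n i≤j
    ... | inj₁ i<j  = inj₁ (i≤j , sat) , inj₂ (i<j , sat)
    ... | inj₂ refl = inj₁ (i≤j , sat) , inj₁ (i≤j , sat)

    SameRegion⇒Saturated : ∀ i j → i ≤ j → SameRegion i j → Saturated i j
    SameRegion⇒Saturated i j i≤j same with SameRegion-ordered i j same
    ... | inj₁ (_ , sat) = sat
    ... | inj₂ (j≤i , sat) with ≤-antisym i≤j j≤i
    ...   | refl = sat

    SameRegion-refl : ∀ i → SameRegion i i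
    SameRegion-refl i = inj₁ (≤-refl , Saturated-empty i)

    SameRegion-sym : ∀ i j → SameRegion i j → SameRegion j i
    SameRegion-sym i j same with SameRegion-ordered i j same
    ... | inj₁ (i≤j , sat) = proj₂ (SameRegion-intro i j i≤j sat)
    ... | inj₂ (j≤i , sat) = proj₁ (SameRegion-intro j i j≤i sat)

    SameRegion-trans : ∀ i j k → SameRegion i j → SameRegion j k → SameRegion i k
    SameRegion-trans i j k s₁ s₂ with SameRegion-ordered i j s₁ | SameRegion-ordered j k s₂
    ... | inj₁ (i≤j , sat₁) | inj₁ (j≤k , sat₂) =
      proj₁ (SameRegion-intro i k (≤-trans i≤j j≤k) (Saturated-join i j k i≤j j≤k sat₁ sat₂))
    ... | inj₂ (j≤i , sat₁) | inj₂ (k≤j , sat₂) =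
      proj₂ (SameRegion-intro k i (≤-trans k≤j j≤i) (Saturated-join k j i k≤j j≤i sat₂ sat₁))
    ... | inj₁ (i≤j , sat₁) | inj₂ (k≤j , sat₂) with ≤-total i k
    ...   | inj₁ i≤k = proj₁ (SameRegion-intro i k i≤k (Saturated-diffʳ i k j k≤j sat₁ sat₂))
    ...   | inj₂ k≤i = proj₂ (SameRegion-intro k i k≤i (Saturated-diffʳ k i j i≤j sat₂ sat₁))
    SameRegion-trans i j k s₁ s₂ | inj₂ (j≤i , sat₁) | inj₁ (j≤k , sat₂) with ≤-total i k
    ...   | inj₁ i≤k = proj₁ (SameRegion-intro i k i≤k (Saturated-diffˡ j i k j≤i sat₂ sat₁))
    ...   | inj₂ k≤i = proj₂ (SameRegion-intro k i k≤i (Saturated-diffˡ j k i j≤k sat₁ sat₂))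

    sameRegionᵇ-true : ∀ i j → SameRegion i j → sameRegionᵇ blk i j ≡ true
    sameRegionᵇ-true i j (inj₁ (i≤j , sat)) rewrite ≤ᵇ-true i≤j | separatedᵇ-false i j sat = refl
    sameRegionᵇ-true i j (inj₂ (j<i , sat)) rewrite ≤ᵇ-false (<⇒≱ j<i) | separatedᵇ-false j i sat = refl

    sameRegionᵇ-true⁻¹ : ∀ i j → sameRegionᵇ blk i j ≡ true → SameRegion i j
    sameRegionᵇ-true⁻¹ i j eq with i ≤ᵇ j in i≤ᵇj
    ... | true  = inj₁ (≤ᵇ-true⁻¹ i≤ᵇj , separatedᵇ-false⁻¹ i j (not≡true⇒≡false eq))
    ... | false = inj₂ (≰⇒> (≤ᵇ-false⁻¹ i≤ᵇj) , separatedᵇ-false⁻¹ j i (not≡true⇒≡false eq))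

    ρrep : ℕ → ℕ
    ρrep = at (ρRaw blk)

    private
      ρrep-unfold : ∀ x → 1 ≤ x → x ≤ n → ρrep x ≡ fromMaybe 0 (findᵇ (λ y → sameRegionᵇ blk y x) (ascending 1 n))
      ρrep-unfold x 1≤x x≤n =
        trans (at-tabulate (λ x → fromMaybe 0 (findᵇ (λ y → sameRegionᵇ blk y x) [1‥ n ])) x 1≤x x≤n)
              (cong (λ l → fromMaybe 0 (findᵇ (λ y → sameRegionᵇ blk y x) l)) ([1‥n]≡ascending n))

    ρrep-least : ∀ x → 1 ≤ x → x ≤ n →
      1 ≤ ρrep x × ρrep x ≤ n × SameRegion (ρrep x) x × (∀ z → 1 ≤ z → z < ρrep x → ¬ SameRegion z x)
    ρrep-least x 1≤x x≤n with findᵇ (λ y → sameRegionᵇ blk y x) (ascending 1 n) in eq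
    ... | nothing = contradiction (sameRegionᵇ-true x x (SameRegion-refl x))
                      (false≢true (findᵇ-ascending-nothing _ 1 n eq x 1≤x (s≤s x≤n)))
    ... | just y rewrite ρrep-unfold x 1≤x x≤n | eq =
      let 1≤y , y<1+n , same , below = findᵇ-ascending-just _ 1 n y eq in
      1≤y , s≤s⁻¹ y<1+n , sameRegionᵇ-true⁻¹ y x same ,
      λ z 1≤z z<y same′ → false≢true (below z 1≤z z<y) (sameRegionᵇ-true z x same′)

    ρrep≡least : ∀ x y → 1 ≤ x → x ≤ n → 1 ≤ y → y ≤ n → SameRegion y x →
      (∀ z → 1 ≤ z → z < y → ¬ SameRegion z x) → ρrep x ≡ y
    ρrep≡least x y 1≤x x≤n 1≤y y≤n same below = trans (ρrep-unfold x 1≤x x≤n) (cong (fromMaybe 0)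
      (findᵇ-ascending-least _ 1 n y 1≤y (s≤s y≤n) (sameRegionᵇ-true y x same) not-before))
      where
      not-before : ∀ z → 1 ≤ z → z < y → sameRegionᵇ blk z x ≡ false
      not-before z 1≤z z<y with sameRegionᵇ blk z x in eq
      ... | false = refl
      ... | true  = contradiction (sameRegionᵇ-true⁻¹ z x eq) (below z 1≤z z<y)

    ρrep-sameRegion : ∀ x y → 1 ≤ x → x ≤ n → 1 ≤ y → y ≤ n → SameRegion x y → ρrep x ≡ ρrep y
    ρrep-sameRegion x y 1≤x x≤n 1≤y y≤n same =
      let 1≤r , r≤n , r~y , below = ρrep-least y 1≤y y≤n in
      ρrep≡least x (ρrep y) 1≤x x≤n 1≤r r≤n (SameRegion-trans (ρrep y) y x r~y (SameRegion-sym x y same))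
        (λ z 1≤z z<r z~x → below z 1≤z z<r (SameRegion-trans z x y z~x same))

    ρrep-sameRegion⁻¹ : ∀ x y → 1 ≤ x → x ≤ n → 1 ≤ y → y ≤ n → ρrep x ≡ ρrep y → SameRegion x y
    ρrep-sameRegion⁻¹ x y 1≤x x≤n 1≤y y≤n eq =
      SameRegion-trans x (ρrep x) y (SameRegion-sym (ρrep x) x (proj₁ (proj₂ (proj₂ (ρrep-least x 1≤x x≤n)))))
        (subst (λ w → SameRegion w y) (sym eq) (proj₁ (proj₂ (proj₂ (ρrep-least y 1≤y y≤n)))))

    ρRaw-isSetPartition : IsSetPartitionℕ (ρRaw blk)
    ρRaw-isSetPartition x 1≤x x≤n =
      let 1≤r , r≤n , r~x , below = ρrep-least x 1≤x x≤n in
      1≤r , r≤x below , ρrep-sameRegion (ρrep x) x 1≤r r≤n 1≤x x≤n r~x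
      where
      r≤x : (∀ z → 1 ≤ z → z < ρrep x → ¬ SameRegion z x) → ρrep x ≤ x
      r≤x below with ≤-<-connex (ρrep x) x
      ... | inj₁ r≤x = r≤x
      ... | inj₂ x<r = contradiction (SameRegion-refl x) (below x 1≤x x<r)

    ρRaw-isNonCrossing : IsNonCrossingℕ (ρRaw blk)
    ρRaw-isNonCrossing i j k l 1≤i l≤n i<j j<k k<l ik jl =
      ρrep-sameRegion i j 1≤i i≤n 1≤j j≤n (proj₁ (SameRegion-intro i j (<⇒≤ i<j) sat-ij))
      where
      1≤j = ≤-trans 1≤i (<⇒≤ i<j)
      1≤k = ≤-trans 1≤j (<⇒≤ j<k)
      1≤l = ≤-trans 1≤k (<⇒≤ k<l)
      k≤n = ≤-trans (<⇒≤ k<l) l≤n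
      j≤n = ≤-trans (<⇒≤ j<k) k≤n
      i≤n = ≤-trans (<⇒≤ i<j) j≤n
      sat-ik = SameRegion⇒Saturated i k (<⇒≤ (<-trans i<j j<k)) (ρrep-sameRegion⁻¹ i k 1≤i i≤n 1≤k k≤n ik)
      sat-jl = SameRegion⇒Saturated j l (<⇒≤ (<-trans j<k k<l)) (ρrep-sameRegion⁻¹ j l 1≤j j≤n 1≤l l≤n jl)
      sat-jk = Saturated-meet i j k l (<⇒≤ i<j) (<⇒≤ k<l) sat-ik sat-jl
      sat-ij = Saturated-diffʳ i j k (<⇒≤ j<k) sat-ik sat-jk

  module KrewerasBlocks {n : ℕ} (blk : Vec ℕ n) (part : IsSetPartitionℕ blk) (nc : IsNonCrossingℕ blk) where
    open BlockStructure blk part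
    open KrewerasRegions blk hiding (rep)
    module ρ = BlockStructure (ρRaw blk) ρRaw-isSetPartition

    private
      next-ρ-earlier : ∀ j p → 1 ≤ j → j ≤ n → p < j → 1 ≤ p → rep p ≡ rep j →
        (∀ z → p < z → z < j → rep z ≢ rep j) → next (ρRaw blk) j ≡ suc p
      next-ρ-earlier j p 1≤j j≤n p<j 1≤p same none-between =
        trans (ρ.next-wraps-is j last-in-region)
              (ρrep≡least j (suc p) 1≤j j≤n (s≤s z≤n) (≤-trans p<j j≤n) (proj₁ (SameRegion-intro (suc p) j p<j sat)) below)
        where
        p≤n = ≤-trans (<⇒≤ p<j) j≤n
        last-in-region : ∀ z → j < z → z ≤ n → ρrep j ≢ ρrep z
        last-in-region z j<z z≤n′ eq =
          SameRegion⇒Saturated j z (<⇒≤ j<z) (ρrep-sameRegion⁻¹ j z 1≤j j≤n (≤-trans 1≤j (<⇒≤ j<z)) z≤n′ eq)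
            j p 1≤j j≤n 1≤p p≤n ≤-refl j<z (inj₁ p<j) (sym same)
        below : ∀ z → 1 ≤ z → z < suc p → ¬ SameRegion z j
        below z 1≤z z<1+p same′ =
          SameRegion⇒Saturated z j (≤-trans (s≤s⁻¹ z<1+p) (<⇒≤ p<j)) same′
            p j 1≤p p≤n 1≤j j≤n (s≤s⁻¹ z<1+p) p<j (inj₂ ≤-refl) same
        sat : Saturated (suc p) j
        sat x y 1≤x x≤n 1≤y y≤n p<x x<j (inj₁ y<1+p) x~y with m≤n⇒m<n∨m≡n (s≤s⁻¹ y<1+p)
        ... | inj₁ y<p = none-between x p<x x<j (trans x~y (trans (nc y p x j 1≤y j≤n y<p p<x x<j (sym x~y) same) same))
        ... | inj₂ refl = none-between x p<x x<j (trans x~y same)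
        sat x y 1≤x x≤n 1≤y y≤n p<x x<j (inj₂ j≤y) x~y with m≤n⇒m<n∨m≡n j≤y
        ... | inj₂ refl = none-between x p<x x<j x~y
        ... | inj₁ j<y = none-between x p<x x<j (sym (trans (sym same) (nc p x j y 1≤p y≤n p<x x<j j<y same x~y)))

      next-ρ-wraps : ∀ j M → 1 ≤ j → (∀ z → 1 ≤ z → z < j → rep z ≢ rep j) → j ≤ M → M < n →
        rep M ≡ rep j → (∀ z → M < z → z ≤ n → rep z ≢ rep j) → next (ρRaw blk) j ≡ suc M
      next-ρ-wraps j M 1≤j none-before j≤M M<n same none-after =
        ρ.next-later-is j (suc M) (s≤s j≤M) M<n
          (ρrep-sameRegion j (suc M) 1≤j j≤n (s≤s z≤n) M<n (proj₁ (SameRegion-intro j (suc M) (≤-trans j≤M (n≤1+n M)) sat)))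
          between
        where
        M≤n = <⇒≤ M<n
        j≤n = ≤-trans j≤M M≤n
        between : ∀ z → j < z → z < suc M → ρrep j ≢ ρrep z
        between z j<z z<1+M eq =
          SameRegion⇒Saturated j z (<⇒≤ j<z) (ρrep-sameRegion⁻¹ j z 1≤j j≤n (≤-trans 1≤j (<⇒≤ j<z)) (≤-trans (s≤s⁻¹ z<1+M) M≤n) eq)
            j M 1≤j j≤n (≤-trans 1≤j j≤M) M≤n ≤-refl j<z (inj₂ (s≤s⁻¹ z<1+M)) (sym same)
        sat : Saturated j (suc M)
        sat x y 1≤x x≤n 1≤y y≤n j≤x x<1+M outside x~y with rep x ≟ rep j
        sat x y 1≤x x≤n 1≤y y≤n j≤x x<1+M (inj₁ y<j) x~y | yes x~j = none-before y 1≤y y<j (trans (sym x~y) x~j)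
        sat x y 1≤x x≤n 1≤y y≤n j≤x x<1+M (inj₂ M<y) x~y | yes x~j = none-after y M<y y≤n (trans (sym x~y) x~j)
        sat x y 1≤x x≤n 1≤y y≤n j≤x x<1+M outside x~y | no x≁j = x≁j (crossing outside)
          where
          j<x : j < x
          j<x with m≤n⇒m<n∨m≡n j≤x
          ... | inj₁ j<x = j<x
          ... | inj₂ refl = contradiction refl x≁j
          x<M : x < M
          x<M with m≤n⇒m<n∨m≡n (s≤s⁻¹ x<1+M)
          ... | inj₁ x<M = x<M
          ... | inj₂ refl = contradiction same x≁j
          crossing : y < j ⊎ suc M ≤ y → rep x ≡ rep j
          crossing (inj₁ y<j) = trans x~y (nc y j x M 1≤y M≤n y<j j<x x<M (sym x~y) (sym same))
          crossing (inj₂ M<y) = sym (nc j x M y 1≤j y≤n j<x x<M M<y (sym same) x~y)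

      next-ρ-wraps-last : ∀ j → 1 ≤ j → (∀ z → 1 ≤ z → z < j → rep z ≢ rep j) → j ≤ n →
        rep n ≡ rep j → next (ρRaw blk) j ≡ 1
      next-ρ-wraps-last j 1≤j none-before j≤n same =
        trans (ρ.next-wraps-is j last-in-region)
              (ρrep≡least j 1 1≤j j≤n ≤-refl (≤-trans 1≤j j≤n) (proj₁ (SameRegion-intro 1 j 1≤j sat))
                          (λ z 1≤z z<1 _ → <⇒≱ z<1 1≤z))
        where
        last-in-region : ∀ z → j < z → z ≤ n → ρrep j ≢ ρrep z
        last-in-region z j<z z≤n′ eq =
          SameRegion⇒Saturated j z (<⇒≤ j<z) (ρrep-sameRegion⁻¹ j z 1≤j j≤n (≤-trans 1≤j (<⇒≤ j<z)) z≤n′ eq)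
            j n 1≤j j≤n (≤-trans 1≤j j≤n) ≤-refl ≤-refl j<z (inj₂ z≤n′) (sym same)
        sat : Saturated 1 j
        sat x y 1≤x x≤n 1≤y y≤n _ x<j (inj₁ y<1) x~y = <⇒≱ y<1 1≤y
        sat x y 1≤x x≤n 1≤y y≤n _ x<j (inj₂ j≤y) x~y with m≤n⇒m<n∨m≡n j≤y
        ... | inj₂ refl = none-before x 1≤x x<j x~y
        ... | inj₁ j<y with m≤n⇒m<n∨m≡n y≤n
        ...   | inj₂ refl = none-before x 1≤x x<j (trans x~y same)
        ...   | inj₁ y<n = none-before x 1≤x x<j (nc x j y n 1≤x ≤-refl x<j j<y y<n x~y (sym same))

    next-ρ : ∀ j → 1 ≤ j → j ≤ n → next (ρRaw blk) j ≡ cyclicSuc n (prev blk j)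
    next-ρ j 1≤j j≤n with prevView j 1≤j j≤n
    ... | prev-earlier p p<j 1≤p same none-between eq rewrite eq =
      trans (next-ρ-earlier j p 1≤j j≤n p<j 1≤p same none-between) (sym (cyclicSuc-< n p (<-≤-trans p<j j≤n)))
    ... | prev-wraps none-before M j≤M M≤n same none-after eq rewrite eq with m≤n⇒m<n∨m≡n M≤n
    ...   | inj₁ M<n = trans (next-ρ-wraps j M 1≤j none-before j≤M M<n same none-after) (sym (cyclicSuc-< n M M<n))
    ...   | inj₂ refl = trans (next-ρ-wraps-last j 1≤j none-before j≤M same) (sym (cyclicSuc-last M))

    prev-ρ : ∀ j → 1 ≤ j → j ≤ n → prev (ρRaw blk) (cyclicSuc n j) ≡ next blk j
    prev-ρ j 1≤j j≤n = begin
      prev (ρRaw blk) (cyclicSuc n j)                   ≡⟨ cong (prev (ρRaw blk) ∘ cyclicSuc n) (prev-next j 1≤j j≤n) ⟨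
      prev (ρRaw blk) (cyclicSuc n (prev blk s))        ≡⟨ cong (prev (ρRaw blk)) (next-ρ s 1≤s s≤n) ⟨
      prev (ρRaw blk) (next (ρRaw blk) s)               ≡⟨ ρ.prev-next s 1≤s s≤n ⟩
      s                                                 ∎
      where
      open ≡-Reasoning
      s = next blk j
      1≤s = proj₁ (next-inBlock j 1≤j j≤n)
      s≤n = proj₁ (proj₂ (next-inBlock j 1≤j j≤n))

module Rotation where

  open import Data.Nat using (ℕ; zero; suc; _+_; _∸_; _≤_; _<_; _≟_; _<ᵇ_; _≡ᵇ_; z≤n; s≤s)
  open import Data.Nat.Properties
  open import Data.Nat.GeneralisedArithmetic using (fold; fold-+)
  open import Data.Bool using (Bool; true; false; if_then_else_)
  open import Data.Vec using (Vec; tabulate)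
  open import Data.Fin using (toℕ)
  open import Data.Product using (_×_; _,_; proj₁; proj₂)
  open import Data.Sum using (inj₁; inj₂)
  open import Relation.Nullary using (yes; no)
  open import Relation.Binary.PropositionalEquality
  open Basics

  private variable
    m : ℕ

  InRange : ℕ → ℕ → Set
  InRange m x = 1 ≤ x × x ≤ m

  PreservesRange : Vec ℕ m → Set
  PreservesRange {m} v = ∀ x → InRange m x → InRange m (at v x)

  rot : ℕ → ℕ → ℕ
  rot m p = if p <ᵇ m then p + 1 else 1

  rot⁻¹ : ℕ → ℕ → ℕ
  rot⁻¹ m p = if 1 <ᵇ p then p ∸ 1 else m

  rot-< : ∀ m x → x < m → rot m x ≡ suc x
  rot-< m x x<m rewrite <ᵇ-true x<m = +-comm x 1

  rot-last : ∀ m → rot m m ≡ 1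
  rot-last m rewrite <ᵇ-false (<-irrefl (refl {x = m})) = refl

  rot⁻¹-suc : ∀ m x → 1 ≤ x → rot⁻¹ m (suc x) ≡ x
  rot⁻¹-suc m (suc x) _ = refl

  rot-inRange : ∀ m x → InRange m x → InRange m (rot m x)
  rot-inRange m x (1≤x , x≤m) with m≤n⇒m<n∨m≡n x≤m
  ... | inj₁ x<m rewrite rot-< m x x<m = s≤s z≤n , x<m
  ... | inj₂ refl rewrite rot-last x = ≤-refl , 1≤x

  rot⁻¹-inRange : ∀ m x → InRange m x → InRange m (rot⁻¹ m x)
  rot⁻¹-inRange m (suc zero)    (_ , 1≤m)     = 1≤m , ≤-refl
  rot⁻¹-inRange m (suc (suc x)) (_ , 2+x≤m)   = s≤s z≤n , ≤-trans (n≤1+n (suc x)) 2+x≤m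

  rot-rot⁻¹ : ∀ m x → InRange m x → rot m (rot⁻¹ m x) ≡ x
  rot-rot⁻¹ m (suc zero)    _           = rot-last m
  rot-rot⁻¹ m (suc (suc x)) (_ , 2+x≤m) = rot-< m (suc x) 2+x≤m

  rot⁻¹-rot : ∀ m x → InRange m x → rot⁻¹ m (rot m x) ≡ x
  rot⁻¹-rot m x (1≤x , x≤m) with m≤n⇒m<n∨m≡n x≤m
  ... | inj₁ x<m rewrite rot-< m x x<m = rot⁻¹-suc m x 1≤x
  ... | inj₂ refl rewrite rot-last x = refl

  rot-injective : ∀ m x y → InRange m x → InRange m y → rot m x ≡ rot m y → x ≡ y
  rot-injective m x y x∈ y∈ eq = trans (sym (rot⁻¹-rot m x x∈)) (trans (cong (rot⁻¹ m) eq) (rot⁻¹-rot m y y∈))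

  ≡ᵇ-rot : ∀ m p a → InRange m p → InRange m a → (p ≡ᵇ rot m a) ≡ (rot⁻¹ m p ≡ᵇ a)
  ≡ᵇ-rot m p a p∈ a∈ with rot⁻¹ m p ≟ a
  ... | yes refl = trans (≡ᵇ-true (sym (rot-rot⁻¹ m p p∈))) (sym (≡ᵇ-true {rot⁻¹ m p} refl))
  ... | no ψp≢a = trans (≡ᵇ-false {p} λ p≡ → ψp≢a (trans (cong (rot⁻¹ m) p≡) (rot⁻¹-rot m a a∈)))
                        (sym (≡ᵇ-false {rot⁻¹ m p} ψp≢a))

  at-σRaw : ∀ (mt : Vec ℕ m) p → InRange m p → at (σRaw mt) p ≡ rot m (at mt (rot⁻¹ m p))
  at-σRaw {m} mt p (1≤p , p≤m) = at-tabulate (λ p → rot m (at mt (rot⁻¹ m p))) p 1≤p p≤m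

  σRaw-injective : (u v : Vec ℕ m) → PreservesRange u → PreservesRange v → σRaw u ≡ σRaw v → u ≡ v
  σRaw-injective {m} u v u∈ v∈ eq = at-extensionality u v λ y 1≤y y≤m →
    let y∈ = 1≤y , y≤m
        p∈ = rot-inRange m y y∈
        rotated : rot m (at u (rot⁻¹ m (rot m y))) ≡ rot m (at v (rot⁻¹ m (rot m y)))
        rotated = trans (sym (at-σRaw u (rot m y) p∈)) (trans (cong (λ w → at w (rot m y)) eq) (at-σRaw v (rot m y) p∈))
    in rot-injective m _ _ (u∈ y y∈) (v∈ y y∈) (subst (λ z → rot m (at u z) ≡ rot m (at v z)) (rot⁻¹-rot m y y∈) rotated)

  fold-step : ∀ {A : Set} (s : A → A) z k → fold (s z) s k ≡ s (fold z s k)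
  fold-step s z k = trans (sym (fold-+ z s k {1})) (cong (fold z s) (+-comm k 1))

  fold-inRange : ∀ f → (∀ x → InRange m x → InRange m (f x)) → ∀ k x → InRange m x → InRange m (fold x f k)
  fold-inRange f f∈ zero    x x∈ = x∈
  fold-inRange f f∈ (suc k) x x∈ = f∈ _ (fold-inRange f f∈ k x x∈)

  at-σRaw^ : ∀ k (u : Vec ℕ m) p → InRange m p → at (fold u σRaw k) p ≡ fold (at u (fold p (rot⁻¹ m) k)) (rot m) k
  at-σRaw^ zero    u p p∈ = refl
  at-σRaw^ {m} (suc k) u p p∈ = begin
    at (σRaw (fold u σRaw k)) p                           ≡⟨ at-σRaw (fold u σRaw k) p p∈ ⟩
    rot m (at (fold u σRaw k) (rot⁻¹ m p))                ≡⟨ cong (rot m) (at-σRaw^ k u (rot⁻¹ m p) (rot⁻¹-inRange m p p∈)) ⟩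
    rot m (fold (at u (fold (rot⁻¹ m p) (rot⁻¹ m) k)) (rot m) k)
                                                          ≡⟨ cong (λ z → rot m (fold (at u z) (rot m) k)) (fold-step (rot⁻¹ m) p k) ⟩
    rot m (fold (at u (fold p (rot⁻¹ m) (suc k))) (rot m) k) ∎
    where open ≡-Reasoning

  rot^-ascends : ∀ m k x → x + k ≤ m → fold x (rot m) k ≡ x + k
  rot^-ascends m zero    x _     = sym (+-identityʳ x)
  rot^-ascends m (suc k) x x+k<m = begin
    rot m (fold x (rot m) k)  ≡⟨ cong (rot m) (rot^-ascends m k x (≤-trans (+-monoʳ-≤ x (n≤1+n k)) x+k<m)) ⟩
    rot m (x + k)             ≡⟨ rot-< m (x + k) (subst (_≤ m) (+-suc x k) x+k<m) ⟩
    suc (x + k)               ≡⟨ +-suc x k ⟨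
    x + suc k                 ∎
    where open ≡-Reasoning

  rot^m≡id : ∀ m x → InRange m x → fold x (rot m) m ≡ x
  rot^m≡id m (suc x) (_ , 1+x≤m) = begin
    fold (suc x) (rot m) m                                   ≡⟨ cong (fold (suc x) (rot m)) split ⟨
    fold (suc x) (rot m) (x + suc (m ∸ suc x))               ≡⟨ fold-+ (suc x) (rot m) x ⟩
    fold (rot m (fold (suc x) (rot m) (m ∸ suc x))) (rot m) x ≡⟨ cong (λ z → fold (rot m z) (rot m) x) up ⟩
    fold (rot m m) (rot m) x                                 ≡⟨ cong (λ z → fold z (rot m) x) (rot-last m) ⟩
    fold 1 (rot m) x                                         ≡⟨ rot^-ascends m x 1 1+x≤m ⟩
    suc x                                                    ∎
    where
    open ≡-Reasoning
    split : x + suc (m ∸ suc x) ≡ m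
    split = trans (+-suc x (m ∸ suc x)) (m+[n∸m]≡n 1+x≤m)
    up : fold (suc x) (rot m) (m ∸ suc x) ≡ m
    up = trans (rot^-ascends m (m ∸ suc x) (suc x) (≤-reflexive (m+[n∸m]≡n 1+x≤m))) (m+[n∸m]≡n 1+x≤m)

  rot⁻¹^-rot^ : ∀ m k x → InRange m x → fold (fold x (rot m) k) (rot⁻¹ m) k ≡ x
  rot⁻¹^-rot^ m zero    x x∈ = refl
  rot⁻¹^-rot^ m (suc k) x x∈ = begin
    rot⁻¹ m (fold (rot m y) (rot⁻¹ m) k)    ≡⟨ fold-step (rot⁻¹ m) (rot m y) k ⟨
    fold (rot⁻¹ m (rot m y)) (rot⁻¹ m) k    ≡⟨ cong (λ z → fold z (rot⁻¹ m) k) (rot⁻¹-rot m y (fold-inRange (rot m) (rot-inRange m) k x x∈)) ⟩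
    fold y (rot⁻¹ m) k                      ≡⟨ rot⁻¹^-rot^ m k x x∈ ⟩
    x                                       ∎
    where
    open ≡-Reasoning
    y = fold x (rot m) k

  rot⁻¹^m≡id : ∀ m x → InRange m x → fold x (rot⁻¹ m) m ≡ x
  rot⁻¹^m≡id m x x∈ = trans (cong (λ z → fold z (rot⁻¹ m) m) (sym (rot^m≡id m x x∈))) (rot⁻¹^-rot^ m m x x∈)

  σRaw^m≡id : (u : Vec ℕ m) → PreservesRange u → fold u σRaw m ≡ u
  σRaw^m≡id {m} u u∈ = at-extensionality _ _ λ p 1≤p p≤m → begin
    at (fold u σRaw m) p                            ≡⟨ at-σRaw^ m u p (1≤p , p≤m) ⟩
    fold (at u (fold p (rot⁻¹ m) m)) (rot m) m      ≡⟨ cong (λ z → fold (at u z) (rot m) m) (rot⁻¹^m≡id m p (1≤p , p≤m)) ⟩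
    fold (at u p) (rot m) m                         ≡⟨ rot^m≡id m (at u p) (u∈ p (1≤p , p≤m)) ⟩
    at u p                                          ∎
    where open ≡-Reasoning

  cascade : Bool → Bool → Bool → Bool → ℕ → ℕ → ℕ → ℕ → ℕ → ℕ
  cascade b₁ b₂ b₃ b₄ x₁ x₂ x₃ x₄ x₅ =
    if b₁ then x₁ else if b₂ then x₂ else if b₃ then x₃ else if b₄ then x₄ else x₅

  cascade-float : ∀ (f : ℕ → ℕ) b₁ b₂ b₃ b₄ {x₁ x₂ x₃ x₄ x₅} →
    f (cascade b₁ b₂ b₃ b₄ x₁ x₂ x₃ x₄ x₅) ≡ cascade b₁ b₂ b₃ b₄ (f x₁) (f x₂) (f x₃) (f x₄) (f x₅)
  cascade-float f true  _     _     _     = refl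
  cascade-float f false true  _     _     = refl
  cascade-float f false false true  _     = refl
  cascade-float f false false false true  = refl
  cascade-float f false false false false = refl

  cascade-cong : ∀ {b₁ b₂ b₃ b₄ c₁ c₂ c₃ c₄ x₁ x₂ x₃ x₄ x₅ y₁ y₂ y₃ y₄ y₅} →
    b₁ ≡ c₁ → b₂ ≡ c₂ → b₃ ≡ c₃ → b₄ ≡ c₄ → x₁ ≡ y₁ → x₂ ≡ y₂ → x₃ ≡ y₃ → x₄ ≡ y₄ → x₅ ≡ y₅ →
    cascade b₁ b₂ b₃ b₄ x₁ x₂ x₃ x₄ x₅ ≡ cascade c₁ c₂ c₃ c₄ y₁ y₂ y₃ y₄ y₅
  cascade-cong refl refl refl refl refl refl refl refl refl = refl

  cascade-preserves : ∀ (P : ℕ → Set) b₁ b₂ b₃ b₄ {x₁ x₂ x₃ x₄ x₅} →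
    P x₁ → P x₂ → P x₃ → P x₄ → P x₅ → P (cascade b₁ b₂ b₃ b₄ x₁ x₂ x₃ x₄ x₅)
  cascade-preserves P true  _     _     _     p₁ _  _  _  _  = p₁
  cascade-preserves P false true  _     _     _  p₂ _  _  _  = p₂
  cascade-preserves P false false true  _     _  _  p₃ _  _  = p₃
  cascade-preserves P false false false true  _  _  _  p₄ _  = p₄
  cascade-preserves P false false false false _  _  _  _  p₅ = p₅

  -- The else-branch of eRaw: eᵢ C when i is not matched with i+1.
  rewired : ℕ → Vec ℕ m → ℕ → ℕ
  rewired i mt p = cascade (p ≡ᵇ i) (p ≡ᵇ (i + 1)) (p ≡ᵇ at mt i) (p ≡ᵇ at mt (i + 1))
                           (i + 1) i (at mt (i + 1)) (at mt i) (at mt p)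

  module _ (i : ℕ) (mt : Vec ℕ m) {p : ℕ} where
    rewired-i : p ≡ i → rewired i mt p ≡ i + 1
    rewired-i p≡i rewrite ≡ᵇ-true p≡i = refl

    rewired-i+1 : p ≢ i → p ≡ i + 1 → rewired i mt p ≡ i
    rewired-i+1 p≢i p≡i+1 rewrite ≡ᵇ-false p≢i | ≡ᵇ-true p≡i+1 = refl

    rewired-partner-i : p ≢ i → p ≢ i + 1 → p ≡ at mt i → rewired i mt p ≡ at mt (i + 1)
    rewired-partner-i p≢i p≢i+1 p≡a rewrite ≡ᵇ-false p≢i | ≡ᵇ-false p≢i+1 | ≡ᵇ-true p≡a = refl

    rewired-partner-i+1 : p ≢ i → p ≢ i + 1 → p ≢ at mt i → p ≡ at mt (i + 1) → rewired i mt p ≡ at mt i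
    rewired-partner-i+1 p≢i p≢i+1 p≢a p≡b rewrite ≡ᵇ-false p≢i | ≡ᵇ-false p≢i+1 | ≡ᵇ-false p≢a | ≡ᵇ-true p≡b = refl

    rewired-elsewhere : p ≢ i → p ≢ i + 1 → p ≢ at mt i → p ≢ at mt (i + 1) → rewired i mt p ≡ at mt p
    rewired-elsewhere p≢i p≢i+1 p≢a p≢b rewrite ≡ᵇ-false p≢i | ≡ᵇ-false p≢i+1 | ≡ᵇ-false p≢a | ≡ᵇ-false p≢b = refl

  eRaw-loop : ∀ i (mt : Vec ℕ m) → (at mt i ≡ᵇ (i + 1)) ≡ true → eRaw i mt ≡ (true , mt)
  eRaw-loop i mt eq with at mt i ≡ᵇ (i + 1)
  eRaw-loop i mt refl | .true = refl

  eRaw-rewire : ∀ i (mt : Vec ℕ m) → (at mt i ≡ᵇ (i + 1)) ≡ false →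
    eRaw i mt ≡ (false , tabulate (λ k → rewired i mt (suc (toℕ k))))
  eRaw-rewire i mt eq with at mt i ≡ᵇ (i + 1)
  eRaw-rewire i mt refl | .false = refl

  eRaw-preservesRange : ∀ i (M : Vec ℕ m) → PreservesRange M → 1 ≤ i → i + 1 ≤ m → PreservesRange (proj₂ (eRaw i M))
  eRaw-preservesRange {m} i M M∈ 1≤i i+1≤m with at M i ≟ i + 1
  ... | yes loop = subst (λ r → PreservesRange (proj₂ r)) (sym (eRaw-loop i M (≡ᵇ-true loop))) M∈
  ... | no ¬loop = subst (λ r → PreservesRange (proj₂ r)) (sym (eRaw-rewire i M (≡ᵇ-false ¬loop))) λ p p∈ →
    subst (InRange m) (sym (at-tabulate (rewired i M) p (proj₁ p∈) (proj₂ p∈)))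
      (cascade-preserves (InRange m) (p ≡ᵇ i) (p ≡ᵇ (i + 1)) (p ≡ᵇ at M i) (p ≡ᵇ at M (i + 1))
        i+1∈ i∈ (M∈ (i + 1) i+1∈) (M∈ i i∈) (M∈ p p∈))
    where
    i+1∈ = ≤-trans 1≤i (m≤m+n i 1) , i+1≤m
    i∈ = 1≤i , ≤-trans (m≤m+n i 1) i+1≤m

  module _ {m} (i : ℕ) (M : Vec ℕ m) (M∈ : PreservesRange M) (1≤i : 1 ≤ i) (i+2≤m : i + 2 ≤ m) where
    private
      i+1<m : i + 1 < m
      i+1<m = ≤-trans (≤-reflexive (sym (+-suc i 1))) i+2≤m
      i∈ : InRange m i
      i∈ = 1≤i , <⇒≤ (≤-<-trans (m≤m+n i 1) i+1<m)
      i+1∈ : InRange m (i + 1)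
      i+1∈ = ≤-trans 1≤i (m≤m+n i 1) , <⇒≤ i+1<m
      rot-i : rot m i ≡ i + 1
      rot-i = trans (rot-< m i (≤-<-trans (m≤m+n i 1) i+1<m)) (+-comm 1 i)
      rot-i+1 : rot m (i + 1) ≡ i + 1 + 1
      rot-i+1 = trans (rot-< m (i + 1) i+1<m) (+-comm 1 (i + 1))
      σM-i+1 : at (σRaw M) (i + 1) ≡ rot m (at M i)
      σM-i+1 = trans (at-σRaw M (i + 1) i+1∈)
                     (cong (λ z → rot m (at M z)) (trans (cong (rot⁻¹ m) (sym rot-i)) (rot⁻¹-rot m i i∈)))
      i+2∈ : InRange m (i + 1 + 1)
      i+2∈ = subst (InRange m) rot-i+1 (rot-inRange m (i + 1) i+1∈)
      σM-i+2 : at (σRaw M) (i + 1 + 1) ≡ rot m (at M (i + 1))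
      σM-i+2 = trans (at-σRaw M (i + 1 + 1) i+2∈)
                     (cong (λ z → rot m (at M z)) (trans (cong (rot⁻¹ m) (sym rot-i+1)) (rot⁻¹-rot m (i + 1) i+1∈)))

    rewired-σRaw : ∀ p → InRange m p → rewired (i + 1) (σRaw M) p ≡ rot m (rewired i M (rot⁻¹ m p))
    rewired-σRaw p p∈ = trans
      (cascade-cong
        (trans (cong (p ≡ᵇ_) (sym rot-i)) (≡ᵇ-rot m p i p∈ i∈))
        (trans (cong (p ≡ᵇ_) (sym rot-i+1)) (≡ᵇ-rot m p (i + 1) p∈ i+1∈))
        (trans (cong (p ≡ᵇ_) σM-i+1) (≡ᵇ-rot m p (at M i) p∈ (M∈ i i∈)))
        (trans (cong (p ≡ᵇ_) σM-i+2) (≡ᵇ-rot m p (at M (i + 1)) p∈ (M∈ (i + 1) i+1∈)))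
        (sym rot-i+1) (sym rot-i) σM-i+2 σM-i+1 (at-σRaw M p p∈))
      (sym (cascade-float (rot m) (ψp ≡ᵇ i) (ψp ≡ᵇ (i + 1)) (ψp ≡ᵇ at M i) (ψp ≡ᵇ at M (i + 1))))
      where ψp = rot⁻¹ m p

    eRaw-σRaw : eRaw (i + 1) (σRaw M) ≡ (proj₁ (eRaw i M) , σRaw (proj₂ (eRaw i M)))
    eRaw-σRaw with at M i ≟ i + 1
    ... | yes loop rewrite eRaw-loop i M (≡ᵇ-true loop) =
      eRaw-loop (i + 1) (σRaw M) (≡ᵇ-true (trans σM-i+1 (trans (cong (rot m) loop) rot-i+1)))
    ... | no ¬loop rewrite eRaw-rewire i M (≡ᵇ-false ¬loop) =
      trans (eRaw-rewire (i + 1) (σRaw M) (≡ᵇ-false ¬loop′))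
            (cong (false ,_) (at-extensionality (tabulate {n = m} (λ k → rewired (i + 1) (σRaw M) (suc (toℕ k))))
                                                (σRaw (tabulate {n = m} (λ k → rewired i M (suc (toℕ k))))) λ p 1≤p p≤m → begin
              at (tabulate {n = m} (λ k → rewired (i + 1) (σRaw M) (suc (toℕ k)))) p
                ≡⟨ at-tabulate (rewired (i + 1) (σRaw M)) p 1≤p p≤m ⟩
              rewired (i + 1) (σRaw M) p
                ≡⟨ rewired-σRaw p (1≤p , p≤m) ⟩
              rot m (rewired i M (rot⁻¹ m p))
                ≡⟨ cong (rot m) (at-tabulate (rewired i M) (rot⁻¹ m p) (proj₁ (rot⁻¹-inRange m p (1≤p , p≤m))) (proj₂ (rot⁻¹-inRange m p (1≤p , p≤m)))) ⟨
              rot m (at (tabulate {n = m} (λ k → rewired i M (suc (toℕ k)))) (rot⁻¹ m p))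
                ≡⟨ at-σRaw (tabulate {n = m} (λ k → rewired i M (suc (toℕ k)))) p (1≤p , p≤m) ⟨
              at (σRaw (tabulate {n = m} (λ k → rewired i M (suc (toℕ k))))) p ∎))
      where
      open ≡-Reasoning
      ¬loop′ : at (σRaw M) (i + 1) ≢ i + 1 + 1
      ¬loop′ eq = ¬loop (rot-injective m _ _ (M∈ i i∈) i+1∈ (trans (sym σM-i+1) (trans eq (sym rot-i+1))))

module RotationIsKreweras where

  open import Data.Nat using (ℕ; zero; suc; _*_; _≤_; z≤n; s≤s)
  open import Data.Nat.Properties
  open import Data.Vec using (Vec)
  open import Data.Product using (_,_; proj₁; proj₂)
  open import Data.Sum using (inj₁; inj₂)
  open import Relation.Binary.PropositionalEquality
  open Basics
  open Partitions
  open Arches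
  open KrewerasComplement
  open Rotation

  rot-pos : ∀ n x → 1 ≤ x → x ≤ n → rot (2 * n) (pos x) ≡ 2 * x
  rot-pos n (suc a) _ x≤n =
    trans (cong (rot (2 * n)) (pos-suc a)) (trans (rot-< (2 * n) (suc (2 * a)) (odd<even x≤n)) (sym (*-suc 2 a)))

  rot-primePos : ∀ {n} (blk : Vec ℕ n) y → 1 ≤ y → y ≤ n → rot (2 * n) (primePos blk y) ≡ pos y
  rot-primePos {n} blk (suc zero)    _ _   = rot-last (2 * n)
  rot-primePos {n} blk (suc (suc c)) _ y≤n = trans (rot-< (2 * n) (2 * suc c) (even<even y≤n)) (sym (pos-suc (suc c)))

  rot⁻¹-even : ∀ m j → 1 ≤ j → rot⁻¹ m (2 * j) ≡ pos j
  rot⁻¹-even m (suc a) _ rewrite <ᵇ-true {1} {2 * suc a} (*-monoʳ-≤ 2 (s≤s (z≤n {a}))) = refl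

  rot⁻¹-pos : ∀ m j → 1 ≤ j → rot⁻¹ m (pos (suc j)) ≡ 2 * j
  rot⁻¹-pos m j 1≤j = trans (cong (rot⁻¹ m) (pos-suc j)) (rot⁻¹-suc m (2 * j) (≤-trans 1≤j (m≤n*m j 2)))

  module _ {n : ℕ} (blk : Vec ℕ n) (part : IsSetPartitionℕ blk) (nc : IsNonCrossingℕ blk) where
    open BlockStructure blk part
    open KrewerasBlocks blk part nc
    open ≡-Reasoning

    private
      rotated-partner-pos : ∀ j → 1 ≤ j → j ≤ n →
        rot (2 * n) (at (Ψraw blk) (rot⁻¹ (2 * n) (pos j))) ≡ 2 * prev blk j
      rotated-partner-pos (suc zero) _ 1≤n = begin
        rot (2 * n) (at (Ψraw blk) (2 * n))               ≡⟨ cong (rot (2 * n)) (at-Ψraw blk (2 * n) (≤-trans 1≤n (m≤n*m n 2)) ≤-refl) ⟩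
        rot (2 * n) (ΨpartnerOf blk (2 * n))              ≡⟨ cong (rot (2 * n)) (partner-even blk n) ⟩
        rot (2 * n) (pos (prev blk (cyclicSuc n n)))      ≡⟨ cong (λ z → rot (2 * n) (pos (prev blk z))) (cyclicSuc-last n) ⟩
        rot (2 * n) (pos (prev blk 1))                    ≡⟨ rot-pos n (prev blk 1) (proj₁ (prev-inBlock 1 ≤-refl 1≤n)) (proj₁ (proj₂ (prev-inBlock 1 ≤-refl 1≤n))) ⟩
        2 * prev blk 1                                    ∎
      rotated-partner-pos (suc (suc a)) _ j≤n = begin
        rot (2 * n) (at (Ψraw blk) (rot⁻¹ (2 * n) (pos (suc (suc a)))))
                                                          ≡⟨ cong (λ z → rot (2 * n) (at (Ψraw blk) z)) (rot⁻¹-pos (2 * n) (suc a) (s≤s z≤n)) ⟩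
        rot (2 * n) (at (Ψraw blk) (2 * suc a))           ≡⟨ cong (rot (2 * n)) (at-Ψraw blk (2 * suc a) (s≤s z≤n) (*-monoʳ-≤ 2 (≤-trans (n≤1+n _) j≤n))) ⟩
        rot (2 * n) (ΨpartnerOf blk (2 * suc a))          ≡⟨ cong (rot (2 * n)) (partner-even blk (suc a)) ⟩
        rot (2 * n) (pos (prev blk (cyclicSuc n (suc a)))) ≡⟨ cong (λ z → rot (2 * n) (pos (prev blk z))) (cyclicSuc-< n (suc a) j≤n) ⟩
        rot (2 * n) (pos (prev blk (suc (suc a))))        ≡⟨ rot-pos n _ (proj₁ (prev-inBlock _ (s≤s z≤n) j≤n)) (proj₁ (proj₂ (prev-inBlock _ (s≤s z≤n) j≤n))) ⟩
        2 * prev blk (suc (suc a))                        ∎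

      rotated-partner-even : ∀ j → 1 ≤ j → j ≤ n →
        rot (2 * n) (at (Ψraw blk) (rot⁻¹ (2 * n) (2 * j))) ≡ pos (next blk j)
      rotated-partner-even j 1≤j j≤n = begin
        rot (2 * n) (at (Ψraw blk) (rot⁻¹ (2 * n) (2 * j)))   ≡⟨ cong (λ z → rot (2 * n) (at (Ψraw blk) z)) (rot⁻¹-even (2 * n) j 1≤j) ⟩
        rot (2 * n) (at (Ψraw blk) (pos j))                   ≡⟨ cong (rot (2 * n)) (at-Ψraw blk (pos j) (proj₁ (pos-bounds j 1≤j j≤n)) (proj₂ (pos-bounds j 1≤j j≤n))) ⟩
        rot (2 * n) (ΨpartnerOf blk (pos j))                  ≡⟨ cong (rot (2 * n)) (partner-pos blk j 1≤j) ⟩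
        rot (2 * n) (primePos blk (next blk j))               ≡⟨ rot-primePos blk (next blk j) (proj₁ (next-inBlock j 1≤j j≤n)) (proj₁ (proj₂ (next-inBlock j 1≤j j≤n))) ⟩
        pos (next blk j)                                      ∎

    σRaw-Ψraw : σRaw (Ψraw blk) ≡ Ψraw (ρRaw blk)
    σRaw-Ψraw = at-extensionality _ _ λ p 1≤p p≤2n →
      trans (at-σRaw (Ψraw blk) p (1≤p , p≤2n)) (trans (rotated p 1≤p p≤2n) (sym (at-Ψraw (ρRaw blk) p 1≤p p≤2n)))
      where
      rotated : ∀ p → 1 ≤ p → p ≤ 2 * n → rot (2 * n) (at (Ψraw blk) (rot⁻¹ (2 * n) p)) ≡ ΨpartnerOf (ρRaw blk) p
      rotated p 1≤p p≤2n with pos⊎even p 1≤p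
      ... | inj₁ (j , 1≤j , refl) = begin
        rot (2 * n) (at (Ψraw blk) (rot⁻¹ (2 * n) (pos j)))  ≡⟨ rotated-partner-pos j 1≤j j≤n ⟩
        2 * prev blk j                                       ≡⟨ primePos-cyclicSuc (ρRaw blk) (prev blk j) 1≤h h≤n ⟨
        primePos (ρRaw blk) (cyclicSuc n (prev blk j))       ≡⟨ cong (primePos (ρRaw blk)) (next-ρ j 1≤j j≤n) ⟨
        primePos (ρRaw blk) (next (ρRaw blk) j)              ≡⟨ partner-pos (ρRaw blk) j 1≤j ⟨
        ΨpartnerOf (ρRaw blk) (pos j)                        ∎
        where
        j≤n = pos-bounded n j 1≤j p≤2n
        1≤h = proj₁ (prev-inBlock j 1≤j j≤n)
        h≤n = proj₁ (proj₂ (prev-inBlock j 1≤j j≤n))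
      ... | inj₂ (j , 1≤j , refl) = begin
        rot (2 * n) (at (Ψraw blk) (rot⁻¹ (2 * n) (2 * j)))  ≡⟨ rotated-partner-even j 1≤j j≤n ⟩
        pos (next blk j)                                     ≡⟨ cong pos (prev-ρ j 1≤j j≤n) ⟨
        pos (prev (ρRaw blk) (cyclicSuc n j))                ≡⟨ partner-even (ρRaw blk) j ⟨
        ΨpartnerOf (ρRaw blk) (2 * j)                        ∎
        where j≤n = *-cancelˡ-≤ 2 p≤2n

module FirstGenerator where

  open import Data.Nat using (ℕ; zero; suc; _*_; _≤_; _<_; _≟_; _≡ᵇ_; z≤n; s≤s)
  open import Data.Nat.Properties
  open import Data.Bool using (true; false; if_then_else_)
  open import Data.Vec using (Vec; tabulate)
  open import Data.Fin using (toℕ)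
  open import Data.Product using (_×_; _,_; proj₁; proj₂)
  open import Data.Sum using (_⊎_; inj₁; inj₂)
  open import Relation.Nullary using (yes; no; contradiction)
  open import Function using (_∘_; flip)
  open import Relation.Binary using (tri<; tri≈; tri>)
  open import Relation.Binary.PropositionalEquality
  open Basics
  open Partitions
  open Arches
  open Rotation

  mergeRep : ∀ {n} → Vec ℕ n → ℕ → ℕ
  mergeRep blk x = if at blk x ≡ᵇ at blk 2 then at blk 1 else at blk x

  merged : ∀ {n} → Vec ℕ n → Vec ℕ n
  merged blk = tabulate (λ k → mergeRep blk (suc (toℕ k)))

  f₁Raw-same : ∀ {n} (blk : Vec ℕ n) → (at blk 1 ≡ᵇ at blk 2) ≡ true → f₁Raw blk ≡ (true , blk)
  f₁Raw-same blk eq with at blk 1 ≡ᵇ at blk 2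
  f₁Raw-same blk refl | .true = refl

  f₁Raw-merge : ∀ {n} (blk : Vec ℕ n) → (at blk 1 ≡ᵇ at blk 2) ≡ false → f₁Raw blk ≡ (false , merged blk)
  f₁Raw-merge blk eq with at blk 1 ≡ᵇ at blk 2
  f₁Raw-merge blk refl | .false = refl

  fuse : ℕ → ℕ
  fuse v = if v ≡ᵇ 2 then 1 else v

  In₁₂ : ℕ → Set
  In₁₂ v = v ≡ 1 ⊎ v ≡ 2

  fuse-≢2 : ∀ v → v ≢ 2 → fuse v ≡ v
  fuse-≢2 v v≢2 rewrite ≡ᵇ-false v≢2 = refl

  fuse-In₁₂ : ∀ v → In₁₂ v → fuse v ≡ 1
  fuse-In₁₂ v (inj₁ refl) = refl
  fuse-In₁₂ v (inj₂ refl) = refl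

  fuse≡1 : ∀ v → fuse v ≡ 1 → In₁₂ v
  fuse≡1 v eq with v ≟ 2
  ... | yes v≡2 = inj₂ v≡2
  ... | no v≢2 = inj₁ (trans (sym (fuse-≢2 v v≢2)) eq)

  fuse-cases : ∀ v w → fuse v ≡ fuse w → v ≡ w ⊎ (In₁₂ v × In₁₂ w)
  fuse-cases v w eq with v ≟ 2 | w ≟ 2
  ... | yes refl | yes refl = inj₁ refl
  ... | yes refl | no w≢2 = inj₂ (inj₂ refl , inj₁ (sym (trans eq (fuse-≢2 w w≢2))))
  ... | no v≢2 | yes refl = inj₂ (inj₁ (trans (sym (fuse-≢2 v v≢2)) eq) , inj₂ refl)
  ... | no v≢2 | no w≢2 = inj₁ (trans (sym (fuse-≢2 v v≢2)) (trans eq (fuse-≢2 w w≢2)))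

  In₁₂? : ∀ v → In₁₂ v ⊎ (v ≢ 1 × v ≢ 2)
  In₁₂? v with v ≟ 1 | v ≟ 2
  ... | yes v≡1 | _        = inj₁ (inj₁ v≡1)
  ... | no _    | yes v≡2  = inj₁ (inj₂ v≡2)
  ... | no v≢1  | no v≢2   = inj₂ (v≢1 , v≢2)

  module Merge {n : ℕ} (blk : Vec ℕ n) (part : IsSetPartitionℕ blk) (nc : IsNonCrossingℕ blk)
               (2≤n : 2 ≤ n) (1≁2 : at blk 1 ≢ at blk 2) where
    open BlockStructure blk part

    1≤n : 1 ≤ n
    1≤n = ≤-trans (s≤s z≤n) 2≤n

    rep2≡2 : rep 2 ≡ 2
    rep2≡2 with m≤n⇒m<n∨m≡n (rep≤ 2 (s≤s z≤n) 2≤n)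
    ... | inj₂ rep2≡2 = rep2≡2
    ... | inj₁ (s≤s rep2≤1) with m≤n⇒m<n∨m≡n rep2≤1
    ...   | inj₂ rep2≡1 = contradiction (trans (rep1≡1 1≤n) (sym rep2≡1)) 1≁2
    ...   | inj₁ (s≤s rep2≤0) = contradiction rep2≤0 (<⇒≱ (rep≥1 2 (s≤s z≤n) 2≤n))

    rep′ : ℕ → ℕ
    rep′ = at (merged blk)

    rep′≡fuse : ∀ x → 1 ≤ x → x ≤ n → rep′ x ≡ fuse (rep x)
    rep′≡fuse x 1≤x x≤n rewrite at-tabulate (mergeRep blk) x 1≤x x≤n | rep2≡2 | rep1≡1 1≤n = refl

    rep′≡1 : ∀ x → 1 ≤ x → x ≤ n → In₁₂ (rep x) → rep′ x ≡ 1
    rep′≡1 x 1≤x x≤n in₁₂ = trans (rep′≡fuse x 1≤x x≤n) (fuse-In₁₂ (rep x) in₁₂)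

    rep′≡1⁻¹ : ∀ x → 1 ≤ x → x ≤ n → rep′ x ≡ 1 → In₁₂ (rep x)
    rep′≡1⁻¹ x 1≤x x≤n eq = fuse≡1 (rep x) (trans (sym (rep′≡fuse x 1≤x x≤n)) eq)

    merged-isSetPartition : IsSetPartitionℕ (merged blk)
    merged-isSetPartition x 1≤x x≤n with rep x ≟ 2
    ... | yes rep≡2 rewrite trans (rep′≡fuse x 1≤x x≤n) (cong fuse rep≡2) =
      ≤-refl , 1≤x , trans (rep′≡fuse 1 ≤-refl 1≤n) (cong fuse (rep1≡1 1≤n))
    ... | no rep≢2 rewrite trans (rep′≡fuse x 1≤x x≤n) (fuse-≢2 (rep x) rep≢2) =
      rep≥1 x 1≤x x≤n , rep≤ x 1≤x x≤n ,
      trans (rep′≡fuse (rep x) (rep≥1 x 1≤x x≤n) (rep≤n x 1≤x x≤n)) (trans (cong fuse (rep-idem x 1≤x x≤n)) (fuse-≢2 (rep x) rep≢2))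

    outside₁₂⇒>2 : ∀ x → 1 ≤ x → x ≤ n → rep x ≢ 1 → rep x ≢ 2 → 2 < x
    outside₁₂⇒>2 (suc zero)          _ _ rep≢1 _     = contradiction (rep1≡1 1≤n) rep≢1
    outside₁₂⇒>2 (suc (suc zero))    _ _ _     rep≢2 = contradiction rep2≡2 rep≢2
    outside₁₂⇒>2 (suc (suc (suc x))) _ _ _     _     = s≤s (s≤s (s≤s z≤n))

    crossing-In₁₂ : ∀ y k l → 2 < y → y < k → k < l → l ≤ n → In₁₂ (rep k) → rep y ≡ rep l → In₁₂ (rep y)
    crossing-In₁₂ y k l 2<y y<k k<l l≤n (inj₁ rk≡1) y~l =
      inj₁ (trans (sym (nc 1 y k l ≤-refl l≤n (<-trans (s≤s (s≤s z≤n)) 2<y) y<k k<l (trans (rep1≡1 1≤n) (sym rk≡1)) y~l))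
                  (rep1≡1 1≤n))
    crossing-In₁₂ y k l 2<y y<k k<l l≤n (inj₂ rk≡2) y~l =
      inj₂ (trans (sym (nc 2 y k l (s≤s z≤n) l≤n 2<y y<k k<l (trans rep2≡2 (sym rk≡2)) y~l)) rep2≡2)

    merged-isNonCrossing : IsNonCrossingℕ (merged blk)
    merged-isNonCrossing i j k l 1≤i l≤n i<j j<k k<l i~′k j~′l =
      trans (rep′≡fuse i 1≤i i≤n) (trans (fused (fuse-cases (rep i) (rep k) fik) (fuse-cases (rep j) (rep l) fjl))
                                          (sym (rep′≡fuse j 1≤j j≤n)))
      where
      1≤j = ≤-trans 1≤i (<⇒≤ i<j)
      1≤k = ≤-trans 1≤j (<⇒≤ j<k)
      1≤l = ≤-trans 1≤k (<⇒≤ k<l)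
      k≤n = ≤-trans (<⇒≤ k<l) l≤n
      j≤n = ≤-trans (<⇒≤ j<k) k≤n
      i≤n = ≤-trans (<⇒≤ i<j) j≤n
      fik = trans (sym (rep′≡fuse i 1≤i i≤n)) (trans i~′k (rep′≡fuse k 1≤k k≤n))
      fjl = trans (sym (rep′≡fuse j 1≤j j≤n)) (trans j~′l (rep′≡fuse l 1≤l l≤n))
      both : In₁₂ (rep i) → In₁₂ (rep j) → fuse (rep i) ≡ fuse (rep j)
      both i₁₂ j₁₂ = trans (fuse-In₁₂ (rep i) i₁₂) (sym (fuse-In₁₂ (rep j) j₁₂))
      fused : rep i ≡ rep k ⊎ (In₁₂ (rep i) × In₁₂ (rep k)) → rep j ≡ rep l ⊎ (In₁₂ (rep j) × In₁₂ (rep l)) →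
              fuse (rep i) ≡ fuse (rep j)
      fused (inj₁ i~k) (inj₁ j~l) = cong fuse (nc i j k l 1≤i l≤n i<j j<k k<l i~k j~l)
      fused (inj₂ (i₁₂ , _)) (inj₂ (j₁₂ , _)) = both i₁₂ j₁₂
      fused (inj₂ (i₁₂ , k₁₂)) (inj₁ j~l) with In₁₂? (rep j)
      ... | inj₁ j₁₂ = both i₁₂ j₁₂
      ... | inj₂ (j≢1 , j≢2) =
        both i₁₂ (crossing-In₁₂ j k l (outside₁₂⇒>2 j 1≤j j≤n j≢1 j≢2) j<k k<l l≤n k₁₂ j~l)
      fused (inj₁ i~k) (inj₂ (j₁₂ , _)) with In₁₂? (rep i)
      ... | inj₁ i₁₂ = both i₁₂ j₁₂
      ... | inj₂ (i≢1 , i≢2) =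
        both (crossing-In₁₂ i j k (outside₁₂⇒>2 i 1≤i i≤n i≢1 i≢2) i<j j<k k≤n j₁₂ i~k) j₁₂

    module B′ = BlockStructure (merged blk) merged-isSetPartition

    last₂ : ℕ
    last₂ = prev blk 2

    last₂-spec : 2 ≤ last₂ × last₂ ≤ n × rep last₂ ≡ 2 × (∀ z → last₂ < z → z ≤ n → rep z ≢ 2)
    last₂-spec with prevView 2 (s≤s z≤n) 2≤n
    ... | prev-earlier h h<2 1≤h same _ _ with m≤n⇒m<n∨m≡n 1≤h
    ...   | inj₁ 1<h  = contradiction 1<h (<⇒≱ h<2)
    ...   | inj₂ refl = contradiction same 1≁2
    last₂-spec | prev-wraps _ M 2≤M M≤n same none-after eq rewrite eq =
      2≤M , M≤n , trans same rep2≡2 , λ z M<z z≤n′ rz≡2 → none-after z M<z z≤n′ (trans rz≡2 (sym rep2≡2))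

    block₂<block₁ : ∀ z x → 1 ≤ z → z ≤ n → x ≤ n → rep z ≡ 2 → rep x ≡ 1 → 1 < x → z < x
    block₂<block₁ z x 1≤z z≤n′ x≤n rz≡2 rx≡1 1<x with nextView 1
    ... | next-wraps none-after _ = contradiction (trans (rep1≡1 1≤n) (sym rx≡1)) (none-after x 1<x x≤n)
    ... | next-later j 1<j j≤n same none-between _ = <-≤-trans z<j j≤x
      where
      2<j : 2 < j
      2<j with m≤n⇒m<n∨m≡n 1<j
      ... | inj₁ 2<j = 2<j
      ... | inj₂ refl = contradiction same 1≁2
      z<j : z < j
      z<j with <-cmp z j
      ... | tri< z<j _ _ = z<j
      ... | tri≈ _ refl _ = contradiction (trans same (trans rz≡2 (sym rep2≡2))) 1≁2
      ... | tri> _ _ j<z = contradiction (nc 1 2 j z ≤-refl z≤n′ (s≤s ≤-refl) 2<j j<z same (trans rep2≡2 (sym rz≡2))) 1≁2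
      j≤x : j ≤ x
      j≤x with ≤-<-connex j x
      ... | inj₁ j≤x = j≤x
      ... | inj₂ x<j = contradiction (trans (rep1≡1 1≤n) (sym rx≡1)) (none-between x 1<x x<j)

    next′-1 : next (merged blk) 1 ≡ 2
    next′-1 = B′.next-later-is 1 2 ≤-refl 2≤n
      (trans (rep′≡1 1 ≤-refl 1≤n (inj₁ (rep1≡1 1≤n))) (sym (rep′≡1 2 (s≤s z≤n) 2≤n (inj₂ rep2≡2))))
      (λ z 1<z z<2 _ → <⇒≱ z<2 1<z)

    next′-last₂ : next (merged blk) last₂ ≡ next blk 1
    next′-last₂ with last₂-spec
    ... | 2≤q , q≤n , rq≡2 , after₂ with nextView 1
    ...   | next-later j 1<j j≤n same none-between eq =
      trans (B′.next-later-is last₂ j q<j j≤n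
              (trans rq′≡1 (sym (rep′≡1 j (<⇒≤ 1<j) j≤n (inj₁ (trans (sym same) (rep1≡1 1≤n)))))) between)
            (sym eq)
      where
      1≤q = ≤-trans (s≤s z≤n) 2≤q
      rq′≡1 = rep′≡1 last₂ 1≤q q≤n (inj₂ rq≡2)
      q<j = block₂<block₁ last₂ j 1≤q q≤n j≤n rq≡2 (trans (sym same) (rep1≡1 1≤n)) 1<j
      between : ∀ z → last₂ < z → z < j → rep′ last₂ ≢ rep′ z
      between z q<z z<j eq′ with rep′≡1⁻¹ z (≤-trans 1≤q (<⇒≤ q<z)) (≤-trans (<⇒≤ z<j) j≤n) (trans (sym eq′) rq′≡1)
      ... | inj₁ rz≡1 = none-between z (≤-trans 2≤q (<⇒≤ q<z)) z<j (trans (rep1≡1 1≤n) (sym rz≡1))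
      ... | inj₂ rz≡2 = after₂ z q<z (≤-trans (<⇒≤ z<j) j≤n) rz≡2
    ...   | next-wraps none-after eq =
      trans (B′.next-wraps-is last₂ after) (trans rq′≡1 (trans (sym (rep1≡1 1≤n)) (sym eq)))
      where
      1≤q = ≤-trans (s≤s z≤n) 2≤q
      rq′≡1 = rep′≡1 last₂ 1≤q q≤n (inj₂ rq≡2)
      after : ∀ z → last₂ < z → z ≤ n → rep′ last₂ ≢ rep′ z
      after z q<z z≤n′ eq′ with rep′≡1⁻¹ z (≤-trans 1≤q (<⇒≤ q<z)) z≤n′ (trans (sym eq′) rq′≡1)
      ... | inj₁ rz≡1 = none-after z (≤-trans 2≤q (<⇒≤ q<z)) z≤n′ (trans (rep1≡1 1≤n) (sym rz≡1))
      ... | inj₂ rz≡2 = after₂ z q<z z≤n′ rz≡2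


    private
      next′-outside₁₂ : ∀ x → 1 ≤ x → x ≤ n → rep x ≢ 1 → rep x ≢ 2 → next (merged blk) x ≡ next blk x
      next′-outside₁₂ x 1≤x x≤n rx≢1 rx≢2 = transfer (nextView x)
        where
        rx′≡rx : rep′ x ≡ rep x
        rx′≡rx = trans (rep′≡fuse x 1≤x x≤n) (fuse-≢2 (rep x) rx≢2)
        unfuse : ∀ z → 1 ≤ z → z ≤ n → rep′ x ≡ rep′ z → rep x ≡ rep z
        unfuse z 1≤z z≤n′ eq with fuse-cases (rep x) (rep z) (trans (sym (rep′≡fuse x 1≤x x≤n)) (trans eq (rep′≡fuse z 1≤z z≤n′)))
        ... | inj₁ x~z = x~z
        ... | inj₂ (inj₁ rx≡1 , _) = contradiction rx≡1 rx≢1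
        ... | inj₂ (inj₂ rx≡2 , _) = contradiction rx≡2 rx≢2
        transfer : NextView x → next (merged blk) x ≡ next blk x
        transfer (next-later j x<j j≤n same none-between eq) =
          trans (B′.next-later-is x j x<j j≤n
                  (trans (rep′≡fuse x 1≤x x≤n) (trans (cong fuse same) (sym (rep′≡fuse j (≤-trans 1≤x (<⇒≤ x<j)) j≤n))))
                  (λ z x<z z<j eq′ → none-between z x<z z<j (unfuse z (≤-trans 1≤x (<⇒≤ x<z)) (≤-trans (<⇒≤ z<j) j≤n) eq′)))
                (sym eq)
        transfer (next-wraps none-after eq) =
          trans (B′.next-wraps-is x (λ z x<z z≤n′ eq′ → none-after z x<z z≤n′ (unfuse z (≤-trans 1≤x (<⇒≤ x<z)) z≤n′ eq′)))
                (trans rx′≡rx (sym eq))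

      next′-block₁ : ∀ x → 1 < x → x ≤ n → rep x ≡ 1 → next (merged blk) x ≡ next blk x
      next′-block₁ x 1<x x≤n rx≡1 = transfer (nextView x)
        where
        1≤x = <⇒≤ 1<x
        rx′≡1 = rep′≡1 x 1≤x x≤n (inj₁ rx≡1)
        transfer : NextView x → next (merged blk) x ≡ next blk x
        transfer (next-later j x<j j≤n same none-between eq) =
          trans (B′.next-later-is x j x<j j≤n
                  (trans rx′≡1 (sym (rep′≡1 j (≤-trans 1≤x (<⇒≤ x<j)) j≤n (inj₁ (trans (sym same) rx≡1))))) between)
                (sym eq)
          where
          between : ∀ z → x < z → z < j → rep′ x ≢ rep′ z
          between z x<z z<j eq′ with rep′≡1⁻¹ z (≤-trans 1≤x (<⇒≤ x<z)) (≤-trans (<⇒≤ z<j) j≤n) (trans (sym eq′) rx′≡1)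
          ... | inj₁ rz≡1 = none-between z x<z z<j (trans rx≡1 (sym rz≡1))
          ... | inj₂ rz≡2 = <-asym x<z (block₂<block₁ z x (≤-trans 1≤x (<⇒≤ x<z)) (≤-trans (<⇒≤ z<j) j≤n) x≤n rz≡2 rx≡1 1<x)
        transfer (next-wraps none-after eq) =
          trans (B′.next-wraps-is x after) (trans rx′≡1 (trans (sym rx≡1) (sym eq)))
          where
          after : ∀ z → x < z → z ≤ n → rep′ x ≢ rep′ z
          after z x<z z≤n′ eq′ with rep′≡1⁻¹ z (≤-trans 1≤x (<⇒≤ x<z)) z≤n′ (trans (sym eq′) rx′≡1)
          ... | inj₁ rz≡1 = none-after z x<z z≤n′ (trans rx≡1 (sym rz≡1))
          ... | inj₂ rz≡2 = <-asym x<z (block₂<block₁ z x (≤-trans 1≤x (<⇒≤ x<z)) z≤n′ x≤n rz≡2 rx≡1 1<x)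

      next′-block₂ : ∀ x → 1 < x → x ≤ n → x ≢ last₂ → rep x ≡ 2 → next (merged blk) x ≡ next blk x
      next′-block₂ x 1<x x≤n x≢q rx≡2 = transfer (nextView x)
        where
        1≤x = <⇒≤ 1<x
        rx′≡1 = rep′≡1 x 1≤x x≤n (inj₂ rx≡2)
        transfer : NextView x → next (merged blk) x ≡ next blk x
        transfer (next-later j x<j j≤n same none-between eq) =
          trans (B′.next-later-is x j x<j j≤n
                  (trans rx′≡1 (sym (rep′≡1 j (≤-trans 1≤x (<⇒≤ x<j)) j≤n (inj₂ (trans (sym same) rx≡2))))) between)
                (sym eq)
          where
          between : ∀ z → x < z → z < j → rep′ x ≢ rep′ z
          between z x<z z<j eq′ with rep′≡1⁻¹ z (≤-trans 1≤x (<⇒≤ x<z)) (≤-trans (<⇒≤ z<j) j≤n) (trans (sym eq′) rx′≡1)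
          ... | inj₂ rz≡2 = none-between z x<z z<j (trans rx≡2 (sym rz≡2))
          ... | inj₁ rz≡1 = 1≁2 (trans (nc 1 x z j ≤-refl j≤n 1<x x<z z<j (trans (rep1≡1 1≤n) (sym rz≡1)) same)
                                       (trans rx≡2 (sym rep2≡2)))
        transfer (next-wraps none-after _) with last₂-spec
        ... | _ , q≤n , rq≡2 , after₂ with <-cmp x last₂
        ...   | tri≈ _ x≡q _ = contradiction x≡q x≢q
        ...   | tri< x<q _ _ = contradiction (trans rx≡2 (sym rq≡2)) (none-after last₂ x<q q≤n)
        ...   | tri> _ _ q<x = contradiction rx≡2 (after₂ x q<x x≤n)

    next′-other : ∀ x → 1 ≤ x → x ≤ n → x ≢ 1 → x ≢ last₂ → next (merged blk) x ≡ next blk x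
    next′-other x 1≤x x≤n x≢1 x≢q with In₁₂? (rep x)
    ... | inj₂ (rx≢1 , rx≢2) = next′-outside₁₂ x 1≤x x≤n rx≢1 rx≢2
    ... | inj₁ x₁₂ with m≤n⇒m<n∨m≡n 1≤x
    ...   | inj₂ 1≡x = contradiction (sym 1≡x) x≢1
    ...   | inj₁ 1<x with x₁₂
    ...     | inj₁ rx≡1 = next′-block₁ x 1<x x≤n rx≡1
    ...     | inj₂ rx≡2 = next′-block₂ x 1<x x≤n x≢q rx≡2

    module A = ArchStructure blk part nc
    module A′ = ArchStructure (merged blk) merged-isSetPartition merged-isNonCrossing

    private
      Ψπ : Vec ℕ (2 * n)
      Ψπ = Ψraw blk

      q = last₂
      1≤q = ≤-trans (s≤s z≤n) (proj₁ last₂-spec)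
      q≤n = proj₁ (proj₂ last₂-spec)
      2≤2n = *-monoʳ-≤ 2 1≤n

      primePos-merged : ∀ x → primePos blk x ≡ primePos (merged blk) x
      primePos-merged zero          = refl
      primePos-merged (suc zero)    = refl
      primePos-merged (suc (suc x)) = refl

      Ψπ-1 : at Ψπ 1 ≡ A.archEnd 1
      Ψπ-1 = trans (at-Ψraw blk 1 ≤-refl (≤-trans 1≤n (m≤n*m n 2))) (partner-pos blk 1 ≤-refl)

      Ψπ-2 : at Ψπ 2 ≡ pos q
      Ψπ-2 = trans (at-Ψraw blk 2 (s≤s z≤n) 2≤2n)
                  (trans (partner-even blk 1) (cong (pos ∘ prev blk) (cyclicSuc-< n 1 2≤n)))

      archEnd′≡ : ∀ x → 1 ≤ x → x ≤ n → x ≢ 1 → x ≢ q → A′.archEnd x ≡ A.archEnd x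
      archEnd′≡ x 1≤x x≤n x≢1 x≢q =
        trans (cong (primePos (merged blk)) (next′-other x 1≤x x≤n x≢1 x≢q)) (sym (primePos-merged (next blk x)))

      archEnd′-q : A′.archEnd q ≡ A.archEnd 1
      archEnd′-q = trans (cong (primePos (merged blk)) next′-last₂) (sym (primePos-merged (next blk 1)))

      archEnd≢1 : ∀ x → 1 ≤ x → x ≤ n → A.archEnd x ≢ 1
      archEnd≢1 x 1≤x x≤n eq with primePos-even blk (next blk x) (proj₁ (A.next-inBlock x 1≤x x≤n)) (proj₁ (proj₂ (A.next-inBlock x 1≤x x≤n)))
      ... | c , 1≤c , end≡ = contradiction (trans (sym end≡) eq) (λ 2c≡1 → <-irrefl (sym 2c≡1) (*-monoʳ-≤ 2 1≤c))

      archEnd-q≡2 : A.archEnd q ≡ 2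
      archEnd-q≡2 = cong (primePos blk) (A.next-prev 2 (s≤s z≤n) 2≤n)

      pos≢Ψπ-1 : ∀ x → 1 ≤ x → pos x ≢ at Ψπ 1
      pos≢Ψπ-1 x 1≤x eq = A.pos≢archEnd x 1 1≤x ≤-refl 1≤n (trans eq Ψπ-1)

    rewired-pos : ∀ x → 1 ≤ x → x ≤ n → rewired 1 Ψπ (pos x) ≡ ΨpartnerOf (merged blk) (pos x)
    rewired-pos x 1≤x x≤n with x ≟ 1 | x ≟ q
    ... | yes refl | _ = trans (rewired-i 1 Ψπ refl)
                               (sym (trans (partner-pos (merged blk) 1 ≤-refl) (cong (primePos (merged blk)) next′-1)))
    ... | no x≢1 | yes refl = trans
      (rewired-partner-i+1 1 Ψπ (x≢1 ∘ pos-injective q 1 1≤q ≤-refl) (pos≢even q 1 1≤q) (pos≢Ψπ-1 q 1≤q) (sym Ψπ-2))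
      (trans Ψπ-1 (sym (trans (partner-pos (merged blk) q 1≤q) archEnd′-q)))
    ... | no x≢1 | no x≢q = trans
      (rewired-elsewhere 1 Ψπ (x≢1 ∘ pos-injective x 1 1≤x ≤-refl) (pos≢even x 1 1≤x) (pos≢Ψπ-1 x 1≤x)
                         (x≢q ∘ pos-injective x q 1≤x 1≤q ∘ flip trans Ψπ-2))
      (trans (at-Ψraw blk (pos x) (proj₁ (pos-bounds x 1≤x x≤n)) (proj₂ (pos-bounds x 1≤x x≤n)))
             (trans (partner-pos blk x 1≤x) (sym (trans (partner-pos (merged blk) x 1≤x) (archEnd′≡ x 1≤x x≤n x≢1 x≢q)))))

    rewired-archEnd : ∀ x → 1 ≤ x → x ≤ n → rewired 1 Ψπ (A′.archEnd x) ≡ ΨpartnerOf (merged blk) (A′.archEnd x)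
    rewired-archEnd x 1≤x x≤n with x ≟ 1 | x ≟ q
    ... | yes refl | _ = begin
      rewired 1 Ψπ (A′.archEnd 1)           ≡⟨ cong (rewired 1 Ψπ ∘ primePos (merged blk)) next′-1 ⟩
      rewired 1 Ψπ 2                        ≡⟨ rewired-i+1 1 Ψπ (λ ()) refl ⟩
      1                                     ≡⟨ A′.partner-archEnd 1 ≤-refl 1≤n ⟨
      ΨpartnerOf (merged blk) (A′.archEnd 1) ∎
      where open ≡-Reasoning
    ... | no x≢1 | yes refl = begin
      rewired 1 Ψπ (A′.archEnd q)           ≡⟨ cong (rewired 1 Ψπ) archEnd′-q ⟩
      rewired 1 Ψπ (A.archEnd 1)            ≡⟨ rewired-partner-i 1 Ψπ (archEnd≢1 1 ≤-refl 1≤n) end₁≢2 (sym Ψπ-1) ⟩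
      at Ψπ 2                               ≡⟨ Ψπ-2 ⟩
      pos q                                 ≡⟨ A′.partner-archEnd q 1≤q q≤n ⟨
      ΨpartnerOf (merged blk) (A′.archEnd q) ∎
      where
      open ≡-Reasoning
      end₁≢2 : A.archEnd 1 ≢ 2
      end₁≢2 eq = x≢1 (sym (A.archEnd-injective 1 q ≤-refl 1≤n 1≤q q≤n (trans eq (sym archEnd-q≡2))))
    ... | no x≢1 | no x≢q = begin
      rewired 1 Ψπ (A′.archEnd x)           ≡⟨ cong (rewired 1 Ψπ) (archEnd′≡ x 1≤x x≤n x≢1 x≢q) ⟩
      rewired 1 Ψπ (A.archEnd x)            ≡⟨ rewired-elsewhere 1 Ψπ (archEnd≢1 x 1≤x x≤n) end≢2 end≢Ψ1 end≢Ψ2 ⟩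
      at Ψπ (A.archEnd x)                   ≡⟨ at-Ψraw blk (A.archEnd x) (proj₁ (A.archEnd-bounds x 1≤x x≤n)) (proj₂ (A.archEnd-bounds x 1≤x x≤n)) ⟩
      ΨpartnerOf blk (A.archEnd x)          ≡⟨ A.partner-archEnd x 1≤x x≤n ⟩
      pos x                                 ≡⟨ A′.partner-archEnd x 1≤x x≤n ⟨
      ΨpartnerOf (merged blk) (A′.archEnd x) ∎
      where
      open ≡-Reasoning
      end≢2 : A.archEnd x ≢ 2
      end≢2 eq = x≢q (A.archEnd-injective x q 1≤x x≤n 1≤q q≤n (trans eq (sym archEnd-q≡2)))
      end≢Ψ1 : A.archEnd x ≢ at Ψπ 1
      end≢Ψ1 eq = x≢1 (A.archEnd-injective x 1 1≤x x≤n ≤-refl 1≤n (trans eq Ψπ-1))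
      end≢Ψ2 : A.archEnd x ≢ at Ψπ 2
      end≢Ψ2 eq = A.pos≢archEnd q x 1≤q 1≤x x≤n (sym (trans eq Ψπ-2))

    eRaw₁-merge : eRaw 1 (Ψraw blk) ≡ (false , Ψraw (merged blk))
    eRaw₁-merge = trans (eRaw-rewire 1 Ψπ (≡ᵇ-false Ψπ-1≢2)) (cong (false ,_) (at-extensionality _ _ λ p 1≤p p≤2n →
      trans (at-tabulate (rewired 1 Ψπ) p 1≤p p≤2n) (trans (rewired-at p 1≤p p≤2n) (sym (at-Ψraw (merged blk) p 1≤p p≤2n)))))
      where
      Ψπ-1≢2 : at Ψπ 1 ≢ 2
      Ψπ-1≢2 eq = contradiction (A.archEnd-injective 1 q ≤-refl 1≤n 1≤q q≤n (trans (sym Ψπ-1) (trans eq (sym archEnd-q≡2))))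
                                (λ 1≡q → <-irrefl 1≡q (proj₁ last₂-spec))
      rewired-at : ∀ p → 1 ≤ p → p ≤ 2 * n → rewired 1 Ψπ p ≡ ΨpartnerOf (merged blk) p
      rewired-at p 1≤p p≤2n with A′.position-cover p 1≤p p≤2n
      ... | x , 1≤x , x≤n , inj₁ refl = rewired-pos x 1≤x x≤n
      ... | x , 1≤x , x≤n , inj₂ refl = rewired-archEnd x 1≤x x≤n

  Ψraw-1≡2 : ∀ {n} (blk : Vec ℕ n) → IsSetPartitionℕ blk → 2 ≤ n → at blk 1 ≡ at blk 2 → at (Ψraw blk) 1 ≡ 2
  Ψraw-1≡2 {n} blk part 2≤n 1~2 = begin
    at (Ψraw blk) 1               ≡⟨ at-Ψraw blk 1 ≤-refl (≤-trans 1≤n (m≤n*m n 2)) ⟩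
    ΨpartnerOf blk (pos 1)        ≡⟨ partner-pos blk 1 ≤-refl ⟩
    primePos blk (next blk 1)     ≡⟨ cong (primePos blk) (next-later-is 1 2 ≤-refl 2≤n 1~2 (λ z 1<z z<2 _ → <⇒≱ z<2 1<z)) ⟩
    2                             ∎
    where
    open ≡-Reasoning
    open BlockStructure blk part
    1≤n = ≤-trans (s≤s z≤n) 2≤n

  Ψraw-f₁Raw : ∀ {n} (blk : Vec ℕ n) → IsSetPartitionℕ blk → IsNonCrossingℕ blk → 2 ≤ n →
    eRaw 1 (Ψraw blk) ≡ (proj₁ (f₁Raw blk) , Ψraw (proj₂ (f₁Raw blk))) ×
    IsSetPartitionℕ (proj₂ (f₁Raw blk)) × IsNonCrossingℕ (proj₂ (f₁Raw blk))
  Ψraw-f₁Raw blk part nc 2≤n with at blk 1 ≟ at blk 2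
  ... | yes 1~2 rewrite f₁Raw-same blk (≡ᵇ-true 1~2) =
    eRaw-loop 1 (Ψraw blk) (≡ᵇ-true (Ψraw-1≡2 blk part 2≤n 1~2)) , part , nc
  ... | no 1≁2 rewrite f₁Raw-merge blk (≡ᵇ-false 1≁2) =
    eRaw₁-merge , merged-isSetPartition , merged-isNonCrossing
    where open Merge blk part nc 2≤n 1≁2

module KrewerasInverse where

  open import Data.Nat using (ℕ; zero; suc; _*_; _∸_; _≤_)
  open import Data.Nat.GeneralisedArithmetic using (fold)
  open import Data.Vec using (Vec)
  open import Data.Product using (_×_; _,_; proj₁; proj₂)
  open import Relation.Binary.PropositionalEquality
  open Basics
  open Partitions
  open Arches
  open KrewerasComplement
  open Rotation
  open RotationIsKreweras

  private variable
    n : ℕ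

  ρRaw-isNC : (b : Vec ℕ n) → IsSetPartitionℕ (ρRaw b) × IsNonCrossingℕ (ρRaw b)
  ρRaw-isNC b = ρRaw-isSetPartition , ρRaw-isNonCrossing
    where open KrewerasRegions b

  ρRaw^-isNC : ∀ k (b : Vec ℕ n) → IsSetPartitionℕ b → IsNonCrossingℕ b →
    IsSetPartitionℕ (fold b ρRaw k) × IsNonCrossingℕ (fold b ρRaw k)
  ρRaw^-isNC zero    b part nc = part , nc
  ρRaw^-isNC (suc k) b part nc = ρRaw-isNC (fold b ρRaw k)

  Ψraw-preservesRange : (b : Vec ℕ n) → IsSetPartitionℕ b → IsNonCrossingℕ b → PreservesRange (Ψraw b)
  Ψraw-preservesRange {n} b part nc p (1≤p , p≤2n) =
    let matched = All[1‥]⇒∀ {P = λ p → 1 ≤ at (Ψraw b) p × at (Ψraw b) p ≤ 2 * n × at (Ψraw b) p ≢ p ×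
                                        at (Ψraw b) (at (Ψraw b) p) ≡ p}
                            (proj₁ (ArchStructure.Ψraw-isCD b part nc)) p 1≤p p≤2n
    in proj₁ matched , proj₁ (proj₂ matched)

  Ψraw-ρRaw^ : ∀ k (b : Vec ℕ n) → IsSetPartitionℕ b → IsNonCrossingℕ b → Ψraw (fold b ρRaw k) ≡ fold (Ψraw b) σRaw k
  Ψraw-ρRaw^ zero    b part nc = refl
  Ψraw-ρRaw^ (suc k) b part nc = trans (sym (σRaw-Ψraw (fold b ρRaw k) part′ nc′)) (cong σRaw (Ψraw-ρRaw^ k b part nc))
    where
    part′ = proj₁ (ρRaw^-isNC k b part nc)
    nc′ = proj₂ (ρRaw^-isNC k b part nc)

  -- σ has order 2n on matchings and Ψ is injective, so ρ has order dividing 2n.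
  ρRaw^2n≡id : (b : Vec ℕ n) → IsSetPartitionℕ b → IsNonCrossingℕ b → fold b ρRaw (2 * n) ≡ b
  ρRaw^2n≡id {n} b part nc = Ψraw-injective _ b (proj₁ (ρRaw^-isNC (2 * n) b part nc)) part
    (trans (Ψraw-ρRaw^ (2 * n) b part nc) (σRaw^m≡id (Ψraw b) (Ψraw-preservesRange b part nc)))

  ρ⁻¹Raw : Vec ℕ n → Vec ℕ n
  ρ⁻¹Raw {n} b = fold b ρRaw (2 * n ∸ 1)

  ρRaw-ρ⁻¹Raw : 1 ≤ n → (b : Vec ℕ n) → IsSetPartitionℕ b → IsNonCrossingℕ b → ρRaw (ρ⁻¹Raw b) ≡ b
  ρRaw-ρ⁻¹Raw {suc n} _ b part nc = ρRaw^2n≡id b part nc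

  ρ⁻¹Raw-ρRaw : 1 ≤ n → (b : Vec ℕ n) → IsSetPartitionℕ b → IsNonCrossingℕ b → ρ⁻¹Raw (ρRaw b) ≡ b
  ρ⁻¹Raw-ρRaw {n} 1≤n b part nc = trans (fold-step ρRaw b (2 * n ∸ 1)) (ρRaw-ρ⁻¹Raw 1≤n b part nc)

  ρ⁻¹Raw-isNC : (b : Vec ℕ n) → IsSetPartitionℕ b → IsNonCrossingℕ b →
    IsSetPartitionℕ (ρ⁻¹Raw b) × IsNonCrossingℕ (ρ⁻¹Raw b)
  ρ⁻¹Raw-isNC {n} = ρRaw^-isNC (2 * n ∸ 1)

module Sums {c ℓ} (R : CommutativeRing c ℓ) where

  open import Data.Nat using (ℕ; zero; suc; _≤_; _<_; z≤n; s≤s) renaming (_+_ to _+ℕ_)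
  import Data.Nat.Properties as ℕₚ
  open ℕₚ using (≤-refl; <⇒≤; <⇒≱; <-irrefl; m≤n⇒m<n∨m≡n)
  open import Data.Bool.Properties using (T-irrelevant)
  open import Data.Vec using (Vec; []; _∷_)
  open import Data.Vec.Properties using (∷-injectiveˡ; ∷-injectiveʳ)
  open import Data.List using (List; []; _∷_; map; foldr; _++_; concatMap)
  open import Data.Product using (Σ; _×_; _,_; proj₁; proj₂)
  open import Data.Sum using (inj₁; inj₂)
  open import Relation.Nullary using (Dec; yes; no; contradiction)
  open import Function using (_∘_)
  open import Relation.Nullary.Decidable using (True; toWitness; fromWitness)
  import Relation.Binary.PropositionalEquality as ≡
  open ≡ using (_≡_; _≢_)
  open Basics using (ascending; [1‥n]≡ascending)

  open CommutativeRing R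
  open import Relation.Binary.Reasoning.Setoid setoid

  sumOver : ∀ {B : Set} → List B → (B → Carrier) → Carrier
  sumOver L f = foldr _+_ 0# (map f L)

  ≡⇒≈ : ∀ {x y} → x ≡ y → x ≈ y
  ≡⇒≈ ≡.refl = refl

  module _ {B : Set} where

    sumOver-cong : ∀ (L : List B) {f g : B → Carrier} → (∀ x → f x ≈ g x) → sumOver L f ≈ sumOver L g
    sumOver-cong []      f≈g = refl
    sumOver-cong (x ∷ L) f≈g = +-cong (f≈g x) (sumOver-cong L f≈g)

    sumOver-zero : ∀ (L : List B) {f : B → Carrier} → (∀ x → f x ≈ 0#) → sumOver L f ≈ 0#
    sumOver-zero []      f≈0 = refl
    sumOver-zero (x ∷ L) f≈0 = trans (+-cong (f≈0 x) (sumOver-zero L f≈0)) (+-identityˡ 0#)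

    sumOver-+ : ∀ (L : List B) (f g : B → Carrier) → sumOver L (λ x → f x + g x) ≈ sumOver L f + sumOver L g
    sumOver-+ []      f g = sym (+-identityˡ 0#)
    sumOver-+ (x ∷ L) f g = begin
      (f x + g x) + sumOver L (λ x → f x + g x)   ≈⟨ +-cong refl (sumOver-+ L f g) ⟩
      (f x + g x) + (sumOver L f + sumOver L g)   ≈⟨ +-assoc (f x) (g x) _ ⟩
      f x + (g x + (sumOver L f + sumOver L g))   ≈⟨ +-cong refl (+-assoc (g x) _ _) ⟨
      f x + ((g x + sumOver L f) + sumOver L g)   ≈⟨ +-cong refl (+-cong (+-comm (g x) _) refl) ⟩
      f x + ((sumOver L f + g x) + sumOver L g)   ≈⟨ +-cong refl (+-assoc _ (g x) _) ⟩
      f x + (sumOver L f + (g x + sumOver L g))   ≈⟨ +-assoc (f x) _ _ ⟨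
      (f x + sumOver L f) + (g x + sumOver L g)   ∎

    sumOver-*ʳ : ∀ (L : List B) (f : B → Carrier) k → sumOver L f * k ≈ sumOver L (λ x → f x * k)
    sumOver-*ʳ []      f k = zeroˡ k
    sumOver-*ʳ (x ∷ L) f k = trans (distribʳ k (f x) _) (+-cong refl (sumOver-*ʳ L f k))

    sumOver-++ : ∀ (xs ys : List B) (f : B → Carrier) → sumOver (xs ++ ys) f ≈ sumOver xs f + sumOver ys f
    sumOver-++ []       ys f = sym (+-identityˡ _)
    sumOver-++ (x ∷ xs) ys f = trans (+-cong refl (sumOver-++ xs ys f)) (sym (+-assoc (f x) _ _))

  sumOver-swap : ∀ {B C : Set} (L : List B) (M : List C) (h : B → C → Carrier) →
    sumOver L (λ x → sumOver M (h x)) ≈ sumOver M (λ y → sumOver L (λ x → h x y))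
  sumOver-swap []      M h = sym (sumOver-zero M (λ _ → refl))
  sumOver-swap (x ∷ L) M h =
    trans (+-cong refl (sumOver-swap L M h)) (sym (sumOver-+ M (h x) (λ y → sumOver L (λ x → h x y))))

  sumOver-concatMap : ∀ {B C : Set} (g : B → List C) (L : List B) (f : C → Carrier) →
    sumOver (concatMap g L) f ≈ sumOver L (λ x → sumOver (g x) f)
  sumOver-concatMap g []      f = refl
  sumOver-concatMap g (x ∷ L) f = trans (sumOver-++ (g x) (concatMap g L) f) (+-cong refl (sumOver-concatMap g L f))

  sumOver-map : ∀ {B C : Set} (h : B → C) (L : List B) (f : C → Carrier) → sumOver (map h L) f ≡ sumOver L (λ x → f (h x))
  sumOver-map h []      f = ≡.refl
  sumOver-map h (x ∷ L) f = ≡.cong (f (h x) +_) (sumOver-map h L f)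

  sumOver-ascending-zero : ∀ a k (f : ℕ → Carrier) → (∀ x → a ≤ x → f x ≈ 0#) → sumOver (ascending a k) f ≈ 0#
  sumOver-ascending-zero a zero    f _   = refl
  sumOver-ascending-zero a (suc k) f f≈0 =
    trans (+-cong (f≈0 a ≤-refl) (sumOver-ascending-zero (suc a) k f (λ x a<x → f≈0 x (<⇒≤ a<x)))) (+-identityˡ 0#)

  sumOver-ascending-δ : ∀ a k t (f : ℕ → Carrier) → a ≤ t → t < a +ℕ k → (∀ x → x ≢ t → f x ≈ 0#) →
    sumOver (ascending a k) f ≈ f t
  sumOver-ascending-δ a zero    t f a≤t t<a+0 _ = contradiction a≤t (<⇒≱ (≡.subst (t <_) (ℕₚ.+-identityʳ a) t<a+0))
  sumOver-ascending-δ a (suc k) t f a≤t t<a+k f≈0 with m≤n⇒m<n∨m≡n a≤t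
  ... | inj₂ ≡.refl = trans
    (+-cong refl (sumOver-ascending-zero (suc a) k f (λ x a<x → f≈0 x (λ x≡a → <-irrefl (≡.sym x≡a) a<x))))
    (+-identityʳ _)
  ... | inj₁ a<t = trans
    (+-cong (f≈0 a (λ a≡t → <-irrefl a≡t a<t)) (sumOver-ascending-δ (suc a) k t f a<t (≡.subst (t <_) (ℕₚ.+-suc a k) t<a+k) f≈0))
    (+-identityˡ _)

  sumOver-vecsUpTo-δ : ∀ m k (t : Vec ℕ m) (f : Vec ℕ m → Carrier) →
    (∀ x → 1 ≤ x → x ≤ m → 1 ≤ at t x × at t x ≤ k) → (∀ v → v ≢ t → f v ≈ 0#) →
    sumOver (vecsUpTo m k) f ≈ f t
  sumOver-vecsUpTo-δ zero    k []       f _      _   = +-identityʳ _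
  sumOver-vecsUpTo-δ (suc m) k (t₀ ∷ t) f t∈ f≈0 = begin
    sumOver (concatMap (λ x → map (x ∷_) (vecsUpTo m k)) [1‥ k ]) f
      ≈⟨ sumOver-concatMap (λ x → map (x ∷_) (vecsUpTo m k)) [1‥ k ] f ⟩
    sumOver [1‥ k ] (λ x → sumOver (map (x ∷_) (vecsUpTo m k)) f)
      ≈⟨ sumOver-cong [1‥ k ] (λ x → ≡⇒≈ (sumOver-map (x ∷_) (vecsUpTo m k) f)) ⟩
    sumOver [1‥ k ] tail-sum
      ≡⟨ ≡.cong (λ l → sumOver l tail-sum) ([1‥n]≡ascending k) ⟩
    sumOver (ascending 1 k) tail-sum
      ≈⟨ sumOver-ascending-δ 1 k t₀ tail-sum (proj₁ (t∈ 1 ≤-refl (s≤s z≤n))) (s≤s (proj₂ (t∈ 1 ≤-refl (s≤s z≤n)))) tail-zero ⟩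
    tail-sum t₀
      ≈⟨ sumOver-vecsUpTo-δ m k t (λ w → f (t₀ ∷ w)) (λ { (suc x) _ x≤m → t∈ (suc (suc x)) (s≤s z≤n) (s≤s x≤m) })
                            (λ w w≢t → f≈0 (t₀ ∷ w) (w≢t ∘ ∷-injectiveʳ)) ⟩
    f (t₀ ∷ t) ∎
    where
    tail-sum : ℕ → Carrier
    tail-sum x = sumOver (vecsUpTo m k) (λ w → f (x ∷ w))
    tail-zero : ∀ x → x ≢ t₀ → tail-sum x ≈ 0#
    tail-zero x x≢t₀ = sumOver-zero (vecsUpTo m k) (λ w → f≈0 (x ∷ w) (x≢t₀ ∘ ∷-injectiveˡ))

  module _ {m : ℕ} {P : Vec ℕ m → Set} (P? : (v : Vec ℕ m) → Dec (P v)) where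

    private
      Sub = Σ (Vec ℕ m) (λ v → True (P? v))

      extend : (Sub → Carrier) → Vec ℕ m → Carrier
      extend f v with P? v
      ... | yes p = f (v , fromWitness p)
      ... | no _  = 0#

      sumOver-enumerate : ∀ (L : List (Vec ℕ m)) f → sumOver (enumerate P? L) f ≈ sumOver L (extend f)
      sumOver-enumerate []      f = refl
      sumOver-enumerate (v ∷ L) f with P? v
      ... | yes _ = +-cong refl (sumOver-enumerate L f)
      ... | no _  = trans (sumOver-enumerate L f) (sym (+-identityˡ _))

    Sub-≡ : ∀ (x y : Sub) → proj₁ x ≡ proj₁ y → x ≡ y
    Sub-≡ (v , a) (.v , b) ≡.refl = ≡.cong (v ,_) (T-irrelevant a b)

    private
      extend-at : ∀ f t (x : Sub) → proj₁ x ≡ t → extend f t ≈ f x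
      extend-at f t (t′ , t′∈P) t′≡t with P? t
      ... | yes _  = ≡⇒≈ (≡.cong f (Sub-≡ _ _ (≡.sym t′≡t)))
      ... | no ¬p = contradiction (≡.subst P t′≡t (toWitness t′∈P)) ¬p

    sumOver-enumerate-δ : ∀ k (t : Sub) f → (∀ x → 1 ≤ x → x ≤ m → 1 ≤ at (proj₁ t) x × at (proj₁ t) x ≤ k) →
      (∀ x → proj₁ x ≢ proj₁ t → f x ≈ 0#) → sumOver (enumerate P? (vecsUpTo m k)) f ≈ f t
    sumOver-enumerate-δ k (t , t∈P) f t∈ f≈0 =
      trans (sumOver-enumerate (vecsUpTo m k) f)
            (trans (sumOver-vecsUpTo-δ m k t (extend f) t∈ extend≈0) (extend-at f t (t , t∈P) ≡.refl))
      where
      extend≈0 : ∀ v → v ≢ t → extend f v ≈ 0#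
      extend≈0 v v≢t with P? v
      ... | yes _ = f≈0 _ v≢t
      ... | no _  = refl

module Conjugation {c ℓ} (R : CommutativeRing c ℓ) (τ : CommutativeRing.Carrier R) (n : ℕ) (2≤n : 2 ≤ n) where

  open import Data.Nat using (zero; suc; _∸_; z≤n; s≤s) renaming (_+_ to _+ℕ_; _*_ to _*ℕ_)
  import Data.Nat.Properties as ℕₚ
  open import Data.Bool using (Bool; if_then_else_)
  open import Data.Vec using (Vec)
  open import Data.Product using (_×_; _,_; proj₁; proj₂)
  open import Function using (_∘_)
  open import Relation.Nullary using (yes; no; contradiction)
  open import Relation.Nullary.Decidable using (⌊_⌋; fromWitness; toWitness)
  import Relation.Binary.PropositionalEquality as ≡
  open ≡ using (_≡_; _≢_)
  open Basics
  open Partitions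
  open Arches
  open KrewerasComplement
  open Rotation
  open RotationIsKreweras
  open KrewerasInverse
  open FirstGenerator
  open CommutativeRing R
  open Sums R
  open import Relation.Binary.Reasoning.Setoid setoid

  private
    1≤n : 1 ≤ n
    1≤n = ℕₚ.≤-trans (s≤s z≤n) 2≤n

    partOf : (b : NC n) → IsSetPartitionℕ (proj₁ b)
    partOf b = proj₁ (isNC⇒ℕ (proj₁ b) (proj₂ b))

    ncOf : (b : NC n) → IsNonCrossingℕ (proj₁ b)
    ncOf b = proj₂ (isNC⇒ℕ (proj₁ b) (proj₂ b))

    Ψ̂ : NC n → CD n
    Ψ̂ b = Ψraw (proj₁ b) , fromWitness {a? = isCD? (Ψraw (proj₁ b))} (ArchStructure.Ψraw-isCD (proj₁ b) (partOf b) (ncOf b))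

    ρ̂ : NC n → NC n
    ρ̂ b = ρRaw (proj₁ b) , ℕ⇒isNC (ρRaw (proj₁ b)) (proj₁ (ρRaw-isNC (proj₁ b))) (proj₂ (ρRaw-isNC (proj₁ b)))

    ρ̂⁻¹ : NC n → NC n
    ρ̂⁻¹ b = ρ⁻¹Raw (proj₁ b) , ℕ⇒isNC (ρ⁻¹Raw (proj₁ b)) (proj₁ (ρ⁻¹Raw-isNC (proj₁ b) (partOf b) (ncOf b)))
                                                       (proj₂ (ρ⁻¹Raw-isNC (proj₁ b) (partOf b) (ncOf b)))

    ρ̂-ρ̂⁻¹ : ∀ b → ρ̂ (ρ̂⁻¹ b) ≡ b
    ρ̂-ρ̂⁻¹ b = Sub-≡ isNC? (ρ̂ (ρ̂⁻¹ b)) b (ρRaw-ρ⁻¹Raw 1≤n (proj₁ b) (partOf b) (ncOf b))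

    -- monomial R c t C is definitionally when t (proj₁ C) c.
    when : ∀ {m} → Vec ℕ m → Vec ℕ m → Carrier → Carrier
    when t u k = if ⌊ t ≟ᵛ u ⌋ then k else 0#

    when-≢ : ∀ {m} (t u : Vec ℕ m) k → t ≢ u → when t u k ≈ 0#
    when-≢ t u k t≢u with t ≟ᵛ u
    ... | yes t≡u = contradiction t≡u t≢u
    ... | no _    = refl

    when-refl : ∀ {m} (t : Vec ℕ m) k → when t t k ≈ k
    when-refl t k with t ≟ᵛ t
    ... | yes _   = refl
    ... | no t≢t  = contradiction ≡.refl t≢t

    when-cong : ∀ {m m′} (t u : Vec ℕ m) (t′ u′ : Vec ℕ m′) k → (t ≡ u → t′ ≡ u′) → (t′ ≡ u′ → t ≡ u) →
      when t u k ≡ when t′ u′ k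
    when-cong t u t′ u′ k to from with t ≟ᵛ u | t′ ≟ᵛ u′
    ... | yes _   | yes _    = ≡.refl
    ... | no _    | no _     = ≡.refl
    ... | yes t≡u | no t′≢u′ = contradiction (to t≡u) t′≢u′
    ... | no t≢u  | yes t′≡u′ = contradiction (from t′≡u′) t≢u

    x*y*z≈x*z*y : ∀ x y z → (x * y) * z ≈ (x * z) * y
    x*y*z≈x*z*y x y z = trans (*-assoc x y z) (trans (*-cong refl (*-comm y z)) (sym (*-assoc x z y)))

    sumOver-NC-when : ∀ (b₀ : NC n) (h : NC n → Carrier) →
      sumOver (enumNC n) (λ b → h b * when (proj₁ b₀) (proj₁ b) 1#) ≈ h b₀
    sumOver-NC-when b₀ h = trans
      (sumOver-enumerate-δ isNC? n b₀ _ bounds λ b b≢b₀ → trans (*-cong refl (when-≢ _ _ 1# (b≢b₀ ∘ ≡.sym))) (zeroʳ _))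
      (trans (*-cong refl (when-refl (proj₁ b₀) 1#)) (*-identityʳ _))
      where
      bounds : ∀ x → 1 ≤ x → x ≤ n → 1 ≤ at (proj₁ b₀) x × at (proj₁ b₀) x ≤ n
      bounds x 1≤x x≤n = proj₁ (partOf b₀ x 1≤x x≤n) , ℕₚ.≤-trans (proj₁ (proj₂ (partOf b₀ x 1≤x x≤n))) x≤n

    sumOver-CD-when : ∀ (C₀ : CD n) (h : CD n → Carrier) →
      sumOver (enumCD n) (λ C → h C * when (proj₁ C₀) (proj₁ C) 1#) ≈ h C₀
    sumOver-CD-when C₀ h = trans
      (sumOver-enumerate-δ isCD? (2 *ℕ n) C₀ _ bounds λ C C≢C₀ → trans (*-cong refl (when-≢ _ _ 1# (C≢C₀ ∘ ≡.sym))) (zeroʳ _))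
      (trans (*-cong refl (when-refl (proj₁ C₀) 1#)) (*-identityʳ _))
      where
      bounds : ∀ x → 1 ≤ x → x ≤ 2 *ℕ n → 1 ≤ at (proj₁ C₀) x × at (proj₁ C₀) x ≤ 2 *ℕ n
      t = proj₁ C₀
      bounds x 1≤x x≤2n =
        let matched = All[1‥]⇒∀ {P = λ p → 1 ≤ at t p × at t p ≤ 2 *ℕ n × at t p ≢ p × at t (at t p) ≡ p}
                                (proj₁ (toWitness {a? = isCD? t} (proj₂ C₀))) x 1≤x x≤2n
        in proj₁ matched , proj₁ (proj₂ matched)

  Ψ⁻¹-linExt-Ψ : ∀ (g : CD n → Vect R (CD n)) (v : Vect R (NC n)) (π : NC n) →
    Ψ⁻¹ R τ n (linExt R (enumCD n) g (Ψ R τ n v)) π ≈ sumOver (enumNC n) (λ b → v b * g (Ψ̂ b) (Ψ̂ π))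
  Ψ⁻¹-linExt-Ψ g v π = begin
    sumOver (enumCD n) (λ C → W C * when (Ψraw (proj₁ π)) (proj₁ C) 1#)
      ≈⟨ sumOver-CD-when (Ψ̂ π) W ⟩
    sumOver (enumCD n) (λ C → sumOver (enumNC n) (λ b → v b * when (Ψraw (proj₁ b)) (proj₁ C) 1#) * g C (Ψ̂ π))
      ≈⟨ sumOver-cong (enumCD n) (λ C → sumOver-*ʳ (enumNC n) (λ b → v b * when (Ψraw (proj₁ b)) (proj₁ C) 1#) (g C (Ψ̂ π))) ⟩
    sumOver (enumCD n) (λ C → sumOver (enumNC n) (λ b → (v b * when (Ψraw (proj₁ b)) (proj₁ C) 1#) * g C (Ψ̂ π)))
      ≈⟨ sumOver-swap (enumCD n) (enumNC n) (λ C b → (v b * when (Ψraw (proj₁ b)) (proj₁ C) 1#) * g C (Ψ̂ π)) ⟩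
    sumOver (enumNC n) (λ b → sumOver (enumCD n) (λ C → (v b * when (Ψraw (proj₁ b)) (proj₁ C) 1#) * g C (Ψ̂ π)))
      ≈⟨ sumOver-cong (enumNC n) (λ b → trans
           (sumOver-cong (enumCD n) (λ C → x*y*z≈x*z*y (v b) (when (Ψraw (proj₁ b)) (proj₁ C) 1#) (g C (Ψ̂ π))))
           (sumOver-CD-when (Ψ̂ b) (λ C → v b * g C (Ψ̂ π)))) ⟩
    sumOver (enumNC n) (λ b → v b * g (Ψ̂ b) (Ψ̂ π)) ∎
    where
    W = linExt R (enumCD n) g (Ψ R τ n v)

  ρ≈Ψ⁻¹σΨ : ∀ (v : Vect R (NC n)) (π : NC n) → ρ R τ n v π ≈ Ψ⁻¹ R τ n (σ R τ n (Ψ R τ n v)) π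
  ρ≈Ψ⁻¹σΨ v π = sym (trans (Ψ⁻¹-linExt-Ψ (λ C → monomial R 1# (σRaw (proj₁ C))) v π)
    (sumOver-cong (enumNC n) λ b → *-cong refl (≡⇒≈ (when-cong _ _ _ _ 1#
      (λ σΨb≡Ψπ → Ψraw-injective (ρRaw (proj₁ b)) (proj₁ π) (proj₁ (ρRaw-isNC (proj₁ b))) (partOf π)
                    (≡.trans (≡.sym (σRaw-Ψraw (proj₁ b) (partOf b) (ncOf b))) σΨb≡Ψπ))
      (λ ρb≡π → ≡.trans (σRaw-Ψraw (proj₁ b) (partOf b) (ncOf b)) (≡.cong Ψraw ρb≡π))))))

  private
    eKernel : ℕ → CD n → CD n → Carrier
    eKernel i C = monomial R (if proj₁ (eRaw i (proj₁ C)) then τ else 1#) (proj₂ (eRaw i (proj₁ C)))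

    eKernelSum : ℕ → Vect R (NC n) → NC n → Carrier
    eKernelSum i v π = sumOver (enumNC n) (λ b → v b * eKernel i (Ψ̂ b) (Ψ̂ π))

    F₁≈eKernelSum : ∀ v π → F R τ n 1 v π ≈ eKernelSum 1 v π
    F₁≈eKernelSum v π = sumOver-cong (enumNC n) (λ b → *-cong refl (≡⇒≈ (f₁≡e₁ b)))
      where
      f₁≡e₁ : ∀ b → monomial R (if proj₁ (f₁Raw (proj₁ b)) then τ else 1#) (proj₂ (f₁Raw (proj₁ b))) π ≡ eKernel 1 (Ψ̂ b) (Ψ̂ π)
      f₁≡e₁ b = ≡.trans
        (when-cong (proj₂ f) (proj₁ π) (Ψraw (proj₂ f)) (Ψraw (proj₁ π)) (coeff f) (≡.cong Ψraw)
                   (Ψraw-injective (proj₂ f) (proj₁ π) (proj₁ (proj₂ intertwines)) (partOf π)))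
        (≡.cong (λ r → when (proj₂ r) (Ψraw (proj₁ π)) (coeff r)) (≡.sym (proj₁ intertwines)))
        where
        f = f₁Raw (proj₁ b)
        coeff : ∀ {m} → Bool × Vec ℕ m → Carrier
        coeff r = if proj₁ r then τ else 1#
        intertwines = Ψraw-f₁Raw (proj₁ b) (partOf b) (ncOf b) 2≤n

    ρ⁻¹-apply : ∀ v b → ρ⁻¹ R τ n v b ≈ v (ρ̂ b)
    ρ⁻¹-apply v b = sumOver-NC-when (ρ̂ b) v

    when-ρ⁻¹ : ∀ (b b′ : NC n) k → when (ρ⁻¹Raw (proj₁ b)) (proj₁ b′) k ≡ when (ρRaw (proj₁ b′)) (proj₁ b) k
    when-ρ⁻¹ b b′ k = when-cong _ _ _ _ k
      (λ ρ⁻¹b≡b′ → ≡.trans (≡.cong ρRaw (≡.sym ρ⁻¹b≡b′)) (ρRaw-ρ⁻¹Raw 1≤n (proj₁ b) (partOf b) (ncOf b)))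
      (λ ρb′≡b → ≡.trans (≡.cong ρ⁻¹Raw (≡.sym ρb′≡b)) (ρ⁻¹Raw-ρRaw 1≤n (proj₁ b′) (partOf b′) (ncOf b′)))

    sumOver-NC-reindex : ∀ (H : NC n → Carrier) → sumOver (enumNC n) H ≈ sumOver (enumNC n) (H ∘ ρ̂⁻¹)
    sumOver-NC-reindex H = sym (begin
      sumOver (enumNC n) (H ∘ ρ̂⁻¹)
        ≈⟨ sumOver-cong (enumNC n) (λ b → sym (sumOver-NC-when (ρ̂⁻¹ b) H)) ⟩
      sumOver (enumNC n) (λ b → sumOver (enumNC n) (λ b′ → H b′ * when (ρ⁻¹Raw (proj₁ b)) (proj₁ b′) 1#))
        ≈⟨ sumOver-swap (enumNC n) (enumNC n) (λ b b′ → H b′ * when (ρ⁻¹Raw (proj₁ b)) (proj₁ b′) 1#) ⟩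
      sumOver (enumNC n) (λ b′ → sumOver (enumNC n) (λ b → H b′ * when (ρ⁻¹Raw (proj₁ b)) (proj₁ b′) 1#))
        ≈⟨ sumOver-cong (enumNC n) (λ b′ → sumOver-cong (enumNC n) (λ b → *-cong refl (≡⇒≈ (when-ρ⁻¹ b b′ 1#)))) ⟩
      sumOver (enumNC n) (λ b′ → ρ⁻¹ R τ n (λ _ → H b′) b′)
        ≈⟨ sumOver-cong (enumNC n) (λ b′ → ρ⁻¹-apply (λ _ → H b′) b′) ⟩
      sumOver (enumNC n) H ∎)

    -- Ψ(π) = σ(Ψ(ρ⁻¹π)), and σ conjugates eᵢ into eᵢ₊₁.
    eKernel-shift : ∀ i → 1 ≤ i → i +ℕ 2 ≤ 2 *ℕ n → ∀ b π →
      eKernel i (Ψ̂ (ρ̂⁻¹ b)) (Ψ̂ (ρ̂⁻¹ π)) ≡ eKernel (suc i) (Ψ̂ b) (Ψ̂ π)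
    eKernel-shift i 1≤i i+2≤2n b π = ≡.sym (≡.trans
      (≡.cong (λ r → when (proj₂ r) (Ψraw (proj₁ π)) (coeff r)) shifted) (≡.trans
      (≡.cong (λ z → when (σRaw X) z (coeff (eRaw i M))) (rotated π))
      (when-cong _ _ _ _ _ (σRaw-injective X Y X∈ Y∈) (≡.cong σRaw))))
      where
      coeff : ∀ {m} → Bool × Vec ℕ m → Carrier
      coeff r = if proj₁ r then τ else 1#
      rotated : ∀ x → Ψraw (proj₁ x) ≡ σRaw (Ψraw (ρ⁻¹Raw (proj₁ x)))
      rotated x = ≡.trans (≡.cong Ψraw (≡.sym (ρRaw-ρ⁻¹Raw 1≤n (proj₁ x) (partOf x) (ncOf x))))
                          (≡.sym (σRaw-Ψraw (proj₁ (ρ̂⁻¹ x)) (partOf (ρ̂⁻¹ x)) (ncOf (ρ̂⁻¹ x))))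
      M = Ψraw (ρ⁻¹Raw (proj₁ b))
      M∈ = Ψraw-preservesRange (proj₁ (ρ̂⁻¹ b)) (partOf (ρ̂⁻¹ b)) (ncOf (ρ̂⁻¹ b))
      X = proj₂ (eRaw i M)
      Y = Ψraw (ρ⁻¹Raw (proj₁ π))
      X∈ = eRaw-preservesRange i M M∈ 1≤i (ℕₚ.≤-trans (ℕₚ.+-monoʳ-≤ i (s≤s (z≤n {1}))) i+2≤2n)
      Y∈ = Ψraw-preservesRange (proj₁ (ρ̂⁻¹ π)) (partOf (ρ̂⁻¹ π)) (ncOf (ρ̂⁻¹ π))
      shifted : eRaw (suc i) (Ψraw (proj₁ b)) ≡ (proj₁ (eRaw i M) , σRaw X)
      shifted = ≡.trans (≡.cong₂ eRaw (ℕₚ.+-comm 1 i) (rotated b)) (eRaw-σRaw i M M∈ 1≤i i+2≤2n)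

    F-step : ∀ i → 1 ≤ i → i +ℕ 2 ≤ 2 *ℕ n → (∀ w π → F R τ n i w π ≈ eKernelSum i w π) →
      ∀ v π → ρ R τ n (F R τ n i (ρ⁻¹ R τ n v)) π ≈ eKernelSum (suc i) v π
    F-step i 1≤i i+2≤2n F≈ v π = begin
      sumOver (enumNC n) (λ b → F R τ n i (ρ⁻¹ R τ n v) b * when (ρRaw (proj₁ b)) (proj₁ π) 1#)
        ≈⟨ sumOver-cong (enumNC n) (λ b → *-cong (trans (F≈ (ρ⁻¹ R τ n v) b)
             (sumOver-cong (enumNC n) (λ b′ → *-cong (ρ⁻¹-apply v b′) refl))) (≡⇒≈ (≡.sym (when-ρ⁻¹ π b 1#)))) ⟩
      sumOver (enumNC n) (λ b → G b * when (ρ⁻¹Raw (proj₁ π)) (proj₁ b) 1#)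
        ≈⟨ sumOver-NC-when (ρ̂⁻¹ π) G ⟩
      G (ρ̂⁻¹ π)
        ≈⟨ sumOver-NC-reindex (λ b′ → v (ρ̂ b′) * eKernel i (Ψ̂ b′) (Ψ̂ (ρ̂⁻¹ π))) ⟩
      sumOver (enumNC n) (λ b → v (ρ̂ (ρ̂⁻¹ b)) * eKernel i (Ψ̂ (ρ̂⁻¹ b)) (Ψ̂ (ρ̂⁻¹ π)))
        ≈⟨ sumOver-cong (enumNC n) (λ b → ≡⇒≈ (≡.cong₂ _*_ (≡.cong v (ρ̂-ρ̂⁻¹ b)) (eKernel-shift i 1≤i i+2≤2n b π))) ⟩
      eKernelSum (suc i) v π ∎
      where
      G : NC n → Carrier
      G b = sumOver (enumNC n) (λ b′ → v (ρ̂ b′) * eKernel i (Ψ̂ b′) (Ψ̂ b))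

    F≈eKernelSum : ∀ i → 1 ≤ i → i ≤ 2 *ℕ n ∸ 1 → ∀ v π → F R τ n i v π ≈ eKernelSum i v π
    F≈eKernelSum (suc zero)    _ _         = F₁≈eKernelSum
    F≈eKernelSum (suc (suc i)) _ i+2≤2n-1 =
      F-step (suc i) (s≤s z≤n) (i+3≤2n n i+2≤2n-1) (F≈eKernelSum (suc i) (s≤s z≤n) (ℕₚ.≤-trans (ℕₚ.n≤1+n _) i+2≤2n-1))
      where
      i+3≤2n : ∀ n → suc (suc i) ≤ 2 *ℕ n ∸ 1 → suc i +ℕ 2 ≤ 2 *ℕ n
      i+3≤2n (suc n) le = ℕₚ.≤-trans (ℕₚ.≤-reflexive (ℕₚ.+-comm (suc i) 2)) (s≤s le)

  F≈Ψ⁻¹eΨ : ∀ i → 1 ≤ i → i ≤ 2 *ℕ n ∸ 1 → ∀ v π → F R τ n i v π ≈ Ψ⁻¹ R τ n (e R τ n i (Ψ R τ n v)) π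
  F≈Ψ⁻¹eΨ i 1≤i i≤2n-1 v π = trans (F≈eKernelSum i 1≤i i≤2n-1 v π) (sym (Ψ⁻¹-linExt-Ψ (eKernel i) v π))

mainTheorem4 : ∀ {c ℓ : Level} (R : CommutativeRing c ℓ) →
    let open CommutativeRing R in
    (q q⁻¹ : Carrier) → q * q⁻¹ ≈ 1# →
    let τ = - (q + q⁻¹) in
    (n : ℕ) → 2 ≤ n →
      ((i : ℕ) → 1 ≤ i → i ≤ 2 Nat.* n ∸ 1 →
        (v : Vect R (NC n)) (π : NC n) →
          F R τ n i v π ≈ Ψ⁻¹ R τ n (e R τ n i (Ψ R τ n v)) π)
      ×
      ((v : Vect R (NC n)) (π : NC n) →
          ρ R τ n v π ≈ Ψ⁻¹ R τ n (σ R τ n (Ψ R τ n v)) π)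
-- The identities hold for every τ.
mainTheorem4 R q q⁻¹ _ n 2≤n = F≈Ψ⁻¹eΨ , ρ≈Ψ⁻¹σΨ
  where open Conjugation R (CommutativeRing.-_ R (CommutativeRing._+_ R q q⁻¹)) n 2≤n
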